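{- For every integer $n\ge 0$, $|\mathcal{S}_n(1\text{ - }32,\,21\text{ - }3)| = |\mathcal{S}_n(3\text{ - }12,\,23\text{ - }1)| = a_n$, where $a_n$ is the number of strongly monotone partitions of $[n]$, and $\sum_{n\ge 0} a_n x^n = \dfrac{1}{1-x-x^2\sum_{n\ge 0}B^*_n x^n}$.
   Context: A permutation of $[n]=\{1,\dots,n\}$ is written as a word $\pi=a_1a_2\cdots a_n$. For a permutation $xyz$ of $\{1,2,3\}$: $\pi$ contains the pattern $x\text{ - }yz$ if there are indices $1\le i<j<n$ such that $a_i,a_j,a_{j+1}$ are in the same relative order as $x,y,z$; $\pi$ contains the pattern $xy\text{ - }z$ if there are indices $i$ and $k$ with $i+1<k\le n$ such that $a_i,a_{i+1},a_k$ are in the same relative order as $x,y,z$. $\pi$ avoids a pattern if it does not contain it. $\mathcal{S}_n(p,q)$ is the set of permutations of $[n]$ avoiding both $p$ and $q$. A set partition of $[n]$ with blocks $A_1,\dots,A_k$ indexed so that $\min A_i>\min A_{i+1}$ for all $i\in[k-1]$ is strongly monotone if also $\max A_i>\max A_{i+1}$ for all $i\in[k-1]$. The Bessel number $B^*_n$ is the number of non-overlapping partitions of $[n]$, i.e. partitions having no two blocks $A,B$ with $\min A<\min B<\max A<\max B$ (so $B^*_0=1$). -}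

module Defs where

open import Data.Nat using (ℕ; zero; suc; _<ᵇ_; _≡ᵇ_; _≤ᵇ_; _⊔_)
open import Data.Bool using (Bool; true; false; _∧_; _∨_; not; if_then_else_)
open import Data.List using (List; []; _∷_; length; map; concatMap; upTo; foldr)
open import Data.Product using (_×_; _,_)
open import Data.Integer as ℤ using (ℤ; +_)

count : {A : Set} → (A → Bool) → List A → ℕ
count p []       = 0
count p (x ∷ xs) = if p x then suc (count p xs) else count p xs

allᵇ : {A : Set} → (A → Bool) → List A → Bool
allᵇ p = foldr (λ x r → p x ∧ r) true

anyᵇ : {A : Set} → (A → Bool) → List A → Bool
anyᵇ p = foldr (λ x r → p x ∨ r) false

range : ℕ → List ℕ
range n = map suc (upTo n)

words : ℕ → ℕ → List (List ℕ)
words n zero    = [] ∷ []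
words n (suc k) = concatMap (λ a → map (a ∷_) (words n k)) (range n)

-- 1-indexed lookup (returns 0 outside the word)
at : List ℕ → ℕ → ℕ
at []       _             = 0
at (x ∷ xs) zero          = 0
at (x ∷ xs) (suc zero)    = x
at (x ∷ xs) (suc (suc i)) = at xs (suc i)

elem : ℕ → List ℕ → Bool
elem v w = anyᵇ (λ u → u ≡ᵇ v) w

isPerm : ℕ → List ℕ → Bool
isPerm n w = allᵇ (λ v → elem v w) (range n)

perms : ℕ → List (List ℕ)
perms n = Data.List.filterᵇ (isPerm n) (words n n)
  where import Data.List

Triple : Set
Triple = ℕ × ℕ × ℕ

iff : Bool → Bool → Bool
iff p q = (p ∧ q) ∨ (not p ∧ not q)

sameOrder : Triple → ℕ → ℕ → ℕ → Bool
sameOrder (x , y , z) a b c =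
  iff (a <ᵇ b) (x <ᵇ y) ∧ iff (a <ᵇ c) (x <ᵇ z) ∧ iff (b <ᵇ c) (y <ᵇ z)
  ∧ iff (b <ᵇ a) (y <ᵇ x) ∧ iff (c <ᵇ a) (z <ᵇ x) ∧ iff (c <ᵇ b) (z <ᵇ y)

adjPairs : List ℕ → List (ℕ × ℕ)
adjPairs []           = []
adjPairs (a ∷ [])     = []
adjPairs (a ∷ b ∷ w)  = (a , b) ∷ adjPairs (b ∷ w)

containsX-YZ : Triple → List ℕ → Bool
containsX-YZ p []      = false
containsX-YZ p (a ∷ w) =
  anyᵇ (λ { (b , c) → sameOrder p a b c }) (adjPairs w) ∨ containsX-YZ p w

containsXY-Z : Triple → List ℕ → Bool
containsXY-Z p []          = false
containsXY-Z p (a ∷ [])    = false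
containsXY-Z p (a ∷ b ∷ w) =
  anyᵇ (λ c → sameOrder p a b c) w ∨ containsXY-Z p (b ∷ w)

p1-32 p21-3 p3-12 p23-1 : Triple
p1-32 = 1 , 3 , 2
p21-3 = 2 , 1 , 3
p3-12 = 3 , 1 , 2
p23-1 = 2 , 3 , 1

countS₁ : ℕ → ℕ
countS₁ n = count (λ w → not (containsX-YZ p1-32 w) ∧ not (containsXY-Z p21-3 w)) (perms n)

countS₂ : ℕ → ℕ
countS₂ n = count (λ w → not (containsX-YZ p3-12 w) ∧ not (containsXY-Z p23-1 w)) (perms n)

-- A partition of [n] is encoded (bijectively) by the word f₁⋯fₙ where fᵢ is
-- the minimum of the block containing i.  Such words are exactly those with
-- fᵢ ≤ i and f_{fᵢ} = fᵢ; the blocks are the fibres of f and the block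
-- minima are the fixed points of f.

isPartitionWord : ℕ → List ℕ → Bool
isPartitionWord n f = allᵇ (λ i → (at f i ≤ᵇ i) ∧ (at f (at f i) ≡ᵇ at f i)) (range n)

partitions : ℕ → List (List ℕ)
partitions n = Data.List.filterᵇ (isPartitionWord n) (words n n)
  where import Data.List

isMin : List ℕ → ℕ → Bool
isMin f m = at f m ≡ᵇ m

blockMax : ℕ → List ℕ → ℕ → ℕ
blockMax n f m = foldr (λ i r → if at f i ≡ᵇ m then i ⊔ r else r) 0 (range n)

-- strongly monotone: indexing blocks by decreasing minima, the maxima also
-- decrease; i.e. for blocks A, B: min A < min B implies max A < max B.
stronglyMonotone : ℕ → List ℕ → Bool
stronglyMonotone n f =
  allᵇ (λ m → allᵇ (λ m' →
     not (isMin f m ∧ isMin f m' ∧ (m <ᵇ m')) ∨ (blockMax n f m <ᵇ blockMax n f m'))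
     (range n)) (range n)

nonOverlapping : ℕ → List ℕ → Bool
nonOverlapping n f =
  allᵇ (λ m → allᵇ (λ m' →
     not (isMin f m ∧ isMin f m' ∧ (m <ᵇ m') ∧ (m' <ᵇ blockMax n f m)
          ∧ (blockMax n f m <ᵇ blockMax n f m')))
     (range n)) (range n)

a : ℕ → ℕ
a n = count (stronglyMonotone n) (partitions n)

B* : ℕ → ℕ
B* n = count (nonOverlapping n) (partitions n)

Series : Set
Series = ℕ → ℤ

ofℕ : (ℕ → ℕ) → Series
ofℕ c n = + (c n)

𝟙 : Series
𝟙 zero    = + 1
𝟙 (suc n) = + 0

𝕩 : Series
𝕩 (suc zero) = + 1
𝕩 _          = + 0

_⊖_ : Series → Series → Series
(f ⊖ g) n = f n ℤ.- g n

_⊛_ : Series → Series → Series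
(f ⊛ g) n = foldr ℤ._+_ (+ 0) (map (λ i → f i ℤ.* g (n Data.Nat.∸ i)) (upTo (suc n)))
  where import Data.Nat

infixl 7 _⊛_
infixl 6 _⊖_

module Submission where

-- Reading a partition of [n] from left to right, call a block open once its minimum has been
-- read and its maximum has not.  In a strongly monotone partition the open blocks close first-in
-- first-out, in a non-overlapping one last-in first-out.  Hence aₙ and B*ₙ count weighted
-- Motzkin paths whose height is the number of open blocks: an element opens a block (up), joins
-- one of the h open blocks (level, weight h), closes the oldest resp. newest open block (down), or
-- is a singleton block (level, allowed at height 0 for the queue and always for the stack).
-- Cutting a queue path at its first return to height 0 gives aₙ₊₂ = aₙ₊₁ + Σᵢ aᵢ B*ₙ₋ᵢ, which is
-- the generating function identity.
--
-- Listing the blocks of a strongly monotone partition by decreasing minima, each block increasing,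
-- gives a permutation avoiding 1-32 and 21-3 whose ascending runs are exactly the blocks;
-- conversely the ascending runs of such a permutation have decreasing first and decreasing last
-- letters.  The complement i ↦ n + 1 - i exchanges these permutations with those avoiding 3-12 and
-- 23-1.

open import Defs
open import Data.Nat using (ℕ; zero; suc; _+_; _*_; _∸_; _≤_; _<_; z≤n; s≤s; _<ᵇ_; _≡ᵇ_; _≤ᵇ_; _⊔_)
open import Data.Nat.Properties
open import Data.Bool using (Bool; true; false; _∧_; _∨_; not; if_then_else_; T)
open import Data.Bool.Properties using (∧-zeroʳ)
open import Data.List using (List; []; _∷_; length; map; concatMap; upTo; foldr; _++_; [_]; filterᵇ; concat; drop)
open import Data.List.Properties using (drop-all; upTo-∷ʳ; map-++; foldr-++; map-applyUpTo; length-++; length-map; map-∘)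
open import Data.List.Relation.Unary.All using (All; []; _∷_)
import Data.List.Relation.Unary.All as AllM
open import Data.List.Relation.Unary.All.Properties using (++⁺)
open import Data.Product using (_×_; _,_; proj₁; proj₂; Σ; uncurry)
open import Data.Sum using (_⊎_; inj₁; inj₂)
open import Data.Unit using (⊤; tt)
open import Data.Empty using (⊥; ⊥-elim)
open import Function using (_∘_; id)
open import Algebra.Properties.CommutativeSemigroup +-commutativeSemigroup using () renaming (interchange to +-interchange)
open import Relation.Binary using (tri<; tri≈; tri>)
open import Relation.Binary.PropositionalEquality using (_≡_; _≢_; refl; sym; trans; cong; cong₂; subst; subst₂; module ≡-Reasoning)
open import Data.Nat.Tactic.RingSolver using (solve-∀)
open import Data.Integer as ℤ using (ℤ; 0ℤ)
import Data.Integer.Properties as ℤP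

≡true⇒T : ∀ {b} → b ≡ true → T b
≡true⇒T refl = _

T⇒≡true : ∀ {b} → T b → b ≡ true
T⇒≡true {true} _ = refl

true-false-⊥ : ∀ {x} → x ≡ true → x ≡ false → ⊥
true-false-⊥ refl ()

¬true⇒false : ∀ {b} → b ≢ true → b ≡ false
¬true⇒false {true} h = ⊥-elim (h refl)
¬true⇒false {false} h = refl

bool-ext : ∀ {x y} → (x ≡ true → y ≡ true) → (y ≡ true → x ≡ true) → x ≡ y
bool-ext {true} {true} h g = refl
bool-ext {true} {false} h g = sym (h refl)
bool-ext {false} {true} h g = g refl
bool-ext {false} {false} h g = refl

≡ᵇ-true⇒≡ : ∀ m n → (m ≡ᵇ n) ≡ true → m ≡ n
≡ᵇ-true⇒≡ m n e = ≡ᵇ⇒≡ m n (≡true⇒T e)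

≡ᵇ-refl : ∀ n → (n ≡ᵇ n) ≡ true
≡ᵇ-refl n = T⇒≡true (≡⇒≡ᵇ n n refl)

≡ᵇ-false⇒≢ : ∀ m n → (m ≡ᵇ n) ≡ false → m ≢ n
≡ᵇ-false⇒≢ m .m e refl = true-false-⊥ (≡ᵇ-refl m) e

≢⇒≡ᵇ-false : ∀ m n → m ≢ n → (m ≡ᵇ n) ≡ false
≢⇒≡ᵇ-false m n m≢n = ¬true⇒false (λ e → m≢n (≡ᵇ-true⇒≡ m n e))

≡ᵇ-sym : ∀ m n → (m ≡ᵇ n) ≡ (n ≡ᵇ m)
≡ᵇ-sym m n = bool-ext (λ e → subst (λ k → (k ≡ᵇ m) ≡ true) (≡ᵇ-true⇒≡ m n e) (≡ᵇ-refl m))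
                      (λ e → subst (λ k → (k ≡ᵇ n) ≡ true) (≡ᵇ-true⇒≡ n m e) (≡ᵇ-refl n))

<ᵇ-true⇒< : ∀ m n → (m <ᵇ n) ≡ true → m < n
<ᵇ-true⇒< m n e = <ᵇ⇒< m n (≡true⇒T e)

<⇒<ᵇ-true : ∀ m n → m < n → (m <ᵇ n) ≡ true
<⇒<ᵇ-true m n m<n = T⇒≡true (<⇒<ᵇ m<n)

<ᵇ-false⇒≥ : ∀ m n → (m <ᵇ n) ≡ false → n ≤ m
<ᵇ-false⇒≥ m n e = ≮⇒≥ (λ m<n → true-false-⊥ (<⇒<ᵇ-true m n m<n) e)

≥⇒<ᵇ-false : ∀ m n → n ≤ m → (m <ᵇ n) ≡ false
≥⇒<ᵇ-false m n n≤m = ¬true⇒false (λ e → <⇒≱ (<ᵇ-true⇒< m n e) n≤m)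

≤ᵇ-true⇒≤ : ∀ m n → (m ≤ᵇ n) ≡ true → m ≤ n
≤ᵇ-true⇒≤ m n e = ≤ᵇ⇒≤ m n (≡true⇒T e)

≤⇒≤ᵇ-true : ∀ m n → m ≤ n → (m ≤ᵇ n) ≡ true
≤⇒≤ᵇ-true m n m≤n = T⇒≡true (≤⇒≤ᵇ m≤n)

∧-true⁺ : ∀ {x y} → x ≡ true → y ≡ true → (x ∧ y) ≡ true
∧-true⁺ refl refl = refl

∧-true⁻ˡ : ∀ x {y} → (x ∧ y) ≡ true → x ≡ true
∧-true⁻ˡ true e = refl

∧-true⁻ʳ : ∀ x {y} → (x ∧ y) ≡ true → y ≡ true
∧-true⁻ʳ true e = e

∨-false⁻ : ∀ x y → (x ∨ y) ≡ false → (x ≡ false) × (y ≡ false)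
∨-false⁻ false y e = refl , e

∨-true⁺ˡ : ∀ x y → x ≡ true → (x ∨ y) ≡ true
∨-true⁺ˡ true y e = refl

∨-true⁺ʳ : ∀ x y → y ≡ true → (x ∨ y) ≡ true
∨-true⁺ʳ true y e = refl
∨-true⁺ʳ false y e = e

not∨-true⁺ : ∀ x y → (x ≡ true → y ≡ true) → (not x ∨ y) ≡ true
not∨-true⁺ true y h = h refl
not∨-true⁺ false y h = refl

not∨-true⁻ : ∀ x y → (not x ∨ y) ≡ true → x ≡ true → y ≡ true
not∨-true⁻ true y e refl = e

not-true⁺ : ∀ x → (x ≡ true → ⊥) → not x ≡ true
not-true⁺ true h = ⊥-elim (h refl)
not-true⁺ false h = refl

not-true⁻ : ∀ x → not x ≡ true → x ≡ true → ⊥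
not-true⁻ true () refl

not-true⇒false : ∀ b → not b ≡ true → b ≡ false
not-true⇒false false _ = refl

false⇒not-true : ∀ b → b ≡ false → not b ≡ true
false⇒not-true false _ = refl

∧-true⁻ : ∀ x {y} → (x ∧ y) ≡ true → (x ≡ true) × (y ≡ true)
∧-true⁻ true e = refl , e

iff-true⇒≡ : ∀ p q → iff p q ≡ true → p ≡ q
iff-true⇒≡ true true _ = refl
iff-true⇒≡ false false _ = refl

ind : Bool → ℕ
ind true = 1
ind false = 0

ind-* : ∀ c X → ind c * X ≡ (if c then X else 0)
ind-* true X = +-identityʳ X
ind-* false X = refl

ind-∧ : ∀ x y → ind (x ∧ y) ≡ ind x * ind y
ind-∧ true y = sym (+-identityʳ (ind y))
ind-∧ false y = refl

ind-if : ∀ c → ind c ≡ (if c then 1 else 0)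
ind-if true = refl
ind-if false = refl

sumBelow : (ℕ → ℕ) → ℕ → ℕ
sumBelow g zero = 0
sumBelow g (suc n) = sumBelow g n + g n

sumBelow-suc : ∀ g n → sumBelow g (suc n) ≡ g 0 + sumBelow (g ∘ suc) n
sumBelow-suc g zero = +-comm 0 (g 0)
sumBelow-suc g (suc n) rewrite sumBelow-suc g n = +-assoc (g 0) (sumBelow (g ∘ suc) n) (g (suc n))

sumBelow-cong : ∀ {g h} n → (∀ i → i < n → g i ≡ h i) → sumBelow g n ≡ sumBelow h n
sumBelow-cong zero e = refl
sumBelow-cong (suc n) e = cong₂ _+_ (sumBelow-cong n (λ i p → e i (m<n⇒m<1+n p))) (e n ≤-refl)

sumBelow-reverse : ∀ g n → sumBelow g n ≡ sumBelow (λ i → g (n ∸ suc i)) n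
sumBelow-reverse g zero = refl
sumBelow-reverse g (suc n) = trans (sumBelow-suc g n) (trans (+-comm (g 0) _) (cong₂ _+_
  (trans (sumBelow-reverse (g ∘ suc) n) (sumBelow-cong n (λ i p → cong g (sym (+-∸-assoc 1 p)))))
    (cong g (sym (n∸n≡0 n)))))

sumBelow-+ : ∀ g h n → sumBelow (λ i → g i + h i) n ≡ sumBelow g n + sumBelow h n
sumBelow-+ g h zero = refl
sumBelow-+ g h (suc n) rewrite sumBelow-+ g h n = +-interchange (sumBelow g n) (sumBelow h n)
  (g n) (h n)

sumBelow-* : ∀ c g n → sumBelow (λ i → c * g i) n ≡ c * sumBelow g n
sumBelow-* c g zero = sym (*-zeroʳ c)
sumBelow-* c g (suc n) rewrite sumBelow-* c g n = sym (*-distribˡ-+ c (sumBelow g n) (g n))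

sumBelow-zero : ∀ n → sumBelow (λ _ → 0) n ≡ 0
sumBelow-zero zero = refl
sumBelow-zero (suc n) = cong (_+ 0) (sumBelow-zero n)

sumTo : (ℕ → ℕ) → ℕ → ℕ
sumTo g n = sumBelow (g ∘ suc) n

sumTo-cong : ∀ {g h} n → (∀ x → 1 ≤ x → x ≤ n → g x ≡ h x) → sumTo g n ≡ sumTo h n
sumTo-cong n e = sumBelow-cong n (λ i i<n → e (suc i) (s≤s z≤n) i<n)

sumTo-+ : ∀ g h n → sumTo (λ x → g x + h x) n ≡ sumTo g n + sumTo h n
sumTo-+ g h = sumBelow-+ (g ∘ suc) (h ∘ suc)

sumTo-zero : ∀ n → sumTo (λ _ → 0) n ≡ 0
sumTo-zero = sumBelow-zero

sumTo-one : ∀ n → sumTo (λ _ → 1) n ≡ n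
sumTo-one zero = refl
sumTo-one (suc n) = trans (cong (_+ 1) (sumTo-one n)) (+-comm n 1)

sumTo-indicator-out : (t X m : ℕ) → m < t → sumTo (λ a → if a ≡ᵇ t then X else 0) m ≡ 0
sumTo-indicator-out t X zero p = refl
sumTo-indicator-out t X (suc m) p rewrite ≢⇒≡ᵇ-false (suc m) t
  (λ e → <-irrefl e p) | sumTo-indicator-out t X m (<-trans (n<1+n m) p) = refl

sumTo-indicator : (t X n : ℕ) → 1 ≤ t → t ≤ n → sumTo (λ a → if a ≡ᵇ t then X else 0) n ≡ X
sumTo-indicator .zero X zero () z≤n
sumTo-indicator t X (suc n) p q with m≤n⇒m<n∨m≡n q
... | inj₁ lt rewrite ≢⇒≡ᵇ-false (suc n) t (λ e → <-irrefl (sym e) lt) = trans (+-identityʳ _)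
  (sumTo-indicator t X n p (≤-pred lt))
... | inj₂ refl rewrite ≡ᵇ-refl (suc n) | sumTo-indicator-out (suc n) X n ≤-refl = refl

sumTo-positive : ∀ (c : ℕ → ℕ) n → (∀ v → 1 ≤ v → v ≤ n → 1 ≤ c v) → n ≤ sumTo c n
sumTo-positive c zero h = z≤n
sumTo-positive c (suc n) h = ≤-trans (≤-reflexive (+-comm 1 n))
  (+-mono-≤ (sumTo-positive c n (λ v p q → h v p (m≤n⇒m≤1+n q))) (h (suc n) (s≤s z≤n) ≤-refl))

sumTo-positive-one : ∀ (c : ℕ → ℕ) n → (∀ v → 1 ≤ v → v ≤ n → 1 ≤ c v) → ∀ v → 1 ≤ v → v ≤ n →
  n ∸ 1 + c v ≤ sumTo c n
sumTo-positive-one c zero h v p q = ⊥-elim (<-irrefl refl (≤-trans p q))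
sumTo-positive-one c (suc n) h v p q with m≤n⇒m<n∨m≡n q
... | inj₂ refl = +-monoˡ-≤ (c (suc n)) (sumTo-positive c n (λ v p q → h v p (m≤n⇒m≤1+n q)))
... | inj₁ lt = ≤-trans step
  (+-mono-≤ (sumTo-positive-one c n (λ v p q → h v p (m≤n⇒m≤1+n q)) v p (≤-pred lt))
  (h (suc n) (s≤s z≤n) ≤-refl))
  where
  n1 : 1 ≤ n
  n1 = ≤-trans p (≤-pred lt)
  step : n + c v ≤ n ∸ 1 + c v + 1
  step = ≤-reflexive (trans (cong (_+ c v) (sym (trans (+-comm (n ∸ 1) 1) (m+[n∸m]≡n n1))))
    (trans (+-assoc (n ∸ 1) 1 (c v))
    (trans (cong (n ∸ 1 +_) (+-comm 1 (c v))) (sym (+-assoc (n ∸ 1) (c v) 1)))))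

conv : (ℕ → ℕ) → (ℕ → ℕ) → ℕ → ℕ
conv u v n = sumBelow (λ i → u i * v (n ∸ i)) (suc n)

conv-suc : ∀ u v n → conv u v (suc n) ≡ u 0 * v (suc n) + conv (u ∘ suc) v n
conv-suc u v n = sumBelow-suc (λ i → u i * v (suc n ∸ i)) (suc n)

conv-comm : ∀ u v n → conv u v n ≡ conv v u n
conv-comm u v n = trans (sumBelow-reverse _ (suc n))
  (sumBelow-cong (suc n)
  (λ i p → trans (*-comm (u (n ∸ i)) _) (cong (λ z → v z * u (n ∸ i)) (m∸[m∸n]≡n (≤-pred p)))))

conv-+ : ∀ x y v n → conv (λ k → x k + y k) v n ≡ conv x v n + conv y v n
conv-+ x y v n = trans (sumBelow-cong (suc n) (λ i _ → *-distribʳ-+ (v (n ∸ i)) (x i) (y i)))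
  (sumBelow-+ _ _ (suc n))

conv-* : ∀ c x v n → conv (λ k → c * x k) v n ≡ c * conv x v n
conv-* c x v n = trans (sumBelow-cong (suc n) (λ i _ → *-assoc c (x i) (v (n ∸ i))))
  (sumBelow-* c _ (suc n))

conv-zero : ∀ v n → conv (λ _ → 0) v n ≡ 0
conv-zero v n = sumBelow-zero (suc n)

sumMap : {A : Set} → (A → ℕ) → List A → ℕ
sumMap g [] = 0
sumMap g (x ∷ xs) = g x + sumMap g xs

sumMap-++ : {A : Set} (g : A → ℕ) (xs ys : List A) → sumMap g (xs ++ ys) ≡ sumMap g xs + sumMap g ys
sumMap-++ g [] ys = refl
sumMap-++ g (x ∷ xs) ys = trans (cong (g x +_) (sumMap-++ g xs ys)) (sym (+-assoc (g x) _ _))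

sumMap-map : {A B : Set} (g : B → ℕ) (h : A → B) (xs : List A) → sumMap g (map h xs)
  ≡ sumMap (g ∘ h) xs
sumMap-map g h [] = refl
sumMap-map g h (x ∷ xs) = cong (g (h x) +_) (sumMap-map g h xs)

sumMap-concatMap : {A B : Set} (g : B → ℕ) (h : A → List B) (xs : List A) →
  sumMap g (concatMap h xs) ≡ sumMap (λ x → sumMap g (h x)) xs
sumMap-concatMap g h [] = refl
sumMap-concatMap g h (x ∷ xs) = trans (sumMap-++ g (h x) (concat (map h xs)))
  (cong (sumMap g (h x) +_) (sumMap-concatMap g h xs))

sumMap-cong : {A : Set} {g h : A → ℕ} → (∀ x → g x ≡ h x) → (xs : List A) → sumMap g xs
  ≡ sumMap h xs
sumMap-cong e [] = refl
sumMap-cong e (x ∷ xs) = cong₂ _+_ (e x) (sumMap-cong e xs)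

sumMap-+ : {A : Set} (g h : A → ℕ) (xs : List A) → sumMap (λ x → g x + h x) xs
  ≡ sumMap g xs + sumMap h xs
sumMap-+ g h [] = refl
sumMap-+ g h (x ∷ xs) rewrite sumMap-+ g h xs = +-interchange (g x) (h x) (sumMap g xs)
  (sumMap h xs)

sumMap-* : {A : Set} (c : ℕ) (g : A → ℕ) (xs : List A) → sumMap (λ x → c * g x) xs ≡ c * sumMap g xs
sumMap-* c g [] = sym (*-zeroʳ c)
sumMap-* c g (x ∷ xs) rewrite sumMap-* c g xs = sym (*-distribˡ-+ c (g x) (sumMap g xs))

sumMap-zero : {A : Set} (xs : List A) → sumMap (λ _ → 0) xs ≡ 0
sumMap-zero [] = refl
sumMap-zero (x ∷ xs) = sumMap-zero xs

sumMap-swap : {A B : Set} (g : A → B → ℕ) (xs : List A) (ys : List B) →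
  sumMap (λ x → sumMap (g x) ys) xs ≡ sumMap (λ y → sumMap (λ x → g x y) xs) ys
sumMap-swap g [] ys = sym (sumMap-zero ys)
sumMap-swap g (x ∷ xs) ys = trans (cong (sumMap (g x) ys +_) (sumMap-swap g xs ys))
  (sym (sumMap-+ (g x) (λ y → sumMap (λ x → g x y) xs) ys))

range-suc : ∀ n → range (suc n) ≡ range n ++ [ suc n ]
range-suc n = trans (cong (map suc) (sym (upTo-∷ʳ n))) (map-++ suc (upTo n) [ n ])

sumMap-range : (g : ℕ → ℕ) (n : ℕ) → sumMap g (range n) ≡ sumTo g n
sumMap-range g zero = refl
sumMap-range g (suc n) = trans (cong (sumMap g) (range-suc n))
  (trans (sumMap-++ g (range n) [ suc n ]) (cong₂ _+_ (sumMap-range g n) (+-identityʳ (g (suc n)))))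

sumMap-words : {n : ℕ} (k : ℕ) (g : List ℕ → ℕ) →
  sumMap g (words n (suc k)) ≡ sumTo (λ a → sumMap (λ w → g (a ∷ w)) (words n k)) n
sumMap-words {n} k g = trans (sumMap-concatMap g (λ a → map (a ∷_) (words n k)) (range n))
  (trans (sumMap-cong (λ a → sumMap-map g (a ∷_) (words n k)) (range n)) (sumMap-range _ n))

InRange : ℕ → ℕ → Set
InRange n a = (1 ≤ a) × (a ≤ n)

IsWord : ℕ → ℕ → List ℕ → Set
IsWord n k w = (length w ≡ k) × All (InRange n) w

sumMap-words-cong : ∀ n k (g h : List ℕ → ℕ) → (∀ w → IsWord n k w → g w ≡ h w) →
  sumMap g (words n k) ≡ sumMap h (words n k)
sumMap-words-cong n zero g h e = cong (_+ 0) (e [] (refl , []))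
sumMap-words-cong n (suc k) g h e = trans (sumMap-words {n} k g)
  (trans (sumTo-cong n
  (λ a p q → sumMap-words-cong n k (λ w → g (a ∷ w)) (λ w → h (a ∷ w))
  (λ w (l , r) → e (a ∷ w) (cong suc l , ((p , q) ∷ r))))) (sym (sumMap-words {n} k h)))

count-filterᵇ : ∀ {A : Set} (q p : A → Bool) xs →
                count p (filterᵇ q xs) ≡ sumMap (λ x → ind (q x ∧ p x)) xs
count-filterᵇ q p [] = refl
count-filterᵇ q p (x ∷ xs) with q x
... | false = count-filterᵇ q p xs
... | true with p x
...   | true = cong suc (count-filterᵇ q p xs)
...   | false = count-filterᵇ q p xs

eqListᵇ : List ℕ → List ℕ → Bool
eqListᵇ [] [] = true
eqListᵇ [] (_ ∷ _) = false
eqListᵇ (_ ∷ _) [] = false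
eqListᵇ (x ∷ xs) (y ∷ ys) = (x ≡ᵇ y) ∧ eqListᵇ xs ys

eqListᵇ-true⇒≡ : ∀ xs ys → eqListᵇ xs ys ≡ true → xs ≡ ys
eqListᵇ-true⇒≡ [] [] _ = refl
eqListᵇ-true⇒≡ (x ∷ xs) (y ∷ ys) e = cong₂ _∷_ (≡ᵇ-true⇒≡ x y (∧-true⁻ˡ (x ≡ᵇ y) e))
  (eqListᵇ-true⇒≡ xs ys (∧-true⁻ʳ (x ≡ᵇ y) e))

eqListᵇ-refl : ∀ xs → eqListᵇ xs xs ≡ true
eqListᵇ-refl [] = refl
eqListᵇ-refl (x ∷ xs) rewrite ≡ᵇ-refl x = eqListᵇ-refl xs

sumMap-words-eqListᵇ : ∀ n k x → IsWord n k x → sumMap (λ w → ind (eqListᵇ x w)) (words n k) ≡ 1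
sumMap-words-eqListᵇ n zero [] _ = refl
sumMap-words-eqListᵇ n (suc k) (x ∷ xs) (l , ((p , q) ∷ r)) = trans
  (sumMap-words {n} k (λ w → ind (eqListᵇ (x ∷ xs) w)))
  (trans (sumTo-cong n
    (λ a _ _ → trans (sumMap-cong (λ w → ind∧' (x ≡ᵇ a) (eqListᵇ xs w)) (words n k))
    (trans (sumMap-* (ind (x ≡ᵇ a)) (λ w → ind (eqListᵇ xs w)) (words n k))
    (trans (cong (ind (x ≡ᵇ a) *_) (sumMap-words-eqListᵇ n k xs (suc-injective l , r)))
    (trans (*-identityʳ _)
    (trans (ind-if (x ≡ᵇ a)) (cong (λ z → if z then 1 else 0) (eqb-sym' x a))))))))
  (sumTo-indicator x 1 n p q))
  where
  ind∧' : ∀ a b → ind (a ∧ b) ≡ ind a * ind b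
  ind∧' true b = sym (+-identityʳ (ind b))
  ind∧' false b = refl
  eqb-sym' : ∀ a b → (a ≡ᵇ b) ≡ (b ≡ᵇ a)
  eqb-sym' = ≡ᵇ-sym

-- Double counting the pairs (f , w) with P f and φ f ≡ w.
module CountingBijection (n : ℕ) (P Q : List ℕ → Bool) (φ ψ : List ℕ → List ℕ)
  (φ-into : ∀ f → IsWord n n f → P f ≡ true → IsWord n n (φ f) × (Q (φ f) ≡ true))
  (ψ-into : ∀ w → IsWord n n w → Q w ≡ true → IsWord n n (ψ w) × (P (ψ w) ≡ true))
  (ψ∘φ : ∀ f → IsWord n n f → P f ≡ true → ψ (φ f) ≡ f)
  (φ∘ψ : ∀ w → IsWord n n w → Q w ≡ true → φ (ψ w) ≡ w) where

  W : List (List ℕ)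
  W = words n n

  fibre-of-target : ∀ w → IsWord n n w → sumMap (λ f → ind (P f ∧ eqListᵇ (φ f) w)) W ≡ ind (Q w)
  fibre-of-target w ww with Q w in eq
  ... | true = trans (sumMap-words-cong n n _ _ pt)
    (sumMap-words-eqListᵇ n n (ψ w) (proj₁ (ψ-into w ww eq)))
    where
    pt : ∀ f → IsWord n n f → ind (P f ∧ eqListᵇ (φ f) w) ≡ ind (eqListᵇ (ψ w) f)
    pt f wf = cong ind (bool-ext to from)
      where
      to : (P f ∧ eqListᵇ (φ f) w) ≡ true → eqListᵇ (ψ w) f ≡ true
      to e = let (pf , φf≡w) = ∧-true⁻ (P f) e
             in subst (λ z → eqListᵇ z f ≡ true)
                      (trans (sym (ψ∘φ f wf pf)) (cong ψ (eqListᵇ-true⇒≡ (φ f) w φf≡w))) (eqListᵇ-refl f)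
      from : eqListᵇ (ψ w) f ≡ true → (P f ∧ eqListᵇ (φ f) w) ≡ true
      from e = subst (λ z → (P z ∧ eqListᵇ (φ z) w) ≡ true) (eqListᵇ-true⇒≡ (ψ w) f e)
                     (∧-true⁺ (proj₂ (ψ-into w ww eq)) (subst (λ z → eqListᵇ z w ≡ true) (sym (φ∘ψ w ww eq)) (eqListᵇ-refl w)))
  ... | false = trans (sumMap-words-cong n n _ _ pt) (sumMap-zero W)
    where
    pt : ∀ f → IsWord n n f → ind (P f ∧ eqListᵇ (φ f) w) ≡ 0
    pt f wf with P f in pf | eqListᵇ (φ f) w in fe
    ... | true | true = ⊥-elim
      (true-false-⊥ (subst (λ z → Q z ≡ true) (eqListᵇ-true⇒≡ (φ f) w fe)
      (proj₂ (φ-into f wf pf))) eq)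
    ... | true | false = refl
    ... | false | _ = refl

  fibre-of-source : ∀ f → IsWord n n f → sumMap (λ w → ind (P f ∧ eqListᵇ (φ f) w)) W ≡ ind (P f)
  fibre-of-source f wf with P f in pf
  ... | true = sumMap-words-eqListᵇ n n (φ f) (proj₁ (φ-into f wf pf))
  ... | false = sumMap-zero W

  count-target≡count-source : sumMap (λ w → ind (Q w)) W ≡ sumMap (λ f → ind (P f)) W
  count-target≡count-source = trans
    (sumMap-words-cong n n _ _ (λ w ww → sym (fibre-of-target w ww)))
    (trans (sumMap-swap (λ w f → ind (P f ∧ eqListᵇ (φ f) w)) W W)
      (sumMap-words-cong n n _ _ fibre-of-source))

elem-self : ∀ x xs → elem x (x ∷ xs) ≡ true
elem-self x xs rewrite ≡ᵇ-refl x = refl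

elem-cons : ∀ x m xs → elem m xs ≡ true → elem m (x ∷ xs) ≡ true
elem-cons x m xs e rewrite e with x ≡ᵇ m
... | true = refl
... | false = refl

elem-∷⁻ : ∀ l y r → elem l (y ∷ r) ≡ true → (y ≡ l) ⊎ (elem l r ≡ true)
elem-∷⁻ l y r e with y ≡ᵇ l in eyl
... | true = inj₁ (≡ᵇ-true⇒≡ y l eyl)
... | false = inj₂ e

elem-≢ : ∀ l x xs → elem l xs ≡ true → elem x xs ≡ false → l ≢ x
elem-≢ l x xs e1 e2 refl = true-false-⊥ e1 e2

elem-++ : ∀ z xs ys → elem z (xs ++ ys) ≡ (elem z xs ∨ elem z ys)
elem-++ z [] ys = refl
elem-++ z (x ∷ xs) ys rewrite elem-++ z xs ys with x ≡ᵇ z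
... | true = refl
... | false = refl

elem-++⁺ˡ : ∀ z xs ys → elem z xs ≡ true → elem z (xs ++ ys) ≡ true
elem-++⁺ˡ z xs ys e = trans (elem-++ z xs ys) (∨-true⁺ˡ _ _ e)

elem-++⁺ʳ : ∀ z xs ys → elem z ys ≡ true → elem z (xs ++ ys) ≡ true
elem-++⁺ʳ z xs ys e = trans (elem-++ z xs ys) (∨-true⁺ʳ _ _ e)

elem-++-∷ : ∀ z xs zs → elem z (xs ++ (z ∷ zs)) ≡ true
elem-++-∷ z [] zs = elem-self z zs
elem-++-∷ z (x ∷ xs) zs = elem-cons x z (xs ++ (z ∷ zs)) (elem-++-∷ z xs zs)

elem-concat-map : ∀ (g : ℕ → List ℕ) ms m v → elem m ms ≡ true → elem v (g m) ≡ true →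
  elem v (concat (map g ms)) ≡ true
elem-concat-map g (x ∷ ms) m v em ev with x ≡ᵇ m in exm
... | true rewrite ≡ᵇ-true⇒≡ x m exm = trans (elem-++ v (g m) (concat (map g ms))) (∨-true⁺ˡ _ _ ev)
... | false = trans (elem-++ v (g x) (concat (map g ms)))
  (∨-true⁺ʳ _ _ (elem-concat-map g ms m v em ev))

All-elem : ∀ {P : ℕ → Set} q m → All P q → elem m q ≡ true → P m
All-elem (b ∷ q) m (p ∷ ps) e with b ≡ᵇ m in ebm
... | true rewrite ≡ᵇ-true⇒≡ b m ebm = p
... | false = All-elem q m ps e

elem⇒All : ∀ {P : ℕ → Set} xs → (∀ z → elem z xs ≡ true → P z) → All P xs
elem⇒All [] h = []
elem⇒All (x ∷ xs) h = h x (elem-self x xs) ∷ elem⇒All xs (λ z e → h z (elem-cons x z xs e))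

All-map⁺ : ∀ {P : ℕ → Set} (g : ℕ → ℕ) xs → All (λ x → P (g x)) xs → All P (map g xs)
All-map⁺ g [] _ = []
All-map⁺ g (x ∷ xs) (p ∷ ps) = p ∷ All-map⁺ g xs ps

map-id-All : ∀ (g : List ℕ → List ℕ) (L : List (List ℕ)) → All (λ B → g B ≡ B) L → map g L ≡ L
map-id-All g [] _ = refl
map-id-All g (B ∷ L) (p ∷ ps) = cong₂ _∷_ p (map-id-All g L ps)

Distinct : List ℕ → Set
Distinct [] = ⊤
Distinct (b ∷ q) = (elem b q ≡ false) × Distinct q

distinct-++ : ∀ xs ys → Distinct xs → Distinct ys → (∀ z → elem z xs ≡ true → elem z ys ≡ false) →
  Distinct (xs ++ ys)
distinct-++ [] ys _ dy _ = dy
distinct-++ (x ∷ xs) ys (nx , dx) dy h = ne , distinct-++ xs ys dx dy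
  (λ z e → h z (elem-cons x z xs e))
  where
  ne : elem x (xs ++ ys) ≡ false
  ne rewrite elem-++ x xs ys | nx = h x (elem-self x xs)

distinct-++-disjoint : ∀ xs ys z → Distinct (xs ++ ys) → elem z ys ≡ true → elem z xs ≡ false
distinct-++-disjoint [] ys z _ _ = refl
distinct-++-disjoint (x ∷ xs) ys z (nx , d) e with x ≡ᵇ z in exz
... | true rewrite ≡ᵇ-true⇒≡ x z exz = ⊥-elim
  (true-false-⊥ (trans (elem-++ z xs ys) (∨-true⁺ʳ _ _ e)) nx)
... | false = distinct-++-disjoint xs ys z d e

distinct-++ʳ : ∀ xs ys → Distinct (xs ++ ys) → Distinct ys
distinct-++ʳ [] ys d = d
distinct-++ʳ (x ∷ xs) ys (_ , d) = distinct-++ʳ xs ys d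

Below : ℕ → List ℕ → Set
Below t q = All (λ b → b < t) q

below-∉ : ∀ t q → Below t q → elem t q ≡ false
below-∉ t [] _ = refl
below-∉ t (b ∷ q) (p ∷ ps) rewrite ≢⇒≡ᵇ-false b t (λ e → <-irrefl e p) = below-∉ t q ps

below-elem : ∀ t q m → Below t q → elem m q ≡ true → m < t
below-elem t (b ∷ q) m (p ∷ ps) e with b ≡ᵇ m in ebm
... | true rewrite ≡ᵇ-true⇒≡ b m ebm = p
... | false = below-elem t q m ps e

Covers : ℕ → List ℕ → Set
Covers n xs = ∀ v → 1 ≤ v → v ≤ n → elem v xs ≡ true

AllPositive : List ℕ → Set
AllPositive q = All (λ b → 1 ≤ b) q

occurrences : ℕ → List ℕ → ℕ
occurrences a [] = 0
occurrences a (b ∷ q) = ind (a ≡ᵇ b) + occurrences a q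

occurrences-∉ : ∀ a q → elem a q ≡ false → occurrences a q ≡ 0
occurrences-∉ a [] e = refl
occurrences-∉ a (b ∷ q) e with ∨-false⁻ (b ≡ᵇ a) (elem a q) e
... | e1 , e2 rewrite ≡ᵇ-sym a b | e1 = occurrences-∉ a q e2

occurrences-distinct : ∀ a q → Distinct q → occurrences a q ≡ ind (elem a q)
occurrences-distinct a [] _ = refl
occurrences-distinct a (b ∷ q) (nb , dq) with b ≡ᵇ a in e
... | true rewrite ≡ᵇ-sym a b | e | ≡ᵇ-true⇒≡ b a e | occurrences-∉ a q nb = refl
... | false rewrite ≡ᵇ-sym a b | e = occurrences-distinct a q dq

occurrences-∈ : ∀ a q → elem a q ≡ true → 1 ≤ occurrences a q
occurrences-∈ a (b ∷ q) e with b ≡ᵇ a in eba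
... | true rewrite ≡ᵇ-sym a b | eba = s≤s z≤n
... | false = ≤-trans (occurrences-∈ a q e) (m≤n+m (occurrences a q) (ind (a ≡ᵇ b)))

occurrences-zero⇒∉ : ∀ a q → occurrences a q ≡ 0 → elem a q ≡ false
occurrences-zero⇒∉ a [] _ = refl
occurrences-zero⇒∉ a (b ∷ q) e with a ≡ᵇ b in eab
... | true with e
...   | ()
occurrences-zero⇒∉ a (b ∷ q) e | false rewrite ≡ᵇ-sym b a | eab = occurrences-zero⇒∉ a q e

sumTo-occurrences-length : ∀ n xs → All (InRange n) xs → sumTo (λ v → occurrences v xs) n
  ≡ length xs
sumTo-occurrences-length n [] _ = sumTo-zero n
sumTo-occurrences-length n (b ∷ q) ((p1 , p2) ∷ ps) = trans
  (sumTo-+ (λ v → ind (v ≡ᵇ b)) (λ v → occurrences v q) n)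
  (cong₂ _+_ (trans (sumTo-cong n (λ v _ _ → ind-if (v ≡ᵇ b))) (sumTo-indicator b 1 n p1 p2))
    (sumTo-occurrences-length n q ps))

distinct-covering⇒length : ∀ n xs → Distinct xs → All (InRange n) xs → Covers n xs → length xs ≡ n
distinct-covering⇒length n xs d r c = trans (sym (sumTo-occurrences-length n xs r))
  (trans (sumTo-cong n (λ v p q → trans (occurrences-distinct v xs d) (cong ind (c v p q))))
  (sumTo-one n))

occurrences-≤1⇒distinct : ∀ n xs → All (InRange n) xs →
  (∀ v → 1 ≤ v → v ≤ n → occurrences v xs ≤ 1) → Distinct xs
occurrences-≤1⇒distinct n [] _ _ = tt
occurrences-≤1⇒distinct n (x ∷ xs) ((1≤x , x≤n) ∷ xs∈) at-most-once =
  occurrences-zero⇒∉ x xs x-not-again ,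
  occurrences-≤1⇒distinct n xs xs∈
    (λ v 1≤v v≤n → ≤-trans (m≤n+m (occurrences v xs) (ind (v ≡ᵇ x))) (at-most-once v 1≤v v≤n))
  where
  x-not-again : occurrences x xs ≡ 0
  x-not-again with at-most-once x 1≤x x≤n
  ... | x-once rewrite ≡ᵇ-refl x = n≤0⇒n≡0 (≤-pred x-once)

pigeonhole : ∀ n xs → length xs ≡ n → All (InRange n) xs → Covers n xs → Distinct xs
pigeonhole n xs l r c = occurrences-≤1⇒distinct n xs r bound
  where
  pos : ∀ v → 1 ≤ v → v ≤ n → 1 ≤ occurrences v xs
  pos v p q = occurrences-∈ v xs (c v p q)
  tot : sumTo (λ v → occurrences v xs) n ≡ n
  tot = trans (sumTo-occurrences-length n xs r) l
  bound : ∀ v → 1 ≤ v → v ≤ n → occurrences v xs ≤ 1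
  bound v p q = +-cancelˡ-≤ (n ∸ 1) (occurrences v xs) 1
    (≤-trans (subst (_≤ n) refl
    (≤-trans (sumTo-positive-one (λ v → occurrences v xs) n pos v p q) (≤-reflexive tot)))
    (≤-reflexive (sym (trans (+-comm (n ∸ 1) 1) (m+[n∸m]≡n (≤-trans p q))))))

select : (ℕ → Bool) → List ℕ → List ℕ
select p [] = []
select p (x ∷ xs) = if p x then x ∷ select p xs else select p xs

select-cong : ∀ p p' xs → (∀ m → elem m xs ≡ true → p m ≡ p' m) → select p xs ≡ select p' xs
select-cong p p' [] h = refl
select-cong p p' (x ∷ xs) h rewrite h x (elem-self x xs) = cong (λ z → if p' x then x ∷ z else z)
  (select-cong p p' xs (λ m e → h m (elem-cons x m xs e)))

elem-select⁻ : ∀ (p : ℕ → Bool) xs a → elem a (select p xs) ≡ true →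
  (elem a xs ≡ true) × (p a ≡ true)
elem-select⁻ p (x ∷ xs) a e with p x in epx
... | false = let (h1 , h2) = elem-select⁻ p xs a e in elem-cons x a xs h1 , h2
... | true with x ≡ᵇ a in exa
...   | true rewrite ≡ᵇ-true⇒≡ x a exa = refl , epx
...   | false = elem-select⁻ p xs a e

elem-select⁺ : ∀ (p : ℕ → Bool) xs a → elem a xs ≡ true → p a ≡ true → elem a (select p xs) ≡ true
elem-select⁺ p (x ∷ xs) a e pa with x ≡ᵇ a in exa
... | true rewrite ≡ᵇ-true⇒≡ x a exa | pa = elem-self a (select p xs)
... | false with p x
...   | true = elem-cons x a (select p xs) (elem-select⁺ p xs a e pa)
...   | false = elem-select⁺ p xs a e pa

All-select : ∀ {P : ℕ → Set} (p : ℕ → Bool) xs → All P xs → All P (select p xs)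
All-select p [] _ = []
All-select p (x ∷ xs) (a ∷ as) with p x
... | true = a ∷ All-select p xs as
... | false = All-select p xs as

distinct-select : ∀ (p : ℕ → Bool) xs → Distinct xs → Distinct (select p xs)
distinct-select p [] _ = tt
distinct-select p (x ∷ xs) (nx , dx) with p x
... | true = ¬true⇒false
  (λ e → true-false-⊥ (proj₁ (elem-select⁻ p xs x e)) nx) , distinct-select p xs dx
... | false = distinct-select p xs dx

allᵇ-++ : ∀ (p : ℕ → Bool) xs ys → allᵇ p (xs ++ ys) ≡ (allᵇ p xs ∧ allᵇ p ys)
allᵇ-++ p [] ys = refl
allᵇ-++ p (x ∷ xs) ys rewrite allᵇ-++ p xs ys with p x
... | true = refl
... | false = refl

allᵇ-range⁺ : ∀ (p : ℕ → Bool) n → (∀ i → 1 ≤ i → i ≤ n → p i ≡ true) → allᵇ p (range n) ≡ true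
allᵇ-range⁺ p zero h = refl
allᵇ-range⁺ p (suc n) h = trans (cong (allᵇ p) (range-suc n))
  (trans (allᵇ-++ p (range n) [ suc n ])
  (∧-true⁺ (allᵇ-range⁺ p n (λ i a b → h i a (m≤n⇒m≤1+n b)))
  (∧-true⁺ (h (suc n) (s≤s z≤n) ≤-refl) refl)))

allᵇ-range⁻ : ∀ (p : ℕ → Bool) n → allᵇ p (range n) ≡ true → ∀ i → 1 ≤ i → i ≤ n → p i ≡ true
allᵇ-range⁻ p zero e0 i a b = ⊥-elim (<-irrefl refl (≤-trans a b))
allᵇ-range⁻ p (suc n) e0 i a b with trans (sym (allᵇ-++ p (range n) [ suc n ]))
  (trans (cong (allᵇ p) (sym (range-suc n))) e0) | m≤n⇒m<n∨m≡n b
... | e | inj₁ lt = allᵇ-range⁻ p n (∧-true⁻ˡ (allᵇ p (range n)) e) i a (≤-pred lt)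
... | e | inj₂ refl = ∧-true⁻ˡ (p (suc n)) (∧-true⁻ʳ (allᵇ p (range n)) e)

allᵇ-range²⁻ : ∀ (p : ℕ → ℕ → Bool) n → allᵇ (λ m → allᵇ (p m) (range n)) (range n) ≡ true →
               ∀ m m′ → 1 ≤ m → m ≤ n → 1 ≤ m′ → m′ ≤ n → p m m′ ≡ true
allᵇ-range²⁻ p n e m m′ 1≤m m≤n = allᵇ-range⁻ (p m) n (allᵇ-range⁻ _ n e m 1≤m m≤n) m′

allᵇ-range²⁺ : ∀ (p : ℕ → ℕ → Bool) n → (∀ m m′ → 1 ≤ m → m ≤ n → 1 ≤ m′ → m′ ≤ n → p m m′ ≡ true) →
               allᵇ (λ m → allᵇ (p m) (range n)) (range n) ≡ true
allᵇ-range²⁺ p n h = allᵇ-range⁺ _ n (λ m 1≤m m≤n → allᵇ-range⁺ (p m) n (λ m′ → h m m′ 1≤m m≤n))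

anyᵇ-false⁻ : ∀ {A : Set} (q : A → Bool) xs → anyᵇ q xs ≡ false → All (λ x → q x ≡ false) xs
anyᵇ-false⁻ q [] _ = []
anyᵇ-false⁻ q (x ∷ xs) e = proj₁ (∨-false⁻ (q x) _ e) ∷ anyᵇ-false⁻ q xs
  (proj₂ (∨-false⁻ (q x) _ e))

anyᵇ-false⁺ : ∀ {A : Set} (q : A → Bool) xs → All (λ x → q x ≡ false) xs → anyᵇ q xs ≡ false
anyᵇ-false⁺ q [] _ = refl
anyᵇ-false⁺ q (x ∷ xs) (p ∷ ps) rewrite p = anyᵇ-false⁺ q xs ps

at-suc : ∀ x (g : List ℕ) i → 1 ≤ i → at (x ∷ g) (suc i) ≡ at g i
at-suc x g (suc i) _ = refl

at-All : ∀ {P : ℕ → Set} (g : List ℕ) i → All P g → 1 ≤ i → i ≤ length g → P (at g i)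
at-All (x ∷ g) (suc zero) (px ∷ _) _ _ = px
at-All (x ∷ g) (suc (suc i)) (_ ∷ pg) _ (s≤s le) = at-All g (suc i) pg (s≤s z≤n) le

at-ext : ∀ (f g : List ℕ) → length f ≡ length g →
  (∀ i → 1 ≤ i → i ≤ length f → at f i ≡ at g i) → f ≡ g
at-ext [] [] _ _ = refl
at-ext (x ∷ f) (y ∷ g) l h = cong₂ _∷_ (h 1 (s≤s z≤n) (s≤s z≤n))
  (at-ext f g (suc-injective l)
  (λ i p q → trans (sym (at-suc x f i p)) (trans (h (suc i) (s≤s z≤n) (s≤s q)) (at-suc y g i p))))

drop-at : ∀ (f : List ℕ) j → j < length f → drop j f ≡ at f (suc j) ∷ drop (suc j) f
drop-at (x ∷ f) zero p = refl
drop-at (x ∷ f) (suc j) (s≤s p) = drop-at f j p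

OccursAfter : List ℕ → ℕ → ℕ → Set
OccursAfter g j m = Σ ℕ (λ i → j < i × i ≤ length g × at g i ≡ m)

elem-drop⇒occurs : ∀ g j m → elem m (drop j g) ≡ true → OccursAfter g j m
elem-drop⇒occurs (x ∷ g) zero m e with x ≡ᵇ m in exm
... | true = 1 , s≤s z≤n , s≤s z≤n , ≡ᵇ-true⇒≡ x m exm
... | false with elem-drop⇒occurs g zero m e
...   | (i , lt , le , eq) = suc i , s≤s z≤n , s≤s le , trans (at-suc x g i lt) eq
elem-drop⇒occurs (x ∷ g) (suc j) m e with elem-drop⇒occurs g j m e
... | (i , lt , le , eq) = suc i , s≤s lt , s≤s le , trans (at-suc x g i (≤-trans (s≤s z≤n) lt)) eq

occurs⇒elem-drop : ∀ g j m → OccursAfter g j m → elem m (drop j g) ≡ true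
occurs⇒elem-drop (x ∷ g) zero m (suc zero , lt , le , eq) rewrite eq | ≡ᵇ-refl m = refl
occurs⇒elem-drop (x ∷ g) zero m (suc (suc i) , lt , s≤s le , eq) = ∨-true⁺ʳ (x ≡ᵇ m) _
  (occurs⇒elem-drop g zero m (suc i , s≤s z≤n , le , eq))
occurs⇒elem-drop (x ∷ g) (suc j) m (suc i , s≤s lt , s≤s le , eq) = occurs⇒elem-drop g j m
  (i , lt , le , trans (sym (at-suc x g i (≤-trans (s≤s z≤n) lt))) eq)

head0 : List ℕ → ℕ
head0 [] = 0
head0 (x ∷ _) = x

last0 : List ℕ → ℕ
last0 [] = 0
last0 (x ∷ []) = x
last0 (x ∷ y ∷ r) = last0 (y ∷ r)

NonEmpty : List ℕ → Set
NonEmpty [] = ⊥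
NonEmpty (_ ∷ _) = ⊤

Ascending : List ℕ → Set
Ascending [] = ⊤
Ascending (x ∷ []) = ⊤
Ascending (x ∷ y ∷ r) = (x < y) × Ascending (y ∷ r)

IsRun : List ℕ → Set
IsRun B = NonEmpty B × Ascending B

StrictlyAscending StrictlyDescending : List ℕ → Set
StrictlyAscending [] = ⊤
StrictlyAscending (x ∷ xs) = All (x <_) xs × StrictlyAscending xs
StrictlyDescending [] = ⊤
StrictlyDescending (x ∷ xs) = All (_< x) xs × StrictlyDescending xs

head≤last : ∀ x B → Ascending (x ∷ B) → x ≤ last0 (x ∷ B)
head≤last x [] _ = ≤-refl
head≤last x (y ∷ B) (p , a) = ≤-trans (<⇒≤ p) (head≤last y B a)

ascending⇒All : ∀ x xs → Ascending (x ∷ xs) → All (x <_) xs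
ascending⇒All x [] _ = []
ascending⇒All x (y ∷ r) (p , a) = p ∷ AllM.map (λ q → <-trans p q) (ascending⇒All y r a)

ascending⇒strictlyAscending : ∀ xs → Ascending xs → StrictlyAscending xs
ascending⇒strictlyAscending [] _ = tt
ascending⇒strictlyAscending (x ∷ []) _ = [] , tt
ascending⇒strictlyAscending (x ∷ y ∷ r) (p , a) = ascending⇒All x (y ∷ r)
  (p , a) , ascending⇒strictlyAscending (y ∷ r) a

strictlyAscending⇒ascending : ∀ xs → StrictlyAscending xs → Ascending xs
strictlyAscending⇒ascending [] _ = tt
strictlyAscending⇒ascending (x ∷ []) _ = tt
strictlyAscending⇒ascending (x ∷ y ∷ r) ((p ∷ _) , s) = p , strictlyAscending⇒ascending (y ∷ r) s

head0≤elem : ∀ B v → Ascending B → elem v B ≡ true → head0 B ≤ v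
head0≤elem (x ∷ B) v a e with elem-∷⁻ v x B e
... | inj₁ refl = ≤-refl
... | inj₂ e2 = <⇒≤ (All-elem B v (ascending⇒All x B a) e2)

elem≤last0 : ∀ B v → Ascending B → elem v B ≡ true → v ≤ last0 B
elem≤last0 (x ∷ []) v _ e with elem-∷⁻ v x [] e
... | inj₁ refl = ≤-refl
elem≤last0 (x ∷ y ∷ B) v (p , a) e = go (elem-∷⁻ v x (y ∷ B) e) (elem≤last0 (y ∷ B) v a)
  where
  go : (x ≡ v) ⊎ (elem v (y ∷ B) ≡ true) → (elem v (y ∷ B) ≡ true → v ≤ last0 (y ∷ B)) →
    v ≤ last0 (y ∷ B)
  go (inj₁ refl) _ = ≤-trans (<⇒≤ p) (head≤last y B a)
  go (inj₂ e2) ih = ih e2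

head0-elem : ∀ B → NonEmpty B → elem (head0 B) B ≡ true
head0-elem (x ∷ B) _ = elem-self x B

last0-elem : ∀ B → NonEmpty B → elem (last0 B) B ≡ true
last0-elem (x ∷ []) _ = elem-self x []
last0-elem (x ∷ y ∷ B) _ = elem-cons x (last0 (y ∷ B)) (y ∷ B) (last0-elem (y ∷ B) tt)

elem⇒nonEmpty : ∀ v q → elem v q ≡ true → NonEmpty q
elem⇒nonEmpty v (_ ∷ _) _ = tt

last0-snoc : ∀ xs y → last0 (xs ++ [ y ]) ≡ y
last0-snoc [] y = refl
last0-snoc (x ∷ []) y = refl
last0-snoc (x ∷ x' ∷ xs) y = last0-snoc (x' ∷ xs) y

strictlyAscending-select : ∀ (p : ℕ → Bool) xs → StrictlyAscending xs →
  StrictlyAscending (select p xs)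
strictlyAscending-select p [] _ = tt
strictlyAscending-select p (x ∷ xs) (a , s) with p x
... | true = All-select p xs a , strictlyAscending-select p xs s
... | false = strictlyAscending-select p xs s

strictlyDescending-select : ∀ (p : ℕ → Bool) xs → StrictlyDescending xs →
  StrictlyDescending (select p xs)
strictlyDescending-select p [] _ = tt
strictlyDescending-select p (x ∷ xs) (a , s) with p x
... | true = All-select p xs a , strictlyDescending-select p xs s
... | false = strictlyDescending-select p xs s

upFrom : ℕ → ℕ → List ℕ
upFrom s zero = []
upFrom s (suc k) = s ∷ upFrom (suc s) k

upFrom-snoc : ∀ s k → upFrom s (suc k) ≡ upFrom s k ++ [ s + k ]
upFrom-snoc s zero = cong (λ z → z ∷ []) (sym (+-identityʳ s))
upFrom-snoc s (suc k) = cong (s ∷_)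
  (trans (upFrom-snoc (suc s) k) (cong (λ z → upFrom (suc s) k ++ [ z ]) (sym (+-suc s k))))

All-upFrom : ∀ s k → All (s ≤_) (upFrom s k)
All-upFrom s zero = []
All-upFrom s (suc k) = ≤-refl ∷ AllM.map (λ p → ≤-trans (n≤1+n s) p) (All-upFrom (suc s) k)

strictlyAscending-upFrom : ∀ s k → StrictlyAscending (upFrom s k)
strictlyAscending-upFrom s zero = tt
strictlyAscending-upFrom s (suc k) = All-upFrom (suc s) k , strictlyAscending-upFrom (suc s) k

at-map-upFrom : ∀ (g : ℕ → ℕ) s k i → i < k → at (map g (upFrom s k)) (suc i) ≡ g (s + i)
at-map-upFrom g s (suc k) zero _ = cong g (sym (+-identityʳ s))
at-map-upFrom g s (suc k) (suc i) (s≤s p) = trans (at-map-upFrom g (suc s) k i p)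
  (cong g (sym (+-suc s i)))

<-+-suc : ∀ {i} s k → i < s + suc k → i < suc (s + k)
<-+-suc {i} s k y = subst (i <_) (+-suc s k) y

∉-below-head : ∀ s b B → All (b <_) B → s < b → elem s (b ∷ B) ≡ false
∉-below-head s b B a lt = ¬true⇒false (λ e → lem e)
  where
  lem : elem s (b ∷ B) ≡ true → ⊥
  lem e with elem-∷⁻ s b B e
  ... | inj₁ eq = <-irrefl (sym eq) lt
  ... | inj₂ e2 = <-asym lt (All-elem B s a e2)

select-elem-upFrom : ∀ B s k → StrictlyAscending B → All (λ i → (s ≤ i) × (i < s + k)) B →
  select (λ i → elem i B) (upFrom s k) ≡ B
select-elem-upFrom [] s zero _ _ = refl
select-elem-upFrom (b ∷ B) s zero _ ((p , q) ∷ _) = ⊥-elim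
  (<-irrefl refl (<-≤-trans q (≤-trans (≤-reflexive (+-identityʳ s)) p)))
select-elem-upFrom [] s (suc k) _ _ = select-elem-upFrom [] (suc s) k tt []
select-elem-upFrom (b ∷ B) s (suc k) (a , sa) ((p , q) ∷ rs) with m≤n⇒m<n∨m≡n p
... | inj₂ refl rewrite ≡ᵇ-refl b = cong (b ∷_)
  (trans (select-cong (λ i → elem i (b ∷ B)) (λ i → elem i B) (upFrom (suc b) k) cg)
        (select-elem-upFrom B (suc b) k sa
          (AllM.zipWith (λ { (x , (_ , y)) → x , <-+-suc b k y }) (a , rs))))
  where
  cg : ∀ m → elem m (upFrom (suc b) k) ≡ true → elem m (b ∷ B) ≡ elem m B
  cg m e rewrite ≢⇒≡ᵇ-false b m
    (λ x → <-irrefl x (All-elem (upFrom (suc b) k) m (All-upFrom (suc b) k) e)) = refl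
... | inj₁ lt rewrite ∉-below-head s b B a lt = select-elem-upFrom (b ∷ B) (suc s) k (a , sa)
  ((lt , <-+-suc s k q) ∷ AllM.zipWith (λ { (x , (_ , y)) → <-trans lt x , <-+-suc s k y }) (a , rs))

∉-above : ∀ s ms k → All (_< s) ms → s < suc k → elem (suc k) (s ∷ ms) ≡ false
∉-above s ms k a lt = ¬true⇒false (λ e → lem e)
  where
  lem : elem (suc k) (s ∷ ms) ≡ true → ⊥
  lem e with elem-∷⁻ (suc k) s ms e
  ... | inj₁ eq = <-irrefl eq lt
  ... | inj₂ e2 = <-asym (All-elem ms (suc k) a e2) lt

-- Queues and stacks of open blocks

data Discipline : Set where
  queue stack : Discipline

push : Discipline → ℕ → List ℕ → List ℕ
push queue t q = q ++ [ t ]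
push stack t q = t ∷ q

pop : List ℕ → List ℕ
pop [] = []
pop (_ ∷ q) = q

pushAll : Discipline → ℕ → List ℕ
pushAll d zero = []
pushAll d (suc j) = push d (suc j) (pushAll d j)

length-push : ∀ d t q → length (push d t q) ≡ suc (length q)
length-push queue t q = trans (length-++ q) (+-comm (length q) 1)
length-push stack t q = refl

length-pushAll : ∀ d n → length (pushAll d n) ≡ n
length-pushAll d zero = refl
length-pushAll d (suc n) = trans (length-push d (suc n) (pushAll d n))
  (cong suc (length-pushAll d n))

pushAll-queue : ∀ n → pushAll queue n ≡ upFrom 1 n
pushAll-queue zero = refl
pushAll-queue (suc n) = trans (cong (_++ [ suc n ]) (pushAll-queue n)) (sym (upFrom-snoc 1 n))

-- A singleton block closes before every block opened earlier, so a queue admits it only when no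
-- block is open.
singletonWeight : Discipline → ℕ → ℕ
singletonWeight queue zero = 1
singletonWeight queue (suc _) = 0
singletonWeight stack _ = 1

singletonOk : Discipline → List ℕ → ℕ
singletonOk d q = singletonWeight d (length q)

singletonOkᵇ : Discipline → List ℕ → Bool
singletonOkᵇ queue [] = true
singletonOkᵇ queue (_ ∷ _) = false
singletonOkᵇ stack _ = true

singletonOk≡ind : ∀ d q → singletonOk d q ≡ ind (singletonOkᵇ d q)
singletonOk≡ind queue [] = refl
singletonOk≡ind queue (_ ∷ _) = refl
singletonOk≡ind stack _ = refl

isEmpty : List ℕ → ℕ
isEmpty [] = 1
isEmpty (_ ∷ _) = 0

isEmptyᵇ : List ℕ → Bool
isEmptyᵇ [] = true
isEmptyᵇ (_ ∷ _) = false

isEmpty≡ind : ∀ q → isEmpty q ≡ ind (isEmptyᵇ q)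
isEmpty≡ind [] = refl
isEmpty≡ind (_ ∷ _) = refl

isEmpty⇒[] : ∀ q → isEmptyᵇ q ≡ true → q ≡ []
isEmpty⇒[] [] _ = refl

isEmpty⇒singletonOk : ∀ q → isEmptyᵇ q ≡ true → singletonOkᵇ queue q ≡ true
isEmpty⇒singletonOk [] _ = refl

singletonOk⇒isEmpty : ∀ q → singletonOkᵇ queue q ≡ true → isEmptyᵇ q ≡ true
singletonOk⇒isEmpty [] _ = refl

atHead : ℕ → List ℕ → ℕ
atHead a [] = 0
atHead a (b ∷ _) = ind (a ≡ᵇ b)

atHeadᵇ : ℕ → List ℕ → Bool
atHeadᵇ a [] = false
atHeadᵇ a (b ∷ _) = a ≡ᵇ b

atHead≡ind : ∀ a q → atHead a q ≡ ind (atHeadᵇ a q)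
atHead≡ind a [] = refl
atHead≡ind a (_ ∷ _) = refl

atHead-∉ : ∀ a q → elem a q ≡ false → atHead a q ≡ 0
atHead-∉ a [] e = refl
atHead-∉ a (b ∷ q) e with ∨-false⁻ (b ≡ᵇ a) (elem a q) e
... | e1 , e2 rewrite ≡ᵇ-sym a b | e1 = refl

atHead⇒elem : ∀ a q → atHeadᵇ a q ≡ true → elem a q ≡ true
atHead⇒elem a (b ∷ q) e rewrite ≡ᵇ-true⇒≡ a b e = elem-self b q

atHead-++ : ∀ a q ys → atHeadᵇ a q ≡ true → atHeadᵇ a (q ++ ys) ≡ true
atHead-++ a (b ∷ q) ys e = e

atHead⇒head0 : ∀ a q → atHeadᵇ a q ≡ true → head0 q ≡ a
atHead⇒head0 a (b ∷ q) e = sym (≡ᵇ-true⇒≡ a b e)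

ifNonEmpty : List ℕ → ℕ → ℕ
ifNonEmpty [] X = 0
ifNonEmpty (_ ∷ _) X = X

elem-push-self : ∀ d t q → elem t (push d t q) ≡ true
elem-push-self queue t [] rewrite ≡ᵇ-refl t = refl
elem-push-self queue t (b ∷ q) rewrite elem-push-self queue t q with b ≡ᵇ t
... | true = refl
... | false = refl
elem-push-self stack t q rewrite ≡ᵇ-refl t = refl

elem-push-keep : ∀ d t q b → elem b q ≡ true → elem b (push d t q) ≡ true
elem-push-keep queue t (c ∷ q) b e with c ≡ᵇ b
... | true = refl
... | false = elem-push-keep queue t q b e
elem-push-keep stack t q b e rewrite e with t ≡ᵇ b
... | true = refl
... | false = refl

elem-push-not : ∀ d t q b → b ≢ t → elem b q ≡ false → elem b (push d t q) ≡ false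
elem-push-not queue t [] b ne e rewrite ≢⇒≡ᵇ-false t b (λ x → ne (sym x)) = refl
elem-push-not queue t (c ∷ q) b ne e with ∨-false⁻ (c ≡ᵇ b) (elem b q) e
... | e1 , e2 rewrite e1 = elem-push-not queue t q b ne e2
elem-push-not stack t q b ne e rewrite ≢⇒≡ᵇ-false t b (λ x → ne (sym x)) = e

elem-pop-false : ∀ b q → elem b q ≡ false → elem b (pop q) ≡ false
elem-pop-false b [] e = refl
elem-pop-false b (c ∷ q) e = proj₂ (∨-false⁻ (c ≡ᵇ b) (elem b q) e)

distinct-push : ∀ d t q → elem t q ≡ false → Distinct q → Distinct (push d t q)
distinct-push queue t [] e _ = refl , tt
distinct-push queue t (b ∷ q) e (nb , dq) with ∨-false⁻ (b ≡ᵇ t) (elem t q) e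
... | e1 , e2 = elem-push-not queue t q b
  (λ x → ≡ᵇ-false⇒≢ b t e1 x) nb , distinct-push queue t q e2 dq
distinct-push stack t q e dq = e , dq

distinct-pop : ∀ q → Distinct q → Distinct (pop q)
distinct-pop [] d = d
distinct-pop (_ ∷ _) (_ , d) = d

below-push : ∀ d t q → Below t q → Below (suc t) (push d t q)
below-push queue t q l = ++⁺ (AllM.map m<n⇒m<1+n l) (≤-refl ∷ [])
below-push stack t q l = ≤-refl ∷ AllM.map m<n⇒m<1+n l

below-suc : ∀ t q → Below t q → Below (suc t) q
below-suc t q l = AllM.map m<n⇒m<1+n l

below-pop : ∀ t q → Below t q → Below t (pop q)
below-pop t [] l = l
below-pop t (_ ∷ _) (_ ∷ l) = l

below-pushAll : ∀ d j → Below (suc j) (pushAll d j)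
below-pushAll d zero = []
below-pushAll d (suc j) = below-push d (suc j) (pushAll d j) (below-pushAll d j)

distinct-pushAll : ∀ d j → Distinct (pushAll d j)
distinct-pushAll d zero = tt
distinct-pushAll d (suc j) = distinct-push d (suc j) (pushAll d j)
  (below-∉ (suc j) (pushAll d j) (below-pushAll d j)) (distinct-pushAll d j)

positive-pushAll : ∀ d j → AllPositive (pushAll d j)
positive-pushAll queue zero = []
positive-pushAll queue (suc j) = ++⁺ (positive-pushAll queue j) (s≤s z≤n ∷ [])
positive-pushAll stack zero = []
positive-pushAll stack (suc j) = s≤s z≤n ∷ positive-pushAll stack j

elem-pushAll⁻ : ∀ d j a → elem a (pushAll d j) ≡ true → (1 ≤ a) × (a ≤ j)
elem-pushAll⁻ d j a e = All-elem (pushAll d j) a (positive-pushAll d j) e , ≤-pred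
  (below-elem (suc j) (pushAll d j) a (below-pushAll d j) e)

elem-pushAll⁺ : ∀ d j a → 1 ≤ a → a ≤ j → elem a (pushAll d j) ≡ true
elem-pushAll⁺ d zero a p q = ⊥-elim (<-irrefl refl (≤-trans p q))
elem-pushAll⁺ d (suc j) a p q with m≤n⇒m<n∨m≡n q
... | inj₁ lt = elem-push-keep d (suc j) (pushAll d j) a (elem-pushAll⁺ d j a p (≤-pred lt))
... | inj₂ refl = elem-push-self d (suc j) (pushAll d j)

strictlyAscending-pushAll : ∀ n → StrictlyAscending (pushAll queue n)
strictlyAscending-pushAll n = subst StrictlyAscending (sym (pushAll-queue n))
  (strictlyAscending-upFrom 1 n)

strictlyDescending-pushAll : ∀ n → StrictlyDescending (pushAll stack n)
strictlyDescending-pushAll zero = tt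
strictlyDescending-pushAll (suc n) = below-pushAll stack n , strictlyDescending-pushAll n

at-map-pushAll : ∀ (g : ℕ → ℕ) n i → 1 ≤ i → i ≤ n → at (map g (pushAll queue n)) i ≡ g i
at-map-pushAll g n (suc i) _ p = trans (cong (λ z → at (map g z) (suc i)) (pushAll-queue n))
  (at-map-upFrom g 1 n i p)

length-map-pushAll : ∀ (g : ℕ → ℕ) n → length (map g (pushAll queue n)) ≡ n
length-map-pushAll g n = trans (length-map g (pushAll queue n)) (length-pushAll queue n)

select-push : ∀ d p t q → select p (push d t q)
  ≡ (if p t then push d t (select p q) else select p q)
select-push queue p t [] with p t
... | true = refl
... | false = refl
select-push queue p t (x ∷ q) with p x
... | true rewrite select-push queue p t q with p t
...   | true = refl
...   | false = refl
select-push queue p t (x ∷ q) | false = select-push queue p t q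
select-push stack p t q = refl

select-push-true : ∀ d p t q → p t ≡ true → select p (push d t q) ≡ push d t (select p q)
select-push-true d p t q pt = trans (select-push d p t q)
  (cong (λ b → if b then push d t (select p q) else select p q) pt)

select-push-false : ∀ d p t q → p t ≡ false → select p (push d t q) ≡ select p q
select-push-false d p t q pt = trans (select-push d p t q)
  (cong (λ b → if b then push d t (select p q) else select p q) pt)

select-none : ∀ (p : ℕ → Bool) xs → (∀ m → p m ≡ false) → select p xs ≡ []
select-none p [] h = refl
select-none p (x ∷ xs) h rewrite h x = select-none p xs h

select-pop-head : ∀ (a : ℕ) (p p' : ℕ → Bool) x xs → p x ≡ false → p' a ≡ false →
  (∀ m → elem m (x ∷ xs) ≡ true → m ≢ a → p' m ≡ p m) → p' x ≡ false
select-pop-head a p p' x xs epx pa h with x ≡ᵇ a in exa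
... | true rewrite ≡ᵇ-true⇒≡ x a exa = pa
... | false = trans (h x (elem-self x xs) (≡ᵇ-false⇒≢ x a exa)) epx

select-pop : ∀ (a : ℕ) (p p' : ℕ → Bool) xs → Distinct xs → atHeadᵇ a (select p xs) ≡ true → p' a
  ≡ false →
  (∀ m → elem m xs ≡ true → m ≢ a → p' m ≡ p m) → select p' xs ≡ pop (select p xs)
select-pop a p p' (x ∷ xs) (nx , dx) hb pa h with p x in epx
... | true rewrite sym (≡ᵇ-true⇒≡ a x hb) | pa = select-cong p' p xs
  (λ m e → h m (elem-cons a m xs e) (λ ma → neq m e ma))
  where
  neq : ∀ m → elem m xs ≡ true → m ≡ a → ⊥
  neq m e refl = true-false-⊥ e nx
... | false with p' x in ep'x
...   | true = ⊥-elim (true-false-⊥ ep'x (select-pop-head a p p' x xs epx pa h))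
...   | false = select-pop a p p' xs dx hb pa (λ m e ne → h m (elem-cons x m xs e) ne)

elem-select-pushAll⁻ : ∀ d (p : ℕ → Bool) j a → elem a (select p (pushAll d j)) ≡ true →
  (1 ≤ a) × (a ≤ j) × (p a ≡ true)
elem-select-pushAll⁻ d p j a e =
  let (a∈ , pa) = elem-select⁻ p (pushAll d j) a e
      (1≤a , a≤j) = elem-pushAll⁻ d j a a∈
  in 1≤a , a≤j , pa

elem-select-pushAll⁺ : ∀ d (p : ℕ → Bool) j a → 1 ≤ a → a ≤ j → p a ≡ true →
  elem a (select p (pushAll d j)) ≡ true
elem-select-pushAll⁺ d p j a h1 h2 h3 = elem-select⁺ p (pushAll d j) a
  (elem-pushAll⁺ d j a h1 h2) h3

isEmpty-select⁻ : ∀ (p : ℕ → Bool) xs m → isEmptyᵇ (select p xs) ≡ true → elem m xs ≡ true →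
  p m ≡ false
isEmpty-select⁻ p (x ∷ xs) m n e with p x in epx
... | false with x ≡ᵇ m in exm
...   | true rewrite ≡ᵇ-true⇒≡ x m exm = epx
...   | false = isEmpty-select⁻ p xs m n e
isEmpty-select⁻ p (x ∷ xs) m () e | true

isEmpty-select⁺ : ∀ (p : ℕ → Bool) xs → (∀ m → elem m xs ≡ true → p m ≡ false) →
  isEmptyᵇ (select p xs) ≡ true
isEmpty-select⁺ p [] h = refl
isEmpty-select⁺ p (x ∷ xs) h rewrite h x (elem-self x xs) = isEmpty-select⁺ p xs
  (λ m e → h m (elem-cons x m xs e))

isEmpty-select-pushAll⁻ : ∀ d (p : ℕ → Bool) j → isEmptyᵇ (select p (pushAll d j)) ≡ true → ∀ m →
  1 ≤ m → m ≤ j → p m ≡ false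
isEmpty-select-pushAll⁻ d p j n m h1 h2 = isEmpty-select⁻ p (pushAll d j) m n
  (elem-pushAll⁺ d j m h1 h2)

isEmpty-select-pushAll⁺ : ∀ d (p : ℕ → Bool) j → (∀ m → 1 ≤ m → m ≤ j → p m ≡ false) →
  isEmptyᵇ (select p (pushAll d j)) ≡ true
isEmpty-select-pushAll⁺ d p j h = isEmpty-select⁺ p (pushAll d j) (λ m m∈ → uncurry (h m) (elem-pushAll⁻ d j m m∈))

atHead-queue⁻ : ∀ (p : ℕ → Bool) j a → atHeadᵇ a (select p (pushAll queue j)) ≡ true →
  (∀ m → 1 ≤ m → m < a → p m ≡ false)
atHead-queue⁻ p (suc j) a e m h1 h2 with select p (pushAll queue j) in eq | select-push queue p
  (suc j) (pushAll queue j)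
... | [] | fp with p (suc j)
...   | true rewrite fp | ≡ᵇ-true⇒≡ a (suc j) e = isEmpty-select⁻ p (pushAll queue j) m
  (subst (λ z → isEmptyᵇ z ≡ true) (sym eq) refl) (elem-pushAll⁺ queue j m h1 (≤-pred h2))
...   | false rewrite fp with e
...     | ()
atHead-queue⁻ p (suc j) a e m h1 h2 | (b ∷ q) | fp with p (suc j)
...   | true rewrite fp = atHead-queue⁻ p j a (trans (cong (atHeadᵇ a) eq) e) m h1 h2
...   | false rewrite fp = atHead-queue⁻ p j a (trans (cong (atHeadᵇ a) eq) e) m h1 h2

atHead-queue⁺ : ∀ (p : ℕ → Bool) j a → 1 ≤ a → a ≤ j → p a ≡ true →
  (∀ m → 1 ≤ m → m < a → p m ≡ false) → atHeadᵇ a (select p (pushAll queue j)) ≡ true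
atHead-queue⁺ p zero a h1 h2 h3 h4 = ⊥-elim (<-irrefl refl (≤-trans h1 h2))
atHead-queue⁺ p (suc j) a h1 h2 h3 h4 rewrite select-push queue p (suc j)
  (pushAll queue j) with m≤n⇒m<n∨m≡n h2
... | inj₁ lt with p (suc j)
...   | true = atHead-++ a (select p (pushAll queue j)) _ (atHead-queue⁺ p j a h1 (≤-pred lt) h3 h4)
...   | false = atHead-queue⁺ p j a h1 (≤-pred lt) h3 h4
atHead-queue⁺ p (suc j) a h1 h2 h3 h4 | inj₂ refl rewrite h3 | isEmpty⇒[]
  (select p (pushAll queue j))
  (isEmpty-select-pushAll⁺ queue p j (λ m k1 k2 → h4 m k1 (s≤s k2))) = ≡ᵇ-refl (suc j)

atHead-stack⁻ : ∀ (p : ℕ → Bool) j a → atHeadᵇ a (select p (pushAll stack j)) ≡ true →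
  (∀ m → a < m → m ≤ j → p m ≡ false)
atHead-stack⁻ p (suc j) a e m h1 h2 with p (suc j) in eps
... | true rewrite ≡ᵇ-true⇒≡ a (suc j) e = ⊥-elim (<-irrefl refl (≤-trans h1 h2))
... | false with m≤n⇒m<n∨m≡n h2
...   | inj₁ lt = atHead-stack⁻ p j a e m h1 (≤-pred lt)
...   | inj₂ refl = eps

atHead-stack⁺ : ∀ (p : ℕ → Bool) j a → 1 ≤ a → a ≤ j → p a ≡ true →
  (∀ m → a < m → m ≤ j → p m ≡ false) → atHeadᵇ a (select p (pushAll stack j)) ≡ true
atHead-stack⁺ p zero a h1 h2 h3 h4 = ⊥-elim (<-irrefl refl (≤-trans h1 h2))
atHead-stack⁺ p (suc j) a h1 h2 h3 h4 with m≤n⇒m<n∨m≡n h2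
... | inj₁ lt rewrite h4 (suc j) lt ≤-refl = atHead-stack⁺ p j a h1 (≤-pred lt) h3
  (λ m x y → h4 m x (m≤n⇒m≤1+n y))
... | inj₂ refl rewrite h3 = ≡ᵇ-refl (suc j)

select-elem-pushAll-queue : ∀ B n → StrictlyAscending B → All (InRange n) B →
  select (λ i → elem i B) (pushAll queue n) ≡ B
select-elem-pushAll-queue B n sa r = trans (cong (select (λ i → elem i B)) (pushAll-queue n))
  (select-elem-upFrom B 1 n sa (AllM.map (λ { (x , y) → x , s≤s y }) r))

select-elem-pushAll-stack : ∀ ms n → StrictlyDescending ms → All (InRange n) ms →
  select (λ m → elem m ms) (pushAll stack n) ≡ ms
select-elem-pushAll-stack [] n _ _ = filt-false-g (λ m → elem m []) (pushAll stack n) (λ m → refl)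
  where
  filt-false-g : ∀ (p : ℕ → Bool) xs → (∀ m → p m ≡ false) → select p xs ≡ []
  filt-false-g p [] h = refl
  filt-false-g p (x ∷ xs) h rewrite h x = filt-false-g p xs h
select-elem-pushAll-stack (s ∷ ms) zero _ ((p , q) ∷ _) = ⊥-elim (<-irrefl refl (≤-trans p q))
select-elem-pushAll-stack (s ∷ ms) (suc k) (a , sd) ((p , q) ∷ rs) with m≤n⇒m<n∨m≡n q
... | inj₂ refl rewrite ≡ᵇ-refl (suc k) = cong (suc k ∷_)
  (trans (select-cong (λ m → elem m (suc k ∷ ms)) (λ m → elem m ms) (pushAll stack k) cg)
  (select-elem-pushAll-stack ms k sd
  (AllM.zipWith (λ { (x , y) → x , ≤-pred y }) (AllM.map proj₁ rs , a))))
  where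
  cg : ∀ m → elem m (pushAll stack k) ≡ true → elem m (suc k ∷ ms) ≡ elem m ms
  cg m e rewrite ≢⇒≡ᵇ-false (suc k) m
    (λ x → <-irrefl (sym x) (s≤s (proj₂ (elem-pushAll⁻ stack k m e)))) = refl
... | inj₁ lt rewrite ∉-above s ms k a lt = select-elem-pushAll-stack (s ∷ ms) k (a , sd)
  ((p , ≤-pred lt) ∷ AllM.zipWith (λ { (x , y) → x , ≤-pred (<-trans y lt) })
  (AllM.map proj₁ rs , a))

-- Counting partitions by weighted walks

-- The 0/1 indicator of acceptsᵇ below, written linearly in the continuations so that it can be
-- summed over all words (acceptedWords≡walks).
accepts : Discipline → ℕ → List ℕ → List ℕ → ℕ
accepts d t q [] = isEmpty q
accepts d t q (a ∷ s) =
  (if a ≡ᵇ t then singletonOk d q * accepts d (suc t) q s + accepts d (suc t) (push d t q) s else 0)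
  + occurrences a q * accepts d (suc t) q s
  + atHead a q * accepts d (suc t) (pop q) s

isZero : ℕ → ℕ
isZero zero = 1
isZero (suc _) = 0

-- walks d h k: weighted Motzkin paths of length k from height h down to 0.
mutual
  walks : Discipline → ℕ → ℕ → ℕ
  walks d h zero = isZero h
  walks d h (suc k) = (singletonWeight d h + h) * walks d h k + walks d (suc h) k + walksDown d h k

  walksDown : Discipline → ℕ → ℕ → ℕ
  walksDown d zero k = 0
  walksDown d (suc h) k = walks d h k

acceptedWords : ℕ → Discipline → ℕ → List ℕ → ℕ → ℕ
acceptedWords n d t q k = sumMap (accepts d t q) (words n k)

sumTo-occurrences : ∀ n X q → All (InRange n) q → sumTo (λ a → occurrences a q * X) n ≡ length q * X
sumTo-occurrences n X [] _ = sumTo-zero n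
sumTo-occurrences n X (b ∷ q) ((1≤b , b≤n) ∷ q-inRange) =
  trans (sumTo-cong n (λ a _ _ → trans (*-distribʳ-+ X (ind (a ≡ᵇ b)) (occurrences a q))
                                       (cong (_+ occurrences a q * X) (ind-* (a ≡ᵇ b) X))))
  (trans (sumTo-+ (λ a → if a ≡ᵇ b then X else 0) (λ a → occurrences a q * X) n)
         (cong₂ _+_ (sumTo-indicator b X n 1≤b b≤n) (sumTo-occurrences n X q q-inRange)))

sumTo-atHead : ∀ n X q → All (InRange n) q → sumTo (λ a → atHead a q * X) n ≡ ifNonEmpty q X
sumTo-atHead n X [] _ = sumTo-zero n
sumTo-atHead n X (b ∷ q) ((1≤b , b≤n) ∷ _) =
  trans (sumTo-cong n (λ a _ _ → ind-* (a ≡ᵇ b) X)) (sumTo-indicator b X n 1≤b b≤n)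

sumMap-accepts-∷ : ∀ n d t q k a → let R = λ q′ → acceptedWords n d (suc t) q′ k in
  sumMap (λ w → accepts d t q (a ∷ w)) (words n k)
  ≡ (if a ≡ᵇ t then singletonOk d q * R q + R (push d t q) else 0)
    + occurrences a q * R q + atHead a q * R (pop q)
sumMap-accepts-∷ n d t q k a =
  trans (sumMap-+ (λ w → opening w + joining w) closing W)
        (cong₂ _+_ (trans (sumMap-+ opening joining W)
                          (cong₂ _+_ (sumMap-opening (a ≡ᵇ t))
                            (sumMap-* (occurrences a q) (A q) W)))
                   (sumMap-* (atHead a q) (A (pop q)) W))
  where
  W : List (List ℕ)
  W = words n k
  A : List ℕ → List ℕ → ℕ
  A = accepts d (suc t)
  opening joining closing : List ℕ → ℕ
  opening w = if a ≡ᵇ t then singletonOk d q * A q w + A (push d t q) w else 0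
  joining w = occurrences a q * A q w
  closing w = atHead a q * A (pop q) w
  sumMap-opening : ∀ c →
    sumMap (λ w → if c then singletonOk d q * A q w + A (push d t q) w else 0) W
    ≡ (if c then singletonOk d q * sumMap (A q) W + sumMap (A (push d t q)) W else 0)
  sumMap-opening true =
    trans (sumMap-+ (λ w → singletonOk d q * A q w) (A (push d t q)) W)
          (cong (_+ sumMap (A (push d t q)) W) (sumMap-* (singletonOk d q) (A q) W))
  sumMap-opening false = sumMap-zero W

PosBelow : ℕ → List ℕ → Set
PosBelow t q = All (λ b → 1 ≤ b × b < t) q

posBelow-suc : ∀ t q → PosBelow t q → PosBelow (suc t) q
posBelow-suc t q = AllM.map (λ { (1≤b , b<t) → 1≤b , m<n⇒m<1+n b<t })

posBelow-push : ∀ d t q → 1 ≤ t → PosBelow t q → PosBelow (suc t) (push d t q)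
posBelow-push queue t q 1≤t q-pos = ++⁺ (posBelow-suc t q q-pos) ((1≤t , ≤-refl) ∷ [])
posBelow-push stack t q 1≤t q-pos = (1≤t , ≤-refl) ∷ posBelow-suc t q q-pos

posBelow-pop : ∀ t q → PosBelow t q → PosBelow t (pop q)
posBelow-pop t [] i = i
posBelow-pop t (_ ∷ _) (_ ∷ i) = i

posBelow⇒inRange : ∀ t n q → t ≤ n → PosBelow t q → All (InRange n) q
posBelow⇒inRange t n q t≤n = AllM.map (λ { (1≤b , b<t) → 1≤b , ≤-trans (<⇒≤ b<t) t≤n })

regroup-walks : ∀ s h x y z → s * x + y + h * x + z ≡ (s + h) * x + y + z
regroup-walks = solve-∀

acceptedWords≡walks : ∀ n d k t q → 1 ≤ t → t + k ≤ suc n → PosBelow t q →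
                      acceptedWords n d t q k ≡ walks d (length q) k
acceptedWords≡walks n d zero t [] _ _ _ = refl
acceptedWords≡walks n d zero t (_ ∷ _) _ _ _ = refl
acceptedWords≡walks n d (suc k) t q 1≤t bound q-pos = begin
  acceptedWords n d t q (suc k)
    ≡⟨ sumMap-words {n} k (accepts d t q) ⟩
  sumTo (λ a → sumMap (λ w → accepts d t q (a ∷ w)) (words n k)) n
    ≡⟨ sumTo-cong n (λ a _ _ → sumMap-accepts-∷ n d t q k a) ⟩
  sumTo (λ a → opening a + joining a + closing a) n
    ≡⟨ sumTo-+ (λ a → opening a + joining a) closing n ⟩
  sumTo (λ a → opening a + joining a) n + sumTo closing n
    ≡⟨ cong₂ _+_ (sumTo-+ opening joining n) (sumTo-atHead n (R (pop q)) q q-inRange) ⟩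
  sumTo opening n + sumTo joining n + ifNonEmpty q (R (pop q))
    ≡⟨ cong (_+ ifNonEmpty q (R (pop q)))
            (cong₂ _+_ (sumTo-indicator t _ n 1≤t t≤n) (sumTo-occurrences n (R q) q q-inRange)) ⟩
  singletonOk d q * R q + R (push d t q) + length q * R q + ifNonEmpty q (R (pop q))
    ≡⟨ cong₂ (λ x y → singletonOk d q * x + y + length q * x + ifNonEmpty q (R (pop q)))
             (ih q (posBelow-suc t q q-pos)) (ih (push d t q) (posBelow-push d t q 1≤t q-pos)) ⟩
  singletonOk d q * W₀ + walks d (length (push d t q)) k + length q * W₀ + ifNonEmpty q (R (pop q))
    ≡⟨ cong₂ (λ x y → singletonOk d q * W₀ + x + length q * W₀ + y)
             (cong (λ h → walks d h k) (length-push d t q))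
               (ifNonEmpty-pop q (posBelow-pop (suc t) q (posBelow-suc t q q-pos))) ⟩
  singletonOk d q * W₀ + walks d (suc (length q)) k + length q * W₀ + walksDown d (length q) k
    ≡⟨ regroup-walks (singletonOk d q) (length q) W₀ _ _ ⟩
  walks d (length q) (suc k) ∎
  where
  open ≡-Reasoning
  R : List ℕ → ℕ
  R q′ = acceptedWords n d (suc t) q′ k
  W₀ : ℕ
  W₀ = walks d (length q) k
  opening joining closing : ℕ → ℕ
  opening a = if a ≡ᵇ t then singletonOk d q * R q + R (push d t q) else 0
  joining a = occurrences a q * R q
  closing a = atHead a q * R (pop q)
  t≤n : t ≤ n
  t≤n = ≤-pred (≤-trans (s≤s (m≤m+n t k)) (≤-trans (≤-reflexive (sym (+-suc t k))) bound))
  q-inRange : All (InRange n) q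
  q-inRange = posBelow⇒inRange t n q t≤n q-pos
  ih : ∀ q′ → PosBelow (suc t) q′ → R q′ ≡ walks d (length q′) k
  ih q′ = acceptedWords≡walks n d k (suc t) q′ (s≤s z≤n)
    (≤-trans (≤-reflexive (sym (+-suc t k))) bound)
  ifNonEmpty-pop : ∀ q′ → PosBelow (suc t) (pop q′) → ifNonEmpty q′ (R (pop q′))
    ≡ walksDown d (length q′) k
  ifNonEmpty-pop [] _ = refl
  ifNonEmpty-pop (_ ∷ q′) q′-pos = ih q′ q′-pos

acceptsᵇ : Discipline → ℕ → List ℕ → List ℕ → Bool
acceptsᵇ d t q [] = isEmptyᵇ q
acceptsᵇ d t q (a ∷ s) =
  if a ≡ᵇ t
  then (if elem t s then acceptsᵇ d (suc t) (push d t q) s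
                    else singletonOkᵇ d q ∧ acceptsᵇ d (suc t) q s)
  else (if elem a s then elem a q ∧ acceptsᵇ d (suc t) q s
                    else atHeadᵇ a q ∧ acceptsᵇ d (suc t) (pop q) s)

if-*-zero : ∀ c s c2 h → (if c then s * 0 + 0 else 0) + c2 * 0 + h * 0 ≡ 0
if-*-zero true s c2 h rewrite *-zeroʳ s | *-zeroʳ c2 | *-zeroʳ h = refl
if-*-zero false s c2 h rewrite *-zeroʳ c2 | *-zeroʳ h = refl

accepts-reopened≡0 : ∀ d s t q b → b < t → elem b q ≡ false → elem b s ≡ true → accepts d t q s ≡ 0
accepts-reopened≡0 d (a ∷ s) t q b lt nq es with a ≡ᵇ b in eab
... | true rewrite ≡ᵇ-true⇒≡ a b eab | ≢⇒≡ᵇ-false b t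
  (λ e → <-irrefl e lt) | occurrences-∉ b q nq | atHead-∉ b q nq = refl
... | false
  rewrite accepts-reopened≡0 d s (suc t) q b (m<n⇒m<1+n lt) nq es
        | accepts-reopened≡0 d s (suc t) (push d t q) b (m<n⇒m<1+n lt)
          (elem-push-not d t q b (λ e → <-irrefl e lt) nq) es
        | accepts-reopened≡0 d s (suc t) (pop q) b (m<n⇒m<1+n lt)
          (elem-pop-false b q nq) es = if-*-zero (a ≡ᵇ t) (singletonOk d q) (occurrences a q)
          (atHead a q)

accepts-unclosed≡0 : ∀ d s t q b → elem b q ≡ true → elem b s ≡ false → accepts d t q s ≡ 0
accepts-unclosed≡0 d [] t (c ∷ q) b eq es = refl
accepts-unclosed≡0 d (a ∷ s) t q b eq es with ∨-false⁻ (a ≡ᵇ b) (elem b s) es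
... | e1 , e2 rewrite accepts-unclosed≡0 d s (suc t) q b eq e2 | accepts-unclosed≡0 d s (suc t)
  (push d t q) b (elem-push-keep d t q b eq) e2
  = trans (cong (λ z → (if a ≡ᵇ t then singletonOk d q * 0 + 0 else 0) + occurrences a q * 0 + z)
    (third q eq)) (if-*-zero (a ≡ᵇ t) (singletonOk d q) (occurrences a q) 0)
  where
  third : ∀ q → elem b q ≡ true → atHead a q * accepts d (suc t) (pop q) s ≡ 0
  third (c ∷ q) eq with c ≡ᵇ b in ecb
  ... | true rewrite ≡ᵇ-true⇒≡ c b ecb | e1 = refl
  ... | false rewrite accepts-unclosed≡0 d s (suc t) q b eq e2 = *-zeroʳ (atHead a (c ∷ q))

accepts≡acceptsᵇ : ∀ d s t q → Below t q → Distinct q → accepts d t q s ≡ ind (acceptsᵇ d t q s)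
accepts≡acceptsᵇ d [] t q l dq = isEmpty≡ind q
accepts≡acceptsᵇ d (a ∷ s) t q l dq with a ≡ᵇ t in eat
... | true rewrite ≡ᵇ-true⇒≡ a t eat | occurrences-∉ t q (below-∉ t q l) | atHead-∉ t q
  (below-∉ t q l) with elem t s in ets
...   | true rewrite accepts-reopened≡0 d s (suc t) q t ≤-refl (below-∉ t q l) ets
          | accepts≡acceptsᵇ d s (suc t) (push d t q) (below-push d t q l)
            (distinct-push d t q (below-∉ t q l) dq)
          | *-zeroʳ (singletonOk d q) = trans (+-identityʳ _) (+-identityʳ _)
...   | false rewrite accepts-unclosed≡0 d s (suc t) (push d t q) t (elem-push-self d t q) ets
          | accepts≡acceptsᵇ d s (suc t) q (below-suc t q l) dq
          | singletonOk≡ind d q = trans (+-identityʳ _)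
            (trans (+-identityʳ _)
            (trans (+-identityʳ _) (sym (ind-∧ (singletonOkᵇ d q) (acceptsᵇ d (suc t) q s)))))
accepts≡acceptsᵇ d (a ∷ s) t q l dq | false with elem a s in eas
... | true = trans (cong₂ _+_
  (cong (_+_ 0) (cong₂ _*_ (occurrences-distinct a q dq)
  (accepts≡acceptsᵇ d s (suc t) q (below-suc t q l) dq))) (third q l dq))
  (trans (+-identityʳ _) (sym (ind-∧ (elem a q) _)))
  where
  third : ∀ q → Below t q → Distinct q → atHead a q * accepts d (suc t) (pop q) s ≡ 0
  third [] _ _ = refl
  third (c ∷ q) (cl ∷ _) (nc , _) with a ≡ᵇ c in eac
  ... | false = refl
  ... | true rewrite ≡ᵇ-true⇒≡ a c eac = trans (+-identityʳ _)
    (accepts-reopened≡0 d s (suc t) q c (m<n⇒m<1+n cl) nc eas)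
... | false = trans (cong (_+ atHead a q * accepts d (suc t) (pop q) s) (second (elem a q) refl))
    (trans (cong₂ _*_ (atHead≡ind a q)
      (accepts≡acceptsᵇ d s (suc t) (pop q) (below-suc t (pop q) (below-pop t q l))
      (distinct-pop q dq))) (sym (ind-∧ (atHeadᵇ a q) _)))
  where
  second : ∀ c → elem a q ≡ c → 0 + occurrences a q * accepts d (suc t) q s ≡ 0
  second true e rewrite accepts-unclosed≡0 d s (suc t) q a e eas = *-zeroʳ (occurrences a q)
  second false e rewrite occurrences-∉ a q e = refl

guard : Discipline → ℕ → List ℕ → ℕ → List ℕ → Bool
guard d t q a s =
  if a ≡ᵇ t
  then (if elem t s then true else singletonOkᵇ d q)
  else (if elem a s then elem a q else atHeadᵇ a q)

next : Discipline → ℕ → List ℕ → ℕ → List ℕ → List ℕ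
next d t q a s =
  if a ≡ᵇ t
  then (if elem t s then push d t q else q)
  else (if elem a s then q else pop q)

acceptsᵇ-step : ∀ d t q a s → acceptsᵇ d t q (a ∷ s)
  ≡ guard d t q a s ∧ acceptsᵇ d (suc t) (next d t q a s) s
acceptsᵇ-step d t q a s with a ≡ᵇ t
... | true with elem t s
...   | true = refl
...   | false = refl
acceptsᵇ-step d t q a s | false with elem a s
...   | true = refl
...   | false = refl

lastIndex : (ℕ → ℕ) → ℕ → ℕ → ℕ
lastIndex F m zero = 0
lastIndex F m (suc k) = if F (suc k) ≡ᵇ m then suc k else lastIndex F m k

lastIndex-≤ : ∀ F m k → lastIndex F m k ≤ k
lastIndex-≤ F m zero = z≤n
lastIndex-≤ F m (suc k) with F (suc k) ≡ᵇ m
... | true = ≤-refl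
... | false = m≤n⇒m≤1+n (lastIndex-≤ F m k)

lastIndex-maximal : ∀ F m k i → F i ≡ m → 1 ≤ i → i ≤ k → i ≤ lastIndex F m k
lastIndex-maximal F m zero i e a b = ⊥-elim (<-irrefl refl (≤-trans a b))
lastIndex-maximal F m (suc k) i e a b with F (suc k) ≡ᵇ m in ek
... | true = b
... | false with m≤n⇒m<n∨m≡n b
...   | inj₁ lt = lastIndex-maximal F m k i e a (≤-pred lt)
...   | inj₂ refl = ⊥-elim (≡ᵇ-false⇒≢ (F (suc k)) m ek e)

lastIndex-hit : ∀ F m k → 1 ≤ lastIndex F m k → F (lastIndex F m k) ≡ m
lastIndex-hit F m (suc k) p with F (suc k) ≡ᵇ m in ek
... | true = ≡ᵇ-true⇒≡ (F (suc k)) m ek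
... | false = lastIndex-hit F m k p

blockMaxStep : List ℕ → ℕ → ℕ → ℕ → ℕ
blockMaxStep g m i r = if at g i ≡ᵇ m then i ⊔ r else r

blockMax-foldr-step : ∀ g m k z → lastIndex (at g) m k ⊔ blockMaxStep g m (suc k) z
  ≡ lastIndex (at g) m (suc k) ⊔ z
blockMax-foldr-step g m k z with at g (suc k) ≡ᵇ m
... | true = trans (sym (⊔-assoc (lastIndex (at g) m k) (suc k) z))
  (cong (_⊔ z) (m≤n⇒m⊔n≡n (m≤n⇒m≤1+n (lastIndex-≤ (at g) m k))))
... | false = refl

blockMax-foldr : ∀ (g : List ℕ) m k z → foldr (blockMaxStep g m) z (range k)
  ≡ lastIndex (at g) m k ⊔ z
blockMax-foldr g m zero z = refl
blockMax-foldr g m (suc k) z = trans (cong (foldr (blockMaxStep g m) z) (range-suc k))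
  (trans (foldr-++ (blockMaxStep g m) z (range k) [ suc k ])
  (trans (blockMax-foldr g m k (blockMaxStep g m (suc k) z)) (blockMax-foldr-step g m k z)))

blockMax≡lastIndex : ∀ n g m → blockMax n g m ≡ lastIndex (at g) m n
blockMax≡lastIndex n g m = trans (blockMax-foldr g m n 0) (⊔-identityʳ _)

module Scan (f : List ℕ) where
  F : ℕ → ℕ
  F i = at f i

  isBlockMin : ℕ → Bool
  isBlockMin m = isMin f m

  isOpenAfter : ℕ → ℕ → Bool
  isOpenAfter j m = isBlockMin m ∧ elem m (drop j f)

  openBlocks : Discipline → ℕ → List ℕ
  openBlocks d j = select (isOpenAfter j) (pushAll d j)

  guardAt : Discipline → ℕ → Bool
  guardAt d j = guard d (suc j) (openBlocks d j) (F (suc j)) (drop (suc j) f)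

  guardsFrom : Discipline → ℕ → ℕ → Bool
  guardsFrom d zero j = true
  guardsFrom d (suc k) j = guardAt d j ∧ guardsFrom d k (suc j)

  isOpenAfter-suc : ∀ j → j < length f → ∀ m →
    ((F (suc j) ≡ᵇ m) ≡ true → elem m (drop (suc j) f) ≡ true) → isOpenAfter
      (suc j) m ≡ isOpenAfter j m
  isOpenAfter-suc j j<len m stays-open rewrite drop-at f j j<len with F (suc j) ≡ᵇ m in hit
  ... | false = refl
  ... | true rewrite stays-open refl = refl

  isOpenAfter-suc-new : ∀ d j → j < length f → F (suc j) ≡ suc j →
    ∀ m → elem m (pushAll d j) ≡ true → isOpenAfter (suc j) m ≡ isOpenAfter j m
  isOpenAfter-suc-new d j j<len new m m∈ = isOpenAfter-suc j j<len m (λ hit → ⊥-elim (<-irrefl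
    (trans (sym (≡ᵇ-true⇒≡ (F (suc j)) m hit)) new)
      (below-elem (suc j) (pushAll d j) m (below-pushAll d j) m∈)))

  next-openBlocks : ∀ d j → j < length f → guardAt d j ≡ true →
    next d (suc j) (openBlocks d j) (F (suc j)) (drop (suc j) f) ≡ openBlocks d (suc j)
  next-openBlocks d j j<len ok with F (suc j) ≡ᵇ suc j in new | elem (suc j)
    (drop (suc j) f) in reopened
  ... | true | true =
    trans (cong (push d (suc j))
      (sym (select-cong _ _ (pushAll d j)
      (isOpenAfter-suc-new d j j<len (≡ᵇ-true⇒≡ (F (suc j)) (suc j) new)))))
          (sym (select-push-true d (isOpenAfter (suc j)) (suc j) (pushAll d j)
            (∧-true⁺ new reopened)))
  ... | true | false =
    trans (sym (select-cong _ _ (pushAll d j)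
      (isOpenAfter-suc-new d j j<len (≡ᵇ-true⇒≡ (F (suc j)) (suc j) new))))
          (sym (select-push-false d (isOpenAfter (suc j)) (suc j) (pushAll d j)
            (trans (cong (isBlockMin (suc j) ∧_) reopened) (∧-zeroʳ _))))
  ... | false | _ with elem (F (suc j)) (drop (suc j) f) in continues
  ...   | true =
    trans (sym (select-cong _ _ (pushAll d j) (λ m _ → isOpenAfter-suc j j<len m still-open)))
          (sym (select-push-false d (isOpenAfter (suc j)) (suc j) (pushAll d j)
            (cong (_∧ elem (suc j) (drop (suc j) f)) new)))
    where
    still-open : ∀ {m} → (F (suc j) ≡ᵇ m) ≡ true → elem m (drop (suc j) f) ≡ true
    still-open {m} hit = subst (λ k → elem k (drop (suc j) f) ≡ true)
      (≡ᵇ-true⇒≡ (F (suc j)) m hit) continues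
  ...   | false =
    trans (sym (select-pop (F (suc j)) (isOpenAfter j) (isOpenAfter (suc j)) (pushAll d j)
      (distinct-pushAll d j) ok closed
                  (λ m _ m≢a → isOpenAfter-suc j j<len m
                    (λ hit → ⊥-elim (m≢a (sym (≡ᵇ-true⇒≡ (F (suc j)) m hit)))))))
          (sym (select-push-false d (isOpenAfter (suc j)) (suc j) (pushAll d j)
            (cong (_∧ elem (suc j) (drop (suc j) f)) new)))
    where
    closed : isOpenAfter (suc j) (F (suc j)) ≡ false
    closed = trans (cong (isBlockMin (F (suc j)) ∧_) continues) (∧-zeroʳ _)

  acceptsᵇ≡guardsFrom : ∀ d k j → j + k ≡ length f → acceptsᵇ d (suc j) (openBlocks d j) (drop j f)
    ≡ guardsFrom d k j
  acceptsᵇ≡guardsFrom d zero j e rewrite +-identityʳ j | e | drop-all (length f) f ≤-refl =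
    cong isEmptyᵇ (select-none (λ m → isBlockMin m ∧ false) (pushAll d (length f))
      (λ m → ∧-zeroʳ (isBlockMin m)))
  acceptsᵇ≡guardsFrom d (suc k) j e = trans
    (cong (acceptsᵇ d (suc j) (openBlocks d j)) (drop-at f j jl))
    (trans (acceptsᵇ-step d (suc j) (openBlocks d j) (F (suc j)) (drop (suc j) f))
    (step (guardAt d j) refl))
    where
    jl : j < length f
    jl = subst (j <_) e (m<m+n j (s≤s z≤n))
    step : ∀ c → guardAt d j ≡ c →
      c ∧ acceptsᵇ d (suc (suc j)) (next d (suc j) (openBlocks d j) (F (suc j)) (drop (suc j) f))
      (drop (suc j) f) ≡ c ∧ guardsFrom d k (suc j)
    step false _ = refl
    step true c rewrite next-openBlocks d j jl c = acceptsᵇ≡guardsFrom d k (suc j)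
      (trans (sym (+-suc j k)) e)

blockCondition : Discipline → ℕ → List ℕ → Bool
blockCondition queue = stronglyMonotone
blockCondition stack = nonOverlapping

module PartitionWord (f : List ℕ) (n : ℕ) (len : length f ≡ n) (rng : All (InRange n) f) where
  open Scan f

  maxOf : ℕ → ℕ
  maxOf m = lastIndex F m n

  F-inRange : ∀ i → 1 ≤ i → i ≤ n → (1 ≤ F i) × (F i ≤ n)
  F-inRange i a b = at-All f i rng a (subst (i ≤_) (sym len) b)

  occursAfter⁻ : ∀ j m → elem m (drop j f) ≡ true → Σ ℕ (λ i → j < i × i ≤ n × F i ≡ m)
  occursAfter⁻ j m e with elem-drop⇒occurs f j m e
  ... | (i , a , b , c) = i , a , subst (i ≤_) len b , c

  occursAfter⁺ : ∀ j m i → j < i → i ≤ n → F i ≡ m → elem m (drop j f) ≡ true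
  occursAfter⁺ j m i a b c = occurs⇒elem-drop f j m (i , a , subst (i ≤_) (sym len) b , c)

  maxOf-maximal : ∀ m i → F i ≡ m → 1 ≤ i → i ≤ n → i ≤ maxOf m
  maxOf-maximal m i e a b = lastIndex-maximal F m n i e a b

  maxOf-hit : ∀ m → 1 ≤ maxOf m → F (maxOf m) ≡ m
  maxOf-hit m p = lastIndex-hit F m n p

  maxOf-≤ : ∀ m → maxOf m ≤ n
  maxOf-≤ m = lastIndex-≤ F m n

  lastOccurrence⇒maxOf : ∀ t a → 1 ≤ t → t ≤ n → F t ≡ a → elem a (drop t f) ≡ false → maxOf a ≡ t
  lastOccurrence⇒maxOf t a p q e ne with <-cmp (maxOf a) t
  ... | tri< lt _ _ = ⊥-elim (<⇒≱ lt (maxOf-maximal a t e p q))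
  ... | tri≈ _ eq _ = eq
  ... | tri> _ _ gt = ⊥-elim
    (true-false-⊥ (occursAfter⁺ t a (maxOf a) gt (maxOf-≤ a)
    (maxOf-hit a (≤-trans (s≤s z≤n) gt))) ne)

  maxOf-≤-noLater : ∀ j m → 1 ≤ m → m ≤ n → F m ≡ m → elem m (drop j f) ≡ false → maxOf m ≤ j
  maxOf-≤-noLater j m p q fm ne with ≤-<-connex (maxOf m) j
  ... | inj₁ le = le
  ... | inj₂ gt = ⊥-elim
    (true-false-⊥ (occursAfter⁺ j m (maxOf m) gt (maxOf-≤ m)
    (maxOf-hit m (≤-trans p (maxOf-maximal m m fm p q)))) ne)

  IsPartitionWord : Set
  IsPartitionWord = ∀ i → 1 ≤ i → i ≤ n → (F i ≤ i) × (F (F i) ≡ F i)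

  IsStronglyMonotone : Set
  IsStronglyMonotone = ∀ m m' → 1 ≤ m → m' ≤ n → F m ≡ m → F m' ≡ m' → m < m' → maxOf m < maxOf m'

  IsNonOverlapping : Set
  IsNonOverlapping = ∀ m m' → 1 ≤ m → m' ≤ n → F m ≡ m → F m' ≡ m' → m < m' → m' < maxOf m → maxOf m < maxOf m' → ⊥

  Condition : Discipline → Set
  Condition queue = IsStronglyMonotone
  Condition stack = IsNonOverlapping

  occursLater : ∀ j m → F (suc j) ≢ m → elem m (drop j f) ≡ true →
    Σ ℕ (λ i → suc j < i × i ≤ n × F i ≡ m)
  occursLater j m ne e with occursAfter⁻ j m e
  ... | (i , a , b , c) with m≤n⇒m<n∨m≡n a
  ...   | inj₁ lt = i , lt , b , c
  ...   | inj₂ refl = ⊥-elim (ne c)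

  isBlockMin-true : ∀ m → F m ≡ m → isBlockMin m ≡ true
  isBlockMin-true m e = subst (λ z → (z ≡ᵇ m) ≡ true) (sym e) (≡ᵇ-refl m)

  open⇒min : ∀ j m → isOpenAfter j m ≡ true → F m ≡ m
  open⇒min j m is-open = ≡ᵇ-true⇒≡ (F m) m (∧-true⁻ˡ (isBlockMin m) is-open)

  open⇒outlives : ∀ j m → F (suc j) ≢ m → isOpenAfter j m ≡ true → suc j < maxOf m
  open⇒outlives j m a≢m is-open with occursLater j m a≢m (∧-true⁻ʳ (isBlockMin m) is-open)
  ... | i , j+1<i , i≤n , Fi≡m = <-≤-trans j+1<i
    (maxOf-maximal m i Fi≡m (≤-trans (s≤s z≤n) j+1<i) i≤n)

  closed⇒maxOf≤ : ∀ j m → 1 ≤ m → m ≤ n → F m ≡ m → isOpenAfter j m ≡ false → maxOf m ≤ j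
  closed⇒maxOf≤ j m 1≤m m≤n min closed =
    maxOf-≤-noLater j m 1≤m m≤n min
      (subst (λ b → (b ∧ elem m (drop j f)) ≡ false) (isBlockMin-true m min) closed)

  earlier-min : IsPartitionWord → ∀ j → suc j ≤ n → F (suc j) ≢ suc j →
                (1 ≤ F (suc j)) × (F (suc j) ≤ j) × (F (F (suc j)) ≡ F (suc j))
  earlier-min pw j j<n old =
    proj₁ (F-inRange (suc j) (s≤s z≤n) j<n) ,
    ≤-pred (≤∧≢⇒< (proj₁ (pw (suc j) (s≤s z≤n) j<n)) old) ,
    proj₂ (pw (suc j) (s≤s z≤n) j<n)

  earlier-open : ∀ j → suc j ≤ n → F (F (suc j)) ≡ F (suc j) → isOpenAfter j (F (suc j)) ≡ true
  earlier-open j j<n min = ∧-true⁺ (isBlockMin-true _ min)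
    (occursAfter⁺ j (F (suc j)) (suc j) ≤-refl j<n refl)

  singleton-allowed : ∀ d → Condition d → ∀ j → suc j ≤ n → F (suc j) ≡ suc j →
                      elem (suc j) (drop (suc j) f) ≡ false → singletonOkᵇ d (openBlocks d j) ≡ true
  singleton-allowed stack _ _ _ _ _ = refl
  singleton-allowed queue monotone j j<n new last =
    isEmpty⇒singletonOk (openBlocks queue j)
      (isEmpty-select-pushAll⁺ queue (isOpenAfter j) j (λ m 1≤m m≤j → ¬true⇒false (λ is-open →
        <-asym (open⇒outlives j m (λ a≡m → <-irrefl (trans (sym a≡m) new) (s≤s m≤j)) is-open)
               (subst (maxOf m <_) maxOf-new
                      (monotone m (suc j) 1≤m j<n (open⇒min j m is-open) new (s≤s m≤j))))))
    where
    maxOf-new : maxOf (suc j) ≡ suc j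
    maxOf-new = lastOccurrence⇒maxOf (suc j) (suc j) (s≤s z≤n) j<n new last

  closing-at-head : ∀ d → Condition d → IsPartitionWord → ∀ j → suc j ≤ n → F (suc j) ≢ suc j →
                    elem (F (suc j)) (drop (suc j) f) ≡ false → atHeadᵇ (F (suc j))
                      (openBlocks d j) ≡ true
  closing-at-head d cond pw j j<n old last = at-head d cond
    where
    ℓ : ℕ
    ℓ = F (suc j)
    facts : (1 ≤ ℓ) × (ℓ ≤ j) × (F ℓ ≡ ℓ)
    facts = earlier-min pw j j<n old
    1≤ℓ : 1 ≤ ℓ
    1≤ℓ = proj₁ facts
    ℓ≤j : ℓ ≤ j
    ℓ≤j = proj₁ (proj₂ facts)
    ℓ-min : F ℓ ≡ ℓ
    ℓ-min = proj₂ (proj₂ facts)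
    ℓ≤n : ℓ ≤ n
    ℓ≤n = ≤-trans ℓ≤j (≤-trans (n≤1+n j) j<n)
    maxOf-ℓ : maxOf ℓ ≡ suc j
    maxOf-ℓ = lastOccurrence⇒maxOf (suc j) ℓ (s≤s z≤n) j<n refl last
    at-head : ∀ d → Condition d → atHeadᵇ ℓ (openBlocks d j) ≡ true
    at-head queue monotone =
      atHead-queue⁺ (isOpenAfter j) j ℓ 1≤ℓ ℓ≤j (earlier-open j j<n ℓ-min)
        (λ m 1≤m m<ℓ → ¬true⇒false (λ is-open →
        <-asym (open⇒outlives j m (λ ℓ≡m → <-irrefl (sym ℓ≡m) m<ℓ) is-open)
               (subst (maxOf m <_) maxOf-ℓ
                 (monotone m ℓ 1≤m ℓ≤n (open⇒min j m is-open) ℓ-min m<ℓ))))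
    at-head stack nonOverlapping =
      atHead-stack⁺ (isOpenAfter j) j ℓ 1≤ℓ ℓ≤j (earlier-open j j<n ℓ-min)
        (λ m ℓ<m m≤j → ¬true⇒false (λ is-open →
        nonOverlapping ℓ m 1≤ℓ (≤-trans m≤j (≤-trans (n≤1+n j) j<n)) ℓ-min
          (open⇒min j m is-open) ℓ<m
          (subst (m <_) (sym maxOf-ℓ) (s≤s m≤j))
          (subst (_< maxOf m) (sym maxOf-ℓ)
            (open⇒outlives j m (λ ℓ≡m → <-irrefl ℓ≡m ℓ<m) is-open))))

  guards-hold : ∀ d → Condition d → IsPartitionWord → ∀ j → j < n → guardAt d j ≡ true
  guards-hold d cond pw j j<n with F (suc j) ≡ᵇ suc j in new
  ... | true with elem (suc j) (drop (suc j) f) in stays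
  ...   | true = refl
  ...   | false = singleton-allowed d cond j j<n (≡ᵇ-true⇒≡ (F (suc j)) (suc j) new) stays
  guards-hold d cond pw j j<n | false with elem (F (suc j)) (drop (suc j) f) in continues
  ... | true =
    let (1≤a , a≤j , a-min) = earlier-min pw j j<n (≡ᵇ-false⇒≢ (F (suc j)) (suc j) new)
    in elem-select-pushAll⁺ d (isOpenAfter j) j (F (suc j)) 1≤a a≤j (earlier-open j j<n a-min)
  ... | false = closing-at-head d cond pw j j<n (≡ᵇ-false⇒≢ (F (suc j)) (suc j) new) continues

  guard-join : ∀ d t q a s → (a ≡ᵇ t) ≡ false → guard d t q a s ≡ true → elem a q ≡ true
  guard-join d t q a s e c rewrite e with elem a s
  ... | true = c
  ... | false = atHead⇒elem a q c

  guard-close : ∀ d t q a s → (a ≡ᵇ t) ≡ false → elem a s ≡ false → guard d t q a s ≡ true →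
    atHeadᵇ a q ≡ true
  guard-close d t q a s e e2 c rewrite e | e2 = c

  guard-singleton : ∀ d t q a s → (a ≡ᵇ t) ≡ true → elem t s ≡ false → guard d t q a s ≡ true →
    singletonOkᵇ d q ≡ true
  guard-singleton d t q a s e e2 c rewrite e | e2 = c

  Guards : Discipline → Set
  Guards d = ∀ j → j < n → guardAt d j ≡ true

  guards⇒isPartitionWord : ∀ d → Guards d → IsPartitionWord
  guards⇒isPartitionWord d guards (suc j) _ j<n with F (suc j) ≡ᵇ suc j in new
  ... | true = ≤-reflexive (≡ᵇ-true⇒≡ (F (suc j)) (suc j) new) , cong F
    (≡ᵇ-true⇒≡ (F (suc j)) (suc j) new)
  ... | false with elem-select-pushAll⁻ d (isOpenAfter j) j (F (suc j))
                     (guard-join d (suc j) (openBlocks d j) (F (suc j)) (drop (suc j) f) new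
                       (guards j j<n))
  ...   | (_ , a≤j , is-open) = m≤n⇒m≤1+n a≤j , open⇒min j (F (suc j)) is-open

  no-occurrence-after-max : ∀ m → elem m (drop (maxOf m) f) ≡ false
  no-occurrence-after-max m = ¬true⇒false (λ e →
    let (i , max<i , i≤n , Fi≡m) = occursAfter⁻ (maxOf m) m e
    in <⇒≱ max<i (maxOf-maximal m i Fi≡m (≤-trans (s≤s z≤n) max<i) i≤n))

  ClosingStep : ℕ → Set
  ClosingStep m = Σ ℕ (λ j → (maxOf m ≡ suc j) × (j < n) × (F (suc j) ≡ m) ×
    (elem m (drop (suc j) f) ≡ false))

  closingStep : ∀ m → 1 ≤ maxOf m → ClosingStep m
  closingStep m 1≤max with maxOf m in max≡ | maxOf-hit m 1≤max | maxOf-≤ m | no-occurrence-after-max m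
  ... | suc j | hit | max≤n | last = j , refl , max≤n , hit , last
  ... | zero | _ | _ | _ = ⊥-elim (<⇒≱ 1≤max (≤-reflexive max≡))

  guards⇒stronglyMonotone : Guards queue → IsStronglyMonotone
  guards⇒stronglyMonotone guards m m′ 1≤m m′≤n min min′ m<m′
    with closingStep m′ (≤-trans (≤-trans 1≤m (<⇒≤ m<m′))
      (maxOf-maximal m′ m′ min′ (≤-trans 1≤m (<⇒≤ m<m′)) m′≤n))
  ... | j , max′≡ , j<n , Fj≡m′ , last =
    subst (maxOf m <_) (sym max′≡)
      (s≤s (closed⇒maxOf≤ j m 1≤m (≤-trans (<⇒≤ m<m′) m′≤n) min
      (m-closed (F (suc j) ≡ᵇ suc j) refl)))
    where
    m≤j : m ≤ j
    m≤j = ≤-pred (<-≤-trans m<m′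
      (subst (m′ ≤_) max′≡ (maxOf-maximal m′ m′ min′ (≤-trans 1≤m (<⇒≤ m<m′)) m′≤n)))
    guard-ok : guardAt queue j ≡ true
    guard-ok = guards j j<n
    m-closed : ∀ b → (F (suc j) ≡ᵇ suc j) ≡ b → isOpenAfter j m ≡ false
    m-closed true new =
      isEmpty-select-pushAll⁻ queue (isOpenAfter j) j
        (singletonOk⇒isEmpty (openBlocks queue j)
          (guard-singleton queue (suc j) (openBlocks queue j) (F (suc j)) (drop (suc j) f) new
            (subst (λ k → elem k (drop (suc j) f) ≡ false)
              (trans (sym Fj≡m′) (≡ᵇ-true⇒≡ _ _ new)) last) guard-ok))
        m 1≤m m≤j
    m-closed false old =
      atHead-queue⁻ (isOpenAfter j) j (F (suc j))
        (guard-close queue (suc j) (openBlocks queue j) (F (suc j)) (drop (suc j) f) old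
          (subst (λ k → elem k (drop (suc j) f) ≡ false) (sym Fj≡m′) last) guard-ok)
        m 1≤m (subst (m <_) (sym Fj≡m′) m<m′)

  guards⇒nonOverlapping : Guards stack → IsNonOverlapping
  guards⇒nonOverlapping guards m m′ 1≤m m′≤n min min′ m<m′ m′<max max<max′
    with closingStep m (≤-trans (s≤s z≤n) m′<max)
  ... | j , max≡ , j<n , Fj≡m , last = true-false-⊥ m′-open
    (atHead-stack⁻ (isOpenAfter j) j m m-at-head m′ m<m′ m′≤j)
    where
    m′≤j : m′ ≤ j
    m′≤j = ≤-pred (subst (m′ <_) max≡ m′<max)
    m≢j+1 : (F (suc j) ≡ᵇ suc j) ≡ false
    m≢j+1 = ≢⇒≡ᵇ-false (F (suc j)) (suc j)
      (λ e → <-irrefl (trans (sym Fj≡m) e) (<-≤-trans m<m′ (m≤n⇒m≤1+n m′≤j)))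
    m-at-head : atHeadᵇ m (openBlocks stack j) ≡ true
    m-at-head = subst (λ k → atHeadᵇ k (openBlocks stack j) ≡ true) Fj≡m
      (guard-close stack (suc j) (openBlocks stack j) (F (suc j)) (drop (suc j) f) m≢j+1
        (subst (λ k → elem k (drop (suc j) f) ≡ false) (sym Fj≡m) last) (guards j j<n))
    m′-open : isOpenAfter j m′ ≡ true
    m′-open = ∧-true⁺ (isBlockMin-true m′ min′)
      (occursAfter⁺ j m′ (maxOf m′) (<-trans (subst (j <_) (sym max≡) ≤-refl) max<max′) (maxOf-≤ m′)
        (maxOf-hit m′ (≤-trans (s≤s z≤n) max<max′)))

  guardsFrom⁻ : ∀ d k j → guardsFrom d k j ≡ true → ∀ i → j ≤ i → i < j + k → guardAt d i ≡ true
  guardsFrom⁻ d zero j e i a b = ⊥-elim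
    (<-irrefl refl (<-≤-trans b (≤-trans (≤-reflexive (+-identityʳ j)) a)))
  guardsFrom⁻ d (suc k) j e i a b with m≤n⇒m<n∨m≡n a
  ... | inj₂ refl = ∧-true⁻ˡ (guardAt d i) e
  ... | inj₁ lt = guardsFrom⁻ d k (suc j) (∧-true⁻ʳ (guardAt d j) e) i lt
    (subst (i <_) (+-suc j k) b)

  guardsFrom⁺ : ∀ d k j → (∀ i → j ≤ i → i < j + k → guardAt d i ≡ true) → guardsFrom d k j ≡ true
  guardsFrom⁺ d zero j h = refl
  guardsFrom⁺ d (suc k) j h = ∧-true⁺ (h j ≤-refl (m<m+n j (s≤s z≤n)))
    (guardsFrom⁺ d k (suc j) (λ i a b → h i (<⇒≤ a) (subst (i <_) (sym (+-suc j k)) b)))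

  blockMax≡maxOf : ∀ m → blockMax n f m ≡ maxOf m
  blockMax≡maxOf m = blockMax≡lastIndex n f m

  isPartitionWordᵇ⁻ : isPartitionWord n f ≡ true → IsPartitionWord
  isPartitionWordᵇ⁻ e i 1≤i i≤n =
    let (Fi≤i , FFi≡Fi) = ∧-true⁻ (at f i ≤ᵇ i) (allᵇ-range⁻ _ n e i 1≤i i≤n)
    in ≤ᵇ-true⇒≤ _ _ Fi≤i , ≡ᵇ-true⇒≡ _ _ FFi≡Fi

  isPartitionWordᵇ⁺ : IsPartitionWord → isPartitionWord n f ≡ true
  isPartitionWordᵇ⁺ pw = allᵇ-range⁺ _ n (λ i 1≤i i≤n →
    let (Fi≤i , FFi≡Fi) = pw i 1≤i i≤n
    in ∧-true⁺ (≤⇒≤ᵇ-true _ _ Fi≤i) (subst (λ z → (F (F i) ≡ᵇ z) ≡ true) FFi≡Fi (≡ᵇ-refl (F (F i)))))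

  monotonePair nonOverlappingPair : ℕ → ℕ → Bool
  monotonePair m m′ = not (isMin f m ∧ isMin f m′ ∧ (m <ᵇ m′)) ∨ (blockMax n f m <ᵇ blockMax n f m′)
  nonOverlappingPair m m′ =
    not (isMin f m ∧ isMin f m′ ∧ (m <ᵇ m′) ∧ (m′ <ᵇ blockMax n f m) ∧ (blockMax n f m <ᵇ blockMax n f m′))

  stronglyMonotoneᵇ⁻ : stronglyMonotone n f ≡ true → IsStronglyMonotone
  stronglyMonotoneᵇ⁻ e m m′ 1≤m m′≤n min min′ m<m′ =
    subst₂ _<_ (blockMax≡maxOf m) (blockMax≡maxOf m′)
      (<ᵇ-true⇒< _ _ (not∨-true⁻ _ _ (allᵇ-range²⁻ monotonePair n e m m′ 1≤m m≤n 1≤m′ m′≤n)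
        (∧-true⁺ (isBlockMin-true m min) (∧-true⁺ (isBlockMin-true m′ min′) (<⇒<ᵇ-true m m′ m<m′)))))
    where
    1≤m′ : 1 ≤ m′
    1≤m′ = ≤-trans 1≤m (<⇒≤ m<m′)
    m≤n : m ≤ n
    m≤n = ≤-trans (<⇒≤ m<m′) m′≤n

  stronglyMonotoneᵇ⁺ : IsStronglyMonotone → stronglyMonotone n f ≡ true
  stronglyMonotoneᵇ⁺ monotone = allᵇ-range²⁺ monotonePair n (λ m m′ 1≤m _ _ m′≤n → not∨-true⁺ _ _ (λ mins →
    let (min , rest) = ∧-true⁻ (isBlockMin m) mins
        (min′ , m<m′) = ∧-true⁻ (isBlockMin m′) rest
    in <⇒<ᵇ-true _ _ (subst₂ _<_ (sym (blockMax≡maxOf m)) (sym (blockMax≡maxOf m′))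
         (monotone m m′ 1≤m m′≤n (≡ᵇ-true⇒≡ _ _ min) (≡ᵇ-true⇒≡ _ _ min′) (<ᵇ-true⇒< _ _ m<m′)))))

  nonOverlappingᵇ⁻ : nonOverlapping n f ≡ true → IsNonOverlapping
  nonOverlappingᵇ⁻ e m m′ 1≤m m′≤n min min′ m<m′ m′<max max<max′ =
    not-true⁻ _ (allᵇ-range²⁻ nonOverlappingPair n e m m′ 1≤m m≤n 1≤m′ m′≤n)
      (∧-true⁺ (isBlockMin-true m min) (∧-true⁺ (isBlockMin-true m′ min′) (∧-true⁺ (<⇒<ᵇ-true m m′ m<m′)
        (∧-true⁺ (<⇒<ᵇ-true _ _ (subst (m′ <_) (sym (blockMax≡maxOf m)) m′<max))
                 (<⇒<ᵇ-true _ _ (subst₂ _<_ (sym (blockMax≡maxOf m)) (sym (blockMax≡maxOf m′)) max<max′))))))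
    where
    1≤m′ : 1 ≤ m′
    1≤m′ = ≤-trans 1≤m (<⇒≤ m<m′)
    m≤n : m ≤ n
    m≤n = ≤-trans (<⇒≤ m<m′) m′≤n

  nonOverlappingᵇ⁺ : IsNonOverlapping → nonOverlapping n f ≡ true
  nonOverlappingᵇ⁺ nonOverlap = allᵇ-range²⁺ nonOverlappingPair n (λ m m′ 1≤m _ _ m′≤n → not-true⁺ _ (λ overlapping →
    let (min , rest₁) = ∧-true⁻ (isBlockMin m) overlapping
        (min′ , rest₂) = ∧-true⁻ (isBlockMin m′) rest₁
        (m<m′ , rest₃) = ∧-true⁻ (m <ᵇ m′) rest₂
        (m′<max , max<max′) = ∧-true⁻ (m′ <ᵇ blockMax n f m) rest₃
    in nonOverlap m m′ 1≤m m′≤n (≡ᵇ-true⇒≡ _ _ min) (≡ᵇ-true⇒≡ _ _ min′) (<ᵇ-true⇒< _ _ m<m′)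
         (subst (m′ <_) (blockMax≡maxOf m) (<ᵇ-true⇒< _ _ m′<max))
         (subst₂ _<_ (blockMax≡maxOf m) (blockMax≡maxOf m′) (<ᵇ-true⇒< _ _ max<max′))))

  blockConditionᵇ⁻ : ∀ d → blockCondition d n f ≡ true → Condition d
  blockConditionᵇ⁻ queue = stronglyMonotoneᵇ⁻
  blockConditionᵇ⁻ stack = nonOverlappingᵇ⁻

  blockConditionᵇ⁺ : ∀ d → Condition d → blockCondition d n f ≡ true
  blockConditionᵇ⁺ queue = stronglyMonotoneᵇ⁺
  blockConditionᵇ⁺ stack = nonOverlappingᵇ⁺

  guards⇒condition : ∀ d → Guards d → Condition d
  guards⇒condition queue = guards⇒stronglyMonotone
  guards⇒condition stack = guards⇒nonOverlapping

  acceptsᵇ-correct : ∀ d → acceptsᵇ d 1 [] f ≡ (isPartitionWord n f ∧ blockCondition d n f)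
  acceptsᵇ-correct d = trans (acceptsᵇ≡guardsFrom d n 0 (sym len)) (bool-ext sound complete)
    where
    sound : guardsFrom d n 0 ≡ true → (isPartitionWord n f ∧ blockCondition d n f) ≡ true
    sound e = ∧-true⁺ (isPartitionWordᵇ⁺ (guards⇒isPartitionWord d guards)) (blockConditionᵇ⁺ d (guards⇒condition d guards))
      where
      guards : Guards d
      guards j j<n = guardsFrom⁻ d n 0 e j z≤n j<n
    complete : (isPartitionWord n f ∧ blockCondition d n f) ≡ true → guardsFrom d n 0 ≡ true
    complete e = let (pw , cond) = ∧-true⁻ (isPartitionWord n f) e
                 in guardsFrom⁺ d n 0 (λ j _ j<n → guards-hold d (blockConditionᵇ⁻ d cond) (isPartitionWordᵇ⁻ pw) j j<n)

count≡walks : ∀ d n → count (blockCondition d n) (partitions n) ≡ walks d 0 n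
count≡walks d n = begin
  count (blockCondition d n) (partitions n)
    ≡⟨ count-filterᵇ (isPartitionWord n) (blockCondition d n) (words n n) ⟩
  sumMap (λ f → ind (isPartitionWord n f ∧ blockCondition d n f)) (words n n)
    ≡⟨ sumMap-words-cong n n _ _ accepted ⟩
  acceptedWords n d 1 [] n
    ≡⟨ acceptedWords≡walks n d n 1 [] ≤-refl ≤-refl [] ⟩
  walks d 0 n ∎
  where
  open ≡-Reasoning
  accepted : ∀ f → IsWord n n f → ind (isPartitionWord n f ∧ blockCondition d n f)
    ≡ accepts d 1 [] f
  accepted f (len , f∈) = trans (cong ind (sym (PartitionWord.acceptsᵇ-correct f n len f∈ d)))
                                (sym (accepts≡acceptsᵇ d f 1 [] [] tt))

a≡walks : ∀ n → a n ≡ walks queue 0 n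
a≡walks = count≡walks queue

B*≡walks : ∀ n → B* n ≡ walks stack 0 n
B*≡walks = count≡walks stack

-- The recurrence and the generating function

queueWalks : ℕ → ℕ
queueWalks = walks queue 0

regroup-firstPassage : ∀ a b c d → a + (b + c + d) ≡ b + c + (a + d)
regroup-firstPassage = solve-∀

-- Until its first return to height 0 a queue walk from height h + 1 has the step weights of a
-- stack walk from height h.
walks-firstPassage : ∀ n h → walks queue (suc h) (suc n) ≡ conv (walks stack h) queueWalks n
walks-firstPassage zero zero = refl
walks-firstPassage zero (suc h) rewrite *-zeroʳ h = refl
walks-firstPassage (suc n) h = sym (begin
  conv (S h) Q₀ (suc n)
    ≡⟨ conv-suc (S h) Q₀ n ⟩
  S h 0 * Q₀ (suc n) + conv (S h ∘ suc) Q₀ n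
    ≡⟨ cong (S h 0 * Q₀ (suc n) +_) <-+-suced ⟩
  S h 0 * Q₀ (suc n) +
    (suc h * Q (suc h) (suc n) + Q (suc (suc h)) (suc n) + conv (walksDown stack h) Q₀ n)
    ≡⟨ regroup-firstPassage (S h 0 * Q₀ (suc n)) (suc h * Q (suc h) (suc n))
      (Q (suc (suc h)) (suc n))
                            (conv (walksDown stack h) Q₀ n) ⟩
  suc h * Q (suc h) (suc n) + Q (suc (suc h)) (suc n) +
    (S h 0 * Q₀ (suc n) + conv (walksDown stack h) Q₀ n)
    ≡⟨ cong (suc h * Q (suc h) (suc n) + Q (suc (suc h)) (suc n) +_) (firstStepDown h) ⟩
  Q (suc h) (suc (suc n)) ∎)
  where
  open ≡-Reasoning
  S Q : ℕ → ℕ → ℕ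
  S = walks stack
  Q = walks queue
  Q₀ : ℕ → ℕ
  Q₀ = queueWalks
  <-+-suced : conv (S h ∘ suc) Q₀ n
            ≡ suc h * Q (suc h) (suc n) + Q (suc (suc h)) (suc n) + conv (walksDown stack h) Q₀ n
  <-+-suced = begin
    conv (λ k → suc h * S h k + S (suc h) k + walksDown stack h k) Q₀ n
      ≡⟨ conv-+ (λ k → suc h * S h k + S (suc h) k) (walksDown stack h) Q₀ n ⟩
    conv (λ k → suc h * S h k + S (suc h) k) Q₀ n + conv (walksDown stack h) Q₀ n
      ≡⟨ cong (_+ conv (walksDown stack h) Q₀ n) (conv-+ (λ k → suc h * S h k) (S (suc h)) Q₀ n) ⟩
    conv (λ k → suc h * S h k) Q₀ n + conv (S (suc h)) Q₀ n + conv (walksDown stack h) Q₀ n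
      ≡⟨ cong₂ (λ x y → x + y + conv (walksDown stack h) Q₀ n)
               (trans (conv-* (suc h) (S h) Q₀ n) (cong (suc h *_) (sym (walks-firstPassage n h))))
               (sym (walks-firstPassage n (suc h))) ⟩
    suc h * Q (suc h) (suc n) + Q (suc (suc h)) (suc n) + conv (walksDown stack h) Q₀ n ∎
  firstStepDown : ∀ h → S h 0 * Q₀ (suc n) + conv (walksDown stack h) Q₀ n
    ≡ walksDown queue (suc h) (suc n)
  firstStepDown zero =
    trans (cong (Q₀ (suc n) + 0 +_) (conv-zero Q₀ n)) (trans (+-identityʳ _) (+-identityʳ _))
  firstStepDown (suc h) = sym (walks-firstPassage n h)

queueWalks-recurrence : ∀ m → queueWalks (suc (suc m))
  ≡ queueWalks (suc m) + conv queueWalks (walks stack 0) m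
queueWalks-recurrence m = begin
  1 * queueWalks (suc m) + walks queue 1 (suc m) + 0
    ≡⟨ +-identityʳ _ ⟩
  1 * queueWalks (suc m) + walks queue 1 (suc m)
    ≡⟨ cong₂ _+_ (*-identityˡ (queueWalks (suc m)))
                 (trans (walks-firstPassage m 0) (conv-comm (walks stack 0) queueWalks m)) ⟩
  queueWalks (suc m) + conv queueWalks (walks stack 0) m ∎
  where open ≡-Reasoning

a-recurrence : ∀ m → a (suc (suc m)) ≡ a (suc m) + conv a B* m
a-recurrence m = begin
  a (suc (suc m))                                   ≡⟨ a≡walks (suc (suc m)) ⟩
  queueWalks (suc (suc m))                          ≡⟨ queueWalks-recurrence m ⟩
  queueWalks (suc m) + conv queueWalks (walks stack 0) m
    ≡⟨ sym (cong₂ _+_ (a≡walks (suc m))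
                      (sumBelow-cong (suc m) (λ i _ → cong₂ _*_ (a≡walks i) (B*≡walks (m ∸ i))))) ⟩
  a (suc m) + conv a B* m                           ∎
  where open ≡-Reasoning

sumℤ : (ℕ → ℤ) → ℕ → ℤ
sumℤ g n = foldr ℤ._+_ 0ℤ (map g (upTo n))

sumℤ-suc-left : ∀ g n → sumℤ g (suc n) ≡ g 0 ℤ.+ sumℤ (g ∘ suc) n
sumℤ-suc-left g n =
  cong (λ xs → g 0 ℤ.+ foldr ℤ._+_ 0ℤ xs)
       (trans (map-applyUpTo suc g n) (sym (map-applyUpTo id (g ∘ suc) n)))

sumℤ-suc : ∀ g n → sumℤ g (suc n) ≡ sumℤ g n ℤ.+ g n
sumℤ-suc g zero = trans (ℤP.+-identityʳ (g 0)) (sym (ℤP.+-identityˡ (g 0)))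
sumℤ-suc g (suc n) = begin
  sumℤ g (suc (suc n))                        ≡⟨ sumℤ-suc-left g (suc n) ⟩
  g 0 ℤ.+ sumℤ (g ∘ suc) (suc n)              ≡⟨ cong (λ z → g 0 ℤ.+ z) (sumℤ-suc (g ∘ suc) n) ⟩
  g 0 ℤ.+ (sumℤ (g ∘ suc) n ℤ.+ g (suc n))    ≡⟨ sym (ℤP.+-assoc (g 0) _ _) ⟩
  g 0 ℤ.+ sumℤ (g ∘ suc) n ℤ.+ g (suc n)      ≡⟨ cong (ℤ._+ g (suc n)) (sym (sumℤ-suc-left g n)) ⟩
  sumℤ g (suc n) ℤ.+ g (suc n)                ∎
  where open ≡-Reasoning

sumℤ-cong : ∀ {g h} n → (∀ i → i < n → g i ≡ h i) → sumℤ g n ≡ sumℤ h n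
sumℤ-cong zero e = refl
sumℤ-cong {g} {h} (suc n) e =
  trans (sumℤ-suc g n)
        (trans (cong₂ ℤ._+_ (sumℤ-cong n (λ i i<n → e i (m<n⇒m<1+n i<n))) (e n ≤-refl))
               (sym (sumℤ-suc h n)))

sumℤ-ofℕ : ∀ g n → sumℤ (λ i → ℤ.+ g i) n ≡ ℤ.+ sumBelow g n
sumℤ-ofℕ g zero = refl
sumℤ-ofℕ g (suc n) =
  trans (sumℤ-suc _ n)
        (trans (cong (ℤ._+ ℤ.+ g n) (sumℤ-ofℕ g n)) (sym (ℤP.pos-+ (sumBelow g n) (g n))))

sumℤ-neg : ∀ g n → sumℤ (λ i → ℤ.- g i) n ≡ ℤ.- sumℤ g n
sumℤ-neg g zero = refl
sumℤ-neg g (suc n) =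
  trans (sumℤ-suc _ n)
        (trans (cong (ℤ._+ ℤ.- g n) (sumℤ-neg g n))
               (trans (sym (ℤP.neg-distrib-+ (sumℤ g n) (g n))) (cong ℤ.-_ (sym (sumℤ-suc g n)))))

sumℤ-zero : ∀ g n → (∀ i → i < n → g i ≡ 0ℤ) → sumℤ g n ≡ 0ℤ
sumℤ-zero g zero _ = refl
sumℤ-zero g (suc n) e =
  trans (sumℤ-suc g n)
        (cong₂ ℤ._+_ (sumℤ-zero g n (λ i i<n → e i (m<n⇒m<1+n i<n))) (e n ≤-refl))

x²-coeff-high : ∀ k → (𝕩 ⊛ 𝕩) (suc (suc (suc k))) ≡ 0ℤ
x²-coeff-high k =
  sumℤ-zero (λ i → 𝕩 i ℤ.* 𝕩 (suc (suc (suc k)) ∸ i)) (suc (suc (suc (suc k)))) vanishes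
  where
  vanishes : ∀ i → i < suc (suc (suc (suc k))) → 𝕩 i ℤ.* 𝕩 (suc (suc (suc k)) ∸ i) ≡ 0ℤ
  vanishes zero _ = refl
  vanishes (suc zero) _ = refl
  vanishes (suc (suc i)) _ = refl

x²⊛-coeff : ∀ c m → (𝕩 ⊛ 𝕩 ⊛ ofℕ c) (suc (suc m)) ≡ ℤ.+ c m
x²⊛-coeff c m = begin
  sumℤ term (suc (suc (suc m)))
    ≡⟨ sumℤ-suc-left term (suc (suc m)) ⟩
  0ℤ ℤ.+ sumℤ (term ∘ suc) (suc (suc m))
    ≡⟨ ℤP.+-identityˡ _ ⟩
  sumℤ (term ∘ suc) (suc (suc m))
    ≡⟨ sumℤ-suc-left (term ∘ suc) (suc m) ⟩
  0ℤ ℤ.+ sumℤ (term ∘ suc ∘ suc) (suc m)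
    ≡⟨ ℤP.+-identityˡ _ ⟩
  sumℤ (term ∘ suc ∘ suc) (suc m)
    ≡⟨ sumℤ-suc-left (term ∘ suc ∘ suc) m ⟩
  term 2 ℤ.+ sumℤ (term ∘ suc ∘ suc ∘ suc) m
    ≡⟨ cong (λ z → term 2 ℤ.+ z) (sumℤ-zero (term ∘ suc ∘ suc ∘ suc) m
                            (λ i _ → cong (ℤ._* ℤ.+ c (m ∸ suc i)) (x²-coeff-high i))) ⟩
  term 2 ℤ.+ 0ℤ
    ≡⟨ trans (ℤP.+-identityʳ _) (ℤP.*-identityˡ _) ⟩
  ℤ.+ c m ∎
  where
  open ≡-Reasoning
  term : ℕ → ℤ
  term i = (𝕩 ⊛ 𝕩) i ℤ.* ℤ.+ c (suc (suc m) ∸ i)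

recurrence⇒inverse : ∀ (a b : ℕ → ℕ) → a 0 ≡ 1 → a 1 ≡ 1 →
  (∀ m → a (suc (suc m)) ≡ a (suc m) + conv a b m) →
  ∀ n → (ofℕ a ⊛ (𝟙 ⊖ 𝕩 ⊖ 𝕩 ⊛ 𝕩 ⊛ ofℕ b)) n ≡ 𝟙 n
recurrence⇒inverse a b a₀ a₁ rec zero rewrite a₀ = refl
recurrence⇒inverse a b a₀ a₁ rec (suc zero) rewrite a₀ | a₁ = refl
recurrence⇒inverse a b a₀ a₁ rec (suc (suc m)) = begin
  sumℤ term (suc (suc (suc m)))
    ≡⟨ sumℤ-suc term (suc (suc m)) ⟩
  sumℤ term (suc (suc m)) ℤ.+ term (suc (suc m))
    ≡⟨ cong (ℤ._+ term (suc (suc m))) (sumℤ-suc term (suc m)) ⟩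
  sumℤ term (suc m) ℤ.+ term (suc m) ℤ.+ term (suc (suc m))
    ≡⟨ cong₂ ℤ._+_ (cong₂ ℤ._+_ low-terms middle-term) last-term ⟩
  ℤ.- ℤ.+ conv a b m ℤ.+ ℤ.- ℤ.+ a (suc m) ℤ.+ ℤ.+ (a (suc m) + conv a b m)
    ≡⟨ cancel (a (suc m)) (conv a b m) ⟩
  0ℤ ∎
  where
  open ≡-Reasoning
  g : Series
  g = 𝟙 ⊖ 𝕩 ⊖ 𝕩 ⊛ 𝕩 ⊛ ofℕ b
  term : ℕ → ℤ
  term i = ℤ.+ a i ℤ.* g (suc (suc m) ∸ i)
  g-high : ∀ k → g (suc (suc k)) ≡ ℤ.- ℤ.+ b k
  g-high k = trans (ℤP.+-identityˡ _) (cong ℤ.-_ (x²⊛-coeff b k))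
  low-term : ∀ i → i < suc m → term i ≡ ℤ.- ℤ.+ (a i * b (m ∸ i))
  low-term i i<1+m = begin
    ℤ.+ a i ℤ.* g (suc (suc m) ∸ i)     ≡⟨ cong (λ k → ℤ.+ a i ℤ.* g k)
      (+-∸-assoc 2 (≤-pred i<1+m)) ⟩
    ℤ.+ a i ℤ.* g (suc (suc (m ∸ i)))   ≡⟨ cong (λ z → ℤ.+ a i ℤ.* z) (g-high (m ∸ i)) ⟩
    ℤ.+ a i ℤ.* ℤ.- ℤ.+ b (m ∸ i)       ≡⟨ sym (ℤP.neg-distribʳ-* (ℤ.+ a i) (ℤ.+ b (m ∸ i))) ⟩
    ℤ.- (ℤ.+ a i ℤ.* ℤ.+ b (m ∸ i))     ≡⟨ cong ℤ.-_ (sym (ℤP.pos-* (a i) (b (m ∸ i)))) ⟩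
    ℤ.- ℤ.+ (a i * b (m ∸ i))           ∎
  low-terms : sumℤ term (suc m) ≡ ℤ.- ℤ.+ conv a b m
  low-terms =
    trans (sumℤ-cong (suc m) low-term)
          (trans (sumℤ-neg (λ i → ℤ.+ (a i * b (m ∸ i))) (suc m))
                 (cong ℤ.-_ (sumℤ-ofℕ (λ i → a i * b (m ∸ i)) (suc m))))
  middle-term : term (suc m) ≡ ℤ.- ℤ.+ a (suc m)
  middle-term =
    trans (cong (λ k → ℤ.+ a (suc m) ℤ.* g k) (m+n∸n≡m 1 m))
          (trans (ℤP.*-comm (ℤ.+ a (suc m)) _) (ℤP.-1*i≡-i _))
  last-term : term (suc (suc m)) ≡ ℤ.+ (a (suc m) + conv a b m)
  last-term =
    trans (cong (λ k → ℤ.+ a (suc (suc m)) ℤ.* g k) (n∸n≡0 m))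
          (trans (ℤP.*-identityʳ _) (cong ℤ.+_ (rec m)))
  cancel : ∀ x c → ℤ.- ℤ.+ c ℤ.+ ℤ.- ℤ.+ x ℤ.+ ℤ.+ (x + c) ≡ 0ℤ
  cancel x c =
    trans (cong₂ ℤ._+_ (sym (ℤP.neg-distrib-+ (ℤ.+ c) (ℤ.+ x)))
                       (trans (ℤP.pos-+ x c) (ℤP.+-comm (ℤ.+ x) (ℤ.+ c))))
          (ℤP.+-inverseˡ (ℤ.+ c ℤ.+ ℤ.+ x))

-- Ascending runs of permutations avoiding 1-32 and 21-3

addToRuns : ℕ → List (List ℕ) → List (List ℕ)
addToRuns x [] = (x ∷ []) ∷ []
addToRuns x ([] ∷ L) = (x ∷ []) ∷ [] ∷ L
addToRuns x ((y ∷ B) ∷ L) = if x <ᵇ y then (x ∷ y ∷ B) ∷ L else (x ∷ []) ∷ (y ∷ B) ∷ L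

ascRuns : List ℕ → List (List ℕ)
ascRuns [] = []
ascRuns (x ∷ r) = addToRuns x (ascRuns r)

StronglyDecreasing : List (List ℕ) → Set
StronglyDecreasing [] = ⊤
StronglyDecreasing (B ∷ []) = ⊤
StronglyDecreasing (B ∷ B' ∷ L) = (head0 B' < head0 B) × (last0 B' < last0 B) × StronglyDecreasing
  (B' ∷ L)

stronglyDecreasing-tail : ∀ B L → StronglyDecreasing (B ∷ L) → StronglyDecreasing L
stronglyDecreasing-tail B [] _ = tt
stronglyDecreasing-tail B (B' ∷ L) (_ , _ , g) = g

stronglyDecreasing-behead : ∀ x y B L → x < y → StronglyDecreasing ((x ∷ y ∷ B) ∷ L) →
  StronglyDecreasing ((y ∷ B) ∷ L)
stronglyDecreasing-behead x y B [] lt _ = tt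
stronglyDecreasing-behead x y B (B' ∷ L) lt (p , q , r) = <-trans p lt , q , r

ascRuns-∷ : ∀ y r → Σ (List ℕ) (λ B → Σ (List (List ℕ)) (λ L → ascRuns (y ∷ r) ≡ (y ∷ B) ∷ L))
ascRuns-∷ y [] = [] , [] , refl
ascRuns-∷ y (z ∷ r) with ascRuns-∷ z r
... | B , L , e rewrite e with y <ᵇ z
...   | true = z ∷ B , L , refl
...   | false = [] , (z ∷ B) ∷ L , refl

concat-addToRuns : ∀ x L → concat (addToRuns x L) ≡ x ∷ concat L
concat-addToRuns x [] = refl
concat-addToRuns x ([] ∷ L) = refl
concat-addToRuns x ((y ∷ B) ∷ L) with x <ᵇ y
... | true = refl
... | false = refl

concat-ascRuns : ∀ w → concat (ascRuns w) ≡ w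
concat-ascRuns [] = refl
concat-ascRuns (x ∷ r) = trans (concat-addToRuns x (ascRuns r)) (cong (x ∷_) (concat-ascRuns r))

AllAdjacent : (ℕ → ℕ → Set) → List ℕ → Set
AllAdjacent P [] = ⊤
AllAdjacent P (x ∷ []) = ⊤
AllAdjacent P (x ∷ y ∷ r) = P x y × AllAdjacent P (y ∷ r)

secondHead : List (List ℕ) → ℕ
secondHead (B1 ∷ B2 ∷ _) = head0 B2
secondHead _ = 0

firstLast : List (List ℕ) → ℕ
firstLast (B ∷ _) = last0 B
firstLast [] = 0

data AscRunsView (x y : ℕ) (r : List ℕ) : Set where
  extends : ∀ B L → ascRuns (y ∷ r) ≡ (y ∷ B) ∷ L → x < y →
            ascRuns (x ∷ y ∷ r) ≡ (x ∷ y ∷ B) ∷ L → AscRunsView x y r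
  breaks : ∀ B L → ascRuns (y ∷ r) ≡ (y ∷ B) ∷ L → y ≤ x →
           ascRuns (x ∷ y ∷ r) ≡ (x ∷ []) ∷ (y ∷ B) ∷ L → AscRunsView x y r

ascRuns-view : ∀ x y r → AscRunsView x y r
ascRuns-view x y r with ascRuns-∷ y r
... | B , L , e = view (x <ᵇ y) refl
  where
  start : Bool → List (List ℕ)
  start b = if b then (x ∷ y ∷ B) ∷ L else (x ∷ []) ∷ (y ∷ B) ∷ L
  view : ∀ b → (x <ᵇ y) ≡ b → AscRunsView x y r
  view true x<y = extends B L e (<ᵇ-true⇒< x y x<y) (trans (cong (addToRuns x) e) (cong start x<y))
  view false y≤x = breaks B L e (<ᵇ-false⇒≥ x y y≤x) (trans (cong (addToRuns x) e) (cong start y≤x))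

ascRuns-blocks : ∀ w → All (λ B → NonEmpty B × Ascending B) (ascRuns w)
ascRuns-blocks [] = []
ascRuns-blocks (x ∷ []) = (tt , tt) ∷ []
ascRuns-blocks (x ∷ y ∷ r) with ascRuns-view x y r | ascRuns-blocks (y ∷ r)
... | extends B L e lt e2 | ih rewrite e2 | e with ih
...   | (_ , a) ∷ rest = (tt , (lt , a)) ∷ rest
ascRuns-blocks (x ∷ y ∷ r) | breaks B L e le e2 | ih rewrite e2 | e = (tt , tt) ∷ ih

AllAdjacent-map : ∀ {P Q : ℕ → ℕ → Set} → (∀ b c → P b c → Q b c) → ∀ w → AllAdjacent P w →
  AllAdjacent Q w
AllAdjacent-map h [] _ = tt
AllAdjacent-map h (x ∷ []) _ = tt
AllAdjacent-map h (x ∷ y ∷ r) (p , a) = h x y p , AllAdjacent-map h (y ∷ r) a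

secondHead≤ : ∀ B L → StronglyDecreasing (B ∷ L) → secondHead (B ∷ L) ≤ head0 B
secondHead≤ B [] _ = z≤n
secondHead≤ B (B′ ∷ L) (p , _) = <⇒≤ p

secondHead-∷ : ∀ B B′ L → secondHead (B ∷ L) ≡ secondHead (B′ ∷ L)
secondHead-∷ B B′ [] = refl
secondHead-∷ B B′ (_ ∷ _) = refl

DescentsBounded : List ℕ → Set
DescentsBounded w = StronglyDecreasing (ascRuns w) → AllAdjacent
  (λ b c → c < b → c ≤ secondHead (ascRuns w)) w

descentsBounded-step : ∀ x y r → DescentsBounded (y ∷ r) → StronglyDecreasing (ascRuns (x ∷ y ∷ r)) →
  AscRunsView x y r → AllAdjacent (λ b c → c < b → c ≤ secondHead (ascRuns (x ∷ y ∷ r))) (x ∷ y ∷ r)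
descentsBounded-step x y r ih g (extends B L e lt e2) = (λ p → ⊥-elim (<-asym lt p)) , subst
  (λ z → AllAdjacent (λ b c → c < b → c ≤ z) (y ∷ r))
  (trans (cong secondHead e)
  (trans (secondHead-∷ (y ∷ B) (x ∷ y ∷ B) L) (cong secondHead (sym e2))))
  (ih (subst StronglyDecreasing (sym e)
  (stronglyDecreasing-behead x y B L lt (subst StronglyDecreasing e2 g))))
descentsBounded-step x y r ih g (breaks B L e le e2) = first , AllAdjacent-map weak (y ∷ r)
  (ih (subst StronglyDecreasing (sym e) g'))
  where
  g' : StronglyDecreasing ((y ∷ B) ∷ L)
  g' = proj₂ (proj₂ (subst StronglyDecreasing e2 g))
  first : y < x → y ≤ secondHead (ascRuns (x ∷ y ∷ r))
  first _ = subst (λ z → y ≤ secondHead z) (sym e2) ≤-refl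
  bnd : secondHead (ascRuns (y ∷ r)) ≤ y
  bnd = subst (λ z → secondHead z ≤ y) (sym e) (secondHead≤ (y ∷ B) L g')
  weak : ∀ b c → (c < b → c ≤ secondHead (ascRuns (y ∷ r))) → c < b →
    c ≤ secondHead (ascRuns (x ∷ y ∷ r))
  weak b c h p = subst (λ z → c ≤ secondHead z) (sym e2) (≤-trans (h p) bnd)

descentsBounded : ∀ w → DescentsBounded w
descentsBounded [] _ = tt
descentsBounded (x ∷ []) _ = tt
descentsBounded (x ∷ y ∷ r) g = descentsBounded-step x y r (descentsBounded (y ∷ r)) g
  (ascRuns-view x y r)

BoundedByFirstLast : List ℕ → Set
BoundedByFirstLast w = StronglyDecreasing (ascRuns w) → All (λ c → c ≤ firstLast (ascRuns w)) w

boundedByFirstLast-step : ∀ x y r → BoundedByFirstLast (y ∷ r) →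
  StronglyDecreasing (ascRuns (x ∷ y ∷ r)) → AscRunsView x y r →
  All (λ c → c ≤ firstLast (ascRuns (x ∷ y ∷ r))) (x ∷ y ∷ r)
boundedByFirstLast-step x y r ih g (extends B L e lt e2)
  with subst (λ z → All (λ c → c ≤ firstLast z) (y ∷ r)) e
             (ih (subst StronglyDecreasing (sym e)
               (stronglyDecreasing-behead x y B L lt (subst StronglyDecreasing e2 g))))
... | (p ∷ ps) = subst (λ z → All (λ c → c ≤ firstLast z) (x ∷ y ∷ r)) (sym e2)
  (<⇒≤ (<-≤-trans lt p) ∷ p ∷ ps)
boundedByFirstLast-step x y r ih g (breaks B L e le e2) = subst
  (λ z → All (λ c → c ≤ firstLast z) (x ∷ y ∷ r)) (sym e2)
  (≤-refl ∷ AllM.map (λ p → ≤-trans p (<⇒≤ (proj₁ (proj₂ g''))))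
  (subst (λ z → All (λ c → c ≤ firstLast z) (y ∷ r)) e
  (ih (subst StronglyDecreasing (sym e) (proj₂ (proj₂ g''))))))
  where
  g'' : StronglyDecreasing ((x ∷ []) ∷ (y ∷ B) ∷ L)
  g'' = subst StronglyDecreasing e2 g

boundedByFirstLast : ∀ w → BoundedByFirstLast w
boundedByFirstLast [] _ = []
boundedByFirstLast (x ∷ []) _ = ≤-refl ∷ []
boundedByFirstLast (x ∷ y ∷ r) g = boundedByFirstLast-step x y r (boundedByFirstLast (y ∷ r)) g
  (ascRuns-view x y r)

firstLast-elem : ∀ y r → elem (firstLast (ascRuns (y ∷ r))) (y ∷ r) ≡ true
firstLast-elem y [] = elem-self y []
firstLast-elem y (z ∷ r) with ascRuns-view y z r
... | extends B L e lt e2 rewrite e2 = elem-cons y (last0 (z ∷ B)) (z ∷ r)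
  (subst (λ q → elem (firstLast q) (z ∷ r) ≡ true) e (firstLast-elem z r))
... | breaks B L e le e2 rewrite e2 = elem-self y (z ∷ r)

has1-32 has21-3 : List ℕ → Bool
has1-32 = containsX-YZ p1-32
has21-3 = containsXY-Z p21-3

SameComparisons : Triple → ℕ → ℕ → ℕ → Set
SameComparisons (x , y , z) a b c =
  ((a <ᵇ b) ≡ (x <ᵇ y)) × ((a <ᵇ c) ≡ (x <ᵇ z)) × ((b <ᵇ c) ≡ (y <ᵇ z)) ×
  ((b <ᵇ a) ≡ (y <ᵇ x)) × ((c <ᵇ a) ≡ (z <ᵇ x)) × ((c <ᵇ b) ≡ (z <ᵇ y))

sameOrder⁻ : ∀ p a b c → sameOrder p a b c ≡ true → SameComparisons p a b c
sameOrder⁻ (x , y , z) a b c e =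
  let (e₁ , e₂₋₆) = ∧-true⁻ (iff (a <ᵇ b) (x <ᵇ y)) e
      (e₂ , e₃₋₆) = ∧-true⁻ (iff (a <ᵇ c) (x <ᵇ z)) e₂₋₆
      (e₃ , e₄₋₆) = ∧-true⁻ (iff (b <ᵇ c) (y <ᵇ z)) e₃₋₆
      (e₄ , e₅₋₆) = ∧-true⁻ (iff (b <ᵇ a) (y <ᵇ x)) e₄₋₆
      (e₅ , e₆) = ∧-true⁻ (iff (c <ᵇ a) (z <ᵇ x)) e₅₋₆
  in iff-true⇒≡ _ _ e₁ , iff-true⇒≡ _ _ e₂ , iff-true⇒≡ _ _ e₃ ,
     iff-true⇒≡ _ _ e₄ , iff-true⇒≡ _ _ e₅ , iff-true⇒≡ _ _ e₆

sameOrder-1-32⁻ : ∀ a b c → sameOrder p1-32 a b c ≡ true → (a < c) × (c < b)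
sameOrder-1-32⁻ a b c e =
  let (_ , a<c , _ , _ , _ , c<b) = sameOrder⁻ p1-32 a b c e
  in <ᵇ-true⇒< a c a<c , <ᵇ-true⇒< c b c<b

sameOrder-1-32⁺ : ∀ a b c → a < c → c < b → sameOrder p1-32 a b c ≡ true
sameOrder-1-32⁺ a b c p q rewrite <⇒<ᵇ-true a b (<-trans p q) | <⇒<ᵇ-true a c p | ≥⇒<ᵇ-false b c
  (<⇒≤ q) | ≥⇒<ᵇ-false b a (<⇒≤ (<-trans p q)) | ≥⇒<ᵇ-false c a (<⇒≤ p) | <⇒<ᵇ-true c b q = refl

sameOrder-21-3⁻ : ∀ a b c → sameOrder p21-3 a b c ≡ true → (b < a) × (a < c)
sameOrder-21-3⁻ a b c e =
  let (_ , a<c , _ , b<a , _ , _) = sameOrder⁻ p21-3 a b c e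
  in <ᵇ-true⇒< b a b<a , <ᵇ-true⇒< a c a<c

sameOrder-21-3⁺ : ∀ a b c → b < a → a < c → sameOrder p21-3 a b c ≡ true
sameOrder-21-3⁺ a b c p q rewrite ≥⇒<ᵇ-false a b (<⇒≤ p) | <⇒<ᵇ-true a c q | <⇒<ᵇ-true b c
  (<-trans p q) | <⇒<ᵇ-true b a p | ≥⇒<ᵇ-false c a (<⇒≤ q) | ≥⇒<ᵇ-false c b
  (<⇒≤ (<-trans p q)) = refl

anyᵇ-adjPairs-false⁻ : ∀ (q : ℕ × ℕ → Bool) w → anyᵇ q (adjPairs w) ≡ false →
  AllAdjacent (λ b c → q (b , c) ≡ false) w
anyᵇ-adjPairs-false⁻ q [] _ = tt
anyᵇ-adjPairs-false⁻ q (x ∷ []) _ = tt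
anyᵇ-adjPairs-false⁻ q (x ∷ y ∷ r) e = proj₁ (∨-false⁻ (q (x , y)) _ e) , anyᵇ-adjPairs-false⁻ q
  (y ∷ r) (proj₂ (∨-false⁻ (q (x , y)) _ e))

anyᵇ-adjPairs-false⁺ : ∀ (q : ℕ × ℕ → Bool) w → AllAdjacent (λ b c → q (b , c) ≡ false) w →
  anyᵇ q (adjPairs w) ≡ false
anyᵇ-adjPairs-false⁺ q [] _ = refl
anyᵇ-adjPairs-false⁺ q (x ∷ []) _ = refl
anyᵇ-adjPairs-false⁺ q (x ∷ y ∷ r) (p , a) = trans (cong (λ z → z ∨ anyᵇ q (adjPairs (y ∷ r))) p)
  (anyᵇ-adjPairs-false⁺ q (y ∷ r) a)

AllAdjacent-junction : ∀ {P : ℕ → ℕ → Set} y B z zs → AllAdjacent P ((y ∷ B) ++ (z ∷ zs)) →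
  P (last0 (y ∷ B)) z
AllAdjacent-junction y [] z zs (p , _) = p
AllAdjacent-junction y (b ∷ B) z zs (_ , a) = AllAdjacent-junction b B z zs a

avoiding⇒stronglyDecreasing-step : ∀ x y r → elem x (y ∷ r) ≡ false → has1-32 (x ∷ y ∷ r) ≡ false →
  has21-3 (x ∷ y ∷ r) ≡ false →
  StronglyDecreasing (ascRuns (y ∷ r)) → AscRunsView x y r → StronglyDecreasing
    (ascRuns (x ∷ y ∷ r))
avoiding⇒stronglyDecreasing-step x y r nx n1 n2 ih (extends B L e lt e2) = subst StronglyDecreasing
  (sym e2) (goal L (subst StronglyDecreasing e ih)
  (subst (λ z → All (λ B → NonEmpty B × Ascending B) z) e (ascRuns-blocks (y ∷ r)))
  (trans (cong concat (sym e)) (concat-ascRuns (y ∷ r))))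
  where
  adj : AllAdjacent (λ b c → sameOrder p1-32 x b c ≡ false) (y ∷ r)
  adj = anyᵇ-adjPairs-false⁻ _ (y ∷ r) (proj₁ (∨-false⁻ _ _ n1))
  goal : ∀ L → StronglyDecreasing ((y ∷ B) ∷ L) →
    All (λ B → NonEmpty B × Ascending B) ((y ∷ B) ∷ L) → concat ((y ∷ B) ∷ L) ≡ y ∷ r →
    StronglyDecreasing ((x ∷ y ∷ B) ∷ L)
  goal [] _ _ _ = tt
  goal ([] ∷ L') _ (_ ∷ (() , _) ∷ _) _
  goal ((b' ∷ B'') ∷ L') (p , q , g) ((_ , ayB) ∷ _) ce = b'<x , q , g
    where
    ce' : (y ∷ B) ++ (b' ∷ (B'' ++ concat L')) ≡ y ∷ r
    ce' = trans (cong ((y ∷ B) ++_) refl) ce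
    so : sameOrder p1-32 x (last0 (y ∷ B)) b' ≡ false
    so = AllAdjacent-junction y B b' (B'' ++ concat L')
      (subst (AllAdjacent (λ b c → sameOrder p1-32 x b c ≡ false)) (sym ce') adj)
    b'<x : b' < x
    b'<x with <-cmp b' x
    ... | tri< a _ _ = a
    ... | tri≈ _ eq _ = ⊥-elim
      (elem-≢ b' x (y ∷ r)
      (subst (λ z → elem b' z ≡ true) ce' (elem-++-∷ b' (y ∷ B) (B'' ++ concat L'))) nx eq)
    ... | tri> _ _ c = ⊥-elim
      (true-false-⊥ (sameOrder-1-32⁺ x (last0 (y ∷ B)) b' c (<-≤-trans p (head≤last y B ayB))) so)
avoiding⇒stronglyDecreasing-step x y r nx n1 n2 ih (breaks B L e le e2) = subst StronglyDecreasing
  (sym e2) (y<x , l<x , subst StronglyDecreasing e ih)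
  where
  y≢x : y ≢ x
  y≢x eq = true-false-⊥
    (subst (λ z → (z ∨ elem x r) ≡ true) (sym (trans (cong (_≡ᵇ x) eq) (≡ᵇ-refl x))) refl) nx
  y<x : y < x
  y<x with m≤n⇒m<n∨m≡n le
  ... | inj₁ a = a
  ... | inj₂ eq = ⊥-elim (y≢x eq)
  ℓ : ℕ
  ℓ = last0 (y ∷ B)
  ℓmem : elem ℓ (y ∷ r) ≡ true
  ℓmem = subst (λ z → elem (firstLast z) (y ∷ r) ≡ true) e (firstLast-elem y r)
  r213 : All (λ c → sameOrder p21-3 x y c ≡ false) r
  r213 = anyᵇ-false⁻ _ r (proj₁ (∨-false⁻ _ _ n2))
  l<x : ℓ < x
  l<x with elem-∷⁻ ℓ y r ℓmem
  ... | inj₁ eq = subst (_< x) eq y<x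
  ... | inj₂ er with <-cmp ℓ x
  ...   | tri< a _ _ = a
  ...   | tri≈ _ eq _ = ⊥-elim (elem-≢ ℓ x (y ∷ r) ℓmem nx eq)
  ...   | tri> _ _ c = ⊥-elim (true-false-⊥ (sameOrder-21-3⁺ x y ℓ y<x c) (All-elem r ℓ r213 er))

no-1-32-after : ∀ x w → StronglyDecreasing (ascRuns w) → secondHead (ascRuns w) ≤ x →
                anyᵇ (λ { (b , c) → sameOrder p1-32 x b c }) (adjPairs w) ≡ false
no-1-32-after x w g bound = anyᵇ-adjPairs-false⁺ _ w (AllAdjacent-map no-pattern w (descentsBounded w g))
  where
  no-pattern : ∀ b c → (c < b → c ≤ secondHead (ascRuns w)) → sameOrder p1-32 x b c ≡ false
  no-pattern b c bounded = ¬true⇒false (λ so →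
    let (x<c , c<b) = sameOrder-1-32⁻ x b c so in <⇒≱ x<c (≤-trans (bounded c<b) bound))

stronglyDecreasing⇒avoiding-step : ∀ x y r → StronglyDecreasing (ascRuns (x ∷ y ∷ r)) →
  (StronglyDecreasing (ascRuns (y ∷ r)) → (has1-32 (y ∷ r) ≡ false) × (has21-3 (y ∷ r) ≡ false)) →
  AscRunsView x y r → (has1-32 (x ∷ y ∷ r) ≡ false) × (has21-3 (x ∷ y ∷ r) ≡ false)
stronglyDecreasing⇒avoiding-step x y r g ih (extends B L e lt e2) =
  trans (cong (_∨ has1-32 (y ∷ r)) new132) (proj₁ ihr) , trans (cong (_∨ has21-3 (y ∷ r)) new213)
    (proj₂ ihr)
  where
  g' : StronglyDecreasing ((x ∷ y ∷ B) ∷ L)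
  g' = subst StronglyDecreasing e2 g
  gy : StronglyDecreasing (ascRuns (y ∷ r))
  gy = subst StronglyDecreasing (sym e) (stronglyDecreasing-behead x y B L lt g')
  ihr : (has1-32 (y ∷ r) ≡ false) × (has21-3 (y ∷ r) ≡ false)
  ihr = ih gy
  bnd : secondHead (ascRuns (y ∷ r)) ≤ x
  bnd = subst (λ z → secondHead z ≤ x) (sym e)
              (subst (_≤ x) (secondHead-∷ (x ∷ y ∷ B) (y ∷ B) L) (secondHead≤ (x ∷ y ∷ B) L g'))
  new132 : anyᵇ (λ { (b , c) → sameOrder p1-32 x b c }) (adjPairs (y ∷ r)) ≡ false
  new132 = no-1-32-after x (y ∷ r) gy bnd
  new213 : anyᵇ (λ c → sameOrder p21-3 x y c) r ≡ false
  new213 = anyᵇ-false⁺ _ r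
    (AllM.tabulate (λ {c} _ → ¬true⇒false (λ so → <-asym lt (proj₁ (sameOrder-21-3⁻ x y c so)))))
stronglyDecreasing⇒avoiding-step x y r g ih (breaks B L e le e2) =
  trans (cong (_∨ has1-32 (y ∷ r)) new132) (proj₁ ihr) , trans (cong (_∨ has21-3 (y ∷ r)) new213)
    (proj₂ ihr)
  where
  g'' : StronglyDecreasing ((x ∷ []) ∷ (y ∷ B) ∷ L)
  g'' = subst StronglyDecreasing e2 g
  gy : StronglyDecreasing (ascRuns (y ∷ r))
  gy = subst StronglyDecreasing (sym e) (proj₂ (proj₂ g''))
  ihr : (has1-32 (y ∷ r) ≡ false) × (has21-3 (y ∷ r) ≡ false)
  ihr = ih gy
  bnd : secondHead (ascRuns (y ∷ r)) ≤ y
  bnd = subst (λ z → secondHead z ≤ y) (sym e) (secondHead≤ (y ∷ B) L (proj₂ (proj₂ g'')))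
  new132 : anyᵇ (λ { (b , c) → sameOrder p1-32 x b c }) (adjPairs (y ∷ r)) ≡ false
  new132 = no-1-32-after x (y ∷ r) gy (≤-trans bnd (<⇒≤ (proj₁ g'')))
  allb : All (λ c → c ≤ firstLast (ascRuns (y ∷ r))) (y ∷ r)
  allb = boundedByFirstLast (y ∷ r) gy
  lb : firstLast (ascRuns (y ∷ r)) < x
  lb = subst (λ z → firstLast z < x) (sym e) (proj₁ (proj₂ g''))
  new213 : anyᵇ (λ c → sameOrder p21-3 x y c) r ≡ false
  new213 = anyᵇ-false⁺ _ r
    (AllM.map (λ {c} h → ¬true⇒false
    (λ so → <-irrefl refl (<-≤-trans (proj₂ (sameOrder-21-3⁻ x y c so)) (≤-trans h (<⇒≤ lb)))))
    (AllM.tail allb))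

avoiding⇒stronglyDecreasing : ∀ w → Distinct w → has1-32 w ≡ false → has21-3 w ≡ false →
  StronglyDecreasing (ascRuns w)
avoiding⇒stronglyDecreasing [] _ _ _ = tt
avoiding⇒stronglyDecreasing (x ∷ []) _ _ _ = tt
avoiding⇒stronglyDecreasing (x ∷ y ∷ r) (x∉ , distinct) no-1-32 no-21-3 =
  avoiding⇒stronglyDecreasing-step x y r x∉ no-1-32 no-21-3
    (avoiding⇒stronglyDecreasing (y ∷ r) distinct
      (proj₂ (∨-false⁻ (anyᵇ (λ { (b , c) → sameOrder p1-32 x b c }) (adjPairs (y ∷ r))) _ no-1-32))
      (proj₂ (∨-false⁻ (anyᵇ (λ c → sameOrder p21-3 x y c) r) _ no-21-3)))
    (ascRuns-view x y r)

stronglyDecreasing⇒avoiding : ∀ w → StronglyDecreasing (ascRuns w) →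
  (has1-32 w ≡ false) × (has21-3 w ≡ false)
stronglyDecreasing⇒avoiding [] _ = refl , refl
stronglyDecreasing⇒avoiding (x ∷ []) _ = refl , refl
stronglyDecreasing⇒avoiding (x ∷ y ∷ r) g = stronglyDecreasing⇒avoiding-step x y r g
  (stronglyDecreasing⇒avoiding (y ∷ r)) (ascRuns-view x y r)

ascRuns-++ : ∀ B L → NonEmpty B → Ascending B → StronglyDecreasing (B ∷ L) →
  All (λ B → NonEmpty B × Ascending B) L → ascRuns (concat L) ≡ L → ascRuns (B ++ concat L) ≡ B ∷ L
ascRuns-++ (x ∷ []) [] _ _ _ _ e rewrite e = refl
ascRuns-++ (x ∷ []) ((y ∷ B') ∷ L) _ _ (p , q , g) _ e rewrite e | ≥⇒<ᵇ-false x y (<⇒≤ p) = refl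
ascRuns-++ (x ∷ []) ([] ∷ L) _ _ _ ((() , _) ∷ _) e
ascRuns-++ (x ∷ y ∷ B) L _ (lt , a) g al e rewrite ascRuns-++ (y ∷ B) L tt a
  (stronglyDecreasing-behead x y B L lt g) al e | <⇒<ᵇ-true x y lt = refl

ascRuns-concat : ∀ L → StronglyDecreasing L → All (λ B → NonEmpty B × Ascending B) L →
  ascRuns (concat L) ≡ L
ascRuns-concat [] _ _ = refl
ascRuns-concat (B ∷ L) g ((ne , a) ∷ al) = ascRuns-++ B L ne a g al
  (ascRuns-concat L (stronglyDecreasing-tail B L g) al)

-- Strongly monotone partitions as sequences of runs

headOf : List (List ℕ) → ℕ → ℕ
headOf [] v = 0
headOf (B ∷ L) v = if elem v B then head0 B else headOf L v

toPartitionWord : List (List ℕ) → ℕ → List ℕ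
toPartitionWord L n = map (headOf L) (pushAll queue n)

blockOf : List ℕ → ℕ → ℕ → List ℕ
blockOf f n m = select (λ i → at f i ≡ᵇ m) (pushAll queue n)

blocks : List ℕ → ℕ → List (List ℕ)
blocks f n = map (blockOf f n) (select (isMin f) (pushAll stack n))

lastOf : List (List ℕ) → ℕ → ℕ
lastOf [] v = 0
lastOf (B ∷ L) v = if elem v B then last0 B else lastOf L v

last0-select : ∀ (Fn : ℕ → ℕ) m k → last0 (select (λ i → Fn i ≡ᵇ m) (pushAll queue k))
  ≡ lastIndex Fn m k
last0-select Fn m zero = refl
last0-select Fn m (suc k) rewrite select-push queue (λ i → Fn i ≡ᵇ m) (suc k)
  (pushAll queue k) with Fn (suc k) ≡ᵇ m
... | true = last0-snoc (select (λ i → Fn i ≡ᵇ m) (pushAll queue k)) (suc k)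
... | false = last0-select Fn m k

elem-concat-∷⁻ : ∀ v B L → elem v (concat (B ∷ L)) ≡ true →
  (elem v B ≡ true) ⊎ ((elem v B ≡ false) × (elem v (concat L) ≡ true))
elem-concat-∷⁻ v B L e with elem v B in evb
... | true = inj₁ refl
... | false = inj₂ (refl , subst (λ z → (z ∨ elem v (concat L)) ≡ true) evb
  (trans (sym (elem-++ v B (concat L))) e))

headOf-elem : ∀ L v → All IsRun L → elem v (concat L) ≡ true → elem (headOf L v) (concat L) ≡ true
headOf-elem (B ∷ L) v (nb ∷ al) e with elem-concat-∷⁻ v B L e
... | inj₁ ev rewrite ev = elem-++⁺ˡ (head0 B) B (concat L) (head0-elem B (proj₁ nb))
... | inj₂ (nv , ev) rewrite nv = elem-++⁺ʳ (headOf L v) B (concat L) (headOf-elem L v al ev)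

headOf-≤ : ∀ L v → All IsRun L → elem v (concat L) ≡ true → headOf L v ≤ v
headOf-≤ (B ∷ L) v (nb ∷ al) e with elem-concat-∷⁻ v B L e
... | inj₁ ev rewrite ev = head0≤elem B v (proj₂ nb) ev
... | inj₂ (nv , ev) rewrite nv = headOf-≤ L v al ev

headOf-<-head0 : ∀ B L v → StronglyDecreasing (B ∷ L) → All IsRun L → elem v (concat L) ≡ true →
  headOf L v < head0 B
headOf-<-head0 B (B' ∷ L) v (p , q , g) (nb ∷ al) e with elem-concat-∷⁻ v B' L e
... | inj₁ ev rewrite ev = p
... | inj₂ (nv , ev) rewrite nv = <-trans (headOf-<-head0 B' L v g al ev) p

lastOf-<-last0 : ∀ B L v → StronglyDecreasing (B ∷ L) → All IsRun L → elem v (concat L) ≡ true →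
  lastOf L v < last0 B
lastOf-<-last0 B (B' ∷ L) v (p , q , g) (nb ∷ al) e with elem-concat-∷⁻ v B' L e
... | inj₁ ev rewrite ev = q
... | inj₂ (nv , ev) rewrite nv = <-trans (lastOf-<-last0 B' L v g al ev) q

headOf-idem : ∀ L v → All IsRun L → Distinct (concat L) → elem v (concat L) ≡ true →
  headOf L (headOf L v) ≡ headOf L v
headOf-idem (B ∷ L) v (nb ∷ al) d e with elem-concat-∷⁻ v B L e
... | inj₁ ev rewrite ev | head0-elem B (proj₁ nb) = refl
... | inj₂ (nv , ev) rewrite nv | distinct-++-disjoint B (concat L) (headOf L v) d
  (headOf-elem L v al ev) = headOf-idem L v al (distinct-++ʳ B (concat L) d) ev

lastOf-elem : ∀ L v → All IsRun L → elem v (concat L) ≡ true → elem (lastOf L v) (concat L) ≡ true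
lastOf-elem (B ∷ L) v (nb ∷ al) e with elem-concat-∷⁻ v B L e
... | inj₁ ev rewrite ev = elem-++⁺ˡ (last0 B) B (concat L) (last0-elem B (proj₁ nb))
... | inj₂ (nv , ev) rewrite nv = elem-++⁺ʳ (lastOf L v) B (concat L) (lastOf-elem L v al ev)

≤lastOf : ∀ L v → All IsRun L → elem v (concat L) ≡ true → v ≤ lastOf L v
≤lastOf (B ∷ L) v (nb ∷ al) e with elem-concat-∷⁻ v B L e
... | inj₁ ev rewrite ev = elem≤last0 B v (proj₂ nb) ev
... | inj₂ (nv , ev) rewrite nv = ≤lastOf L v al ev

headOf-lastOf : ∀ L v → All IsRun L → Distinct (concat L) → elem v (concat L) ≡ true →
  headOf L (lastOf L v) ≡ headOf L v
headOf-lastOf (B ∷ L) v (nb ∷ al) d e with elem-concat-∷⁻ v B L e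
... | inj₁ ev rewrite ev | last0-elem B (proj₁ nb) = refl
... | inj₂ (nv , ev) rewrite nv | distinct-++-disjoint B (concat L) (lastOf L v) d
  (lastOf-elem L v al ev) = headOf-lastOf L v al (distinct-++ʳ B (concat L) d) ev

headOf≡⇒lastOf≡ : ∀ L i j → StronglyDecreasing L → All IsRun L → elem i (concat L) ≡ true →
  elem j (concat L) ≡ true → headOf L i ≡ headOf L j → lastOf L i ≡ lastOf L j
headOf≡⇒lastOf≡ (B ∷ L) i j g (nb ∷ al) ei ej h with elem-concat-∷⁻ i B L ei | elem-concat-∷⁻ j B L ej
... | inj₁ e1 | inj₁ e2 rewrite e1 | e2 = refl
... | inj₁ e1 | inj₂ (n2 , e2) rewrite e1 | n2 = ⊥-elim
  (<-irrefl (sym h) (headOf-<-head0 B L j g al e2))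
... | inj₂ (n1 , e1) | inj₁ e2 rewrite n1 | e2 = ⊥-elim (<-irrefl h (headOf-<-head0 B L i g al e1))
... | inj₂ (n1 , e1) | inj₂ (n2 , e2) rewrite n1 | n2 = headOf≡⇒lastOf≡ L i j
  (stronglyDecreasing-tail B L g) al e1 e2 h

headOf<⇒lastOf< : ∀ L i j → StronglyDecreasing L → All IsRun L → elem i (concat L) ≡ true →
  elem j (concat L) ≡ true → headOf L i < headOf L j → lastOf L i < lastOf L j
headOf<⇒lastOf< (B ∷ L) i j g (nb ∷ al) ei ej h with elem-concat-∷⁻ i B L ei | elem-concat-∷⁻ j B L ej
... | inj₁ e1 | inj₁ e2 rewrite e1 | e2 = ⊥-elim (<-irrefl refl h)
... | inj₁ e1 | inj₂ (n2 , e2) rewrite e1 | n2 = ⊥-elim (<-asym h (headOf-<-head0 B L j g al e2))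
... | inj₂ (n1 , e1) | inj₁ e2 rewrite n1 | e2 = lastOf-<-last0 B L i g al e1
... | inj₂ (n1 , e1) | inj₂ (n2 , e2) rewrite n1 | n2 = headOf<⇒lastOf< L i j
  (stronglyDecreasing-tail B L g) al e1 e2 h

heads-elem : ∀ L m → All IsRun L → elem m (map head0 L) ≡ true → elem m (concat L) ≡ true
heads-elem (B ∷ L) m (nb ∷ al) e with head0 B ≡ᵇ m in ebm
... | true = subst (λ z → elem z (B ++ concat L) ≡ true) (≡ᵇ-true⇒≡ (head0 B) m ebm)
  (elem-++⁺ˡ (head0 B) B (concat L) (head0-elem B (proj₁ nb)))
... | false = elem-++⁺ʳ m B (concat L) (heads-elem L m al e)

isHead≡ : ∀ L m → All IsRun L → Distinct (concat L) → elem m (concat L) ≡ true → (headOf L m ≡ᵇ m)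
  ≡ elem m (map head0 L)
isHead≡ (B ∷ L) m (nb ∷ al) d e with elem-concat-∷⁻ m B L e
... | inj₁ ev rewrite ev with head0 B ≡ᵇ m
...   | true = refl
...   | false = sym (¬true⇒false
  (λ eh → true-false-⊥ (heads-elem L m al eh)
  (¬true⇒false (λ ec → true-false-⊥ ev (distinct-++-disjoint B (concat L) m d ec)))))
isHead≡ (B ∷ L) m (nb ∷ al) d e | inj₂ (nv , ev) rewrite nv | ≢⇒≡ᵇ-false (head0 B) m
  (λ x → true-false-⊥ (subst (λ z → elem z B ≡ true) x
  (head0-elem B (proj₁ nb))) nv) = isHead≡ L m al (distinct-++ʳ B (concat L) d) ev

heads-strictlyDescending : ∀ L → StronglyDecreasing L → StrictlyDescending (map head0 L)
heads-strictlyDescending [] _ = tt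
heads-strictlyDescending (B ∷ L) g = below B L g , heads-strictlyDescending L
  (stronglyDecreasing-tail B L g)
  where
  below : ∀ B L → StronglyDecreasing (B ∷ L) → All (_< head0 B) (map head0 L)
  below B [] _ = []
  below B (B' ∷ L) (p , q , g) = p ∷ AllM.map (λ x → <-trans x p) (below B' L g)

blocks-from-headOf : ∀ L → StronglyDecreasing L → All IsRun L → Distinct (concat L) →
  All (λ B → (∀ i → elem i B ≡ true → elem i (concat L) ≡ true) ×
    (∀ i → elem i (concat L) ≡ true → (headOf L i ≡ᵇ head0 B) ≡ elem i B)) L
blocks-from-headOf [] _ _ _ = []
blocks-from-headOf (B0 ∷ L) g (nb ∷ al) d = (elem-++-l' , eq0) ∷ AllM.zipWith
  (λ {B} z → step {B} z)
  (blocks-from-headOf L (stronglyDecreasing-tail B0 L g) al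
  (distinct-++ʳ B0 (concat L) d) , below B0 L g al)
  where
  elem-++-l' : ∀ i → elem i B0 ≡ true → elem i (concat (B0 ∷ L)) ≡ true
  elem-++-l' i e = elem-++⁺ˡ i B0 (concat L) e
  eq0 : ∀ i → elem i (concat (B0 ∷ L)) ≡ true → (headOf (B0 ∷ L) i ≡ᵇ head0 B0) ≡ elem i B0
  eq0 i e with elem-concat-∷⁻ i B0 L e
  ... | inj₁ ev rewrite ev = ≡ᵇ-refl (head0 B0)
  ... | inj₂ (nv , ev) rewrite nv = ≢⇒≡ᵇ-false _ _
    (λ x → <-irrefl x (headOf-<-head0 B0 L i g al ev))
  below : ∀ B0 L → StronglyDecreasing (B0 ∷ L) → All IsRun L → All (λ B → head0 B < head0 B0) L
  below B0 [] _ _ = []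
  below B0 (B' ∷ L) (p , q , g) (nb' ∷ al') = p ∷ AllM.map (λ x → <-trans x p) (below B' L g al')
  step : ∀ {B} → ((∀ i → elem i B ≡ true → elem i (concat L) ≡ true) ×
    (∀ i → elem i (concat L) ≡ true → (headOf L i ≡ᵇ head0 B) ≡ elem i B)) × (head0 B < head0 B0) →
    (∀ i → elem i B ≡ true → elem i (concat (B0 ∷ L)) ≡ true) ×
      (∀ i → elem i (concat (B0 ∷ L)) ≡ true → (headOf (B0 ∷ L) i ≡ᵇ head0 B) ≡ elem i B)
  step {B} ((sub , eq) , hb) = (λ i e → elem-++⁺ʳ i B0 (concat L) (sub i e)) , eqB
    where
    eqB : ∀ i → elem i (concat (B0 ∷ L)) ≡ true → (headOf (B0 ∷ L) i ≡ᵇ head0 B) ≡ elem i B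
    eqB i e with elem-concat-∷⁻ i B0 L e
    ... | inj₁ ev rewrite ev = trans (≢⇒≡ᵇ-false _ _ (λ x → <-irrefl (sym x) hb))
      (sym (¬true⇒false (λ eb → true-false-⊥ (sub i eb)
      (¬true⇒false (λ ec → true-false-⊥ ev (distinct-++-disjoint B0 (concat L) i d ec))))))
    ... | inj₂ (nv , ev) rewrite nv = eq i ev

module BlocksOfPartition (f : List ℕ) (n : ℕ) (len : length f ≡ n) (rng : All (InRange n) f)
  (pw : PartitionWord.IsPartitionWord f n len rng)
  (sm : PartitionWord.IsStronglyMonotone f n len rng) where
  open PartitionWord f n len rng
  open Scan f

  block : ℕ → List ℕ
  block = blockOf f n

  minima : List ℕ
  minima = select isBlockMin (pushAll stack n)

  IsBlockMinIn : ℕ → Set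
  IsBlockMinIn m = (F m ≡ m) × (1 ≤ m) × (m ≤ n)

  elem-block⁻ : ∀ v m → elem v (block m) ≡ true → (1 ≤ v) × (v ≤ n) × (F v ≡ m)
  elem-block⁻ v m e =
    let (1≤v , v≤n , Fv≡m) = elem-select-pushAll⁻ queue (λ i → F i ≡ᵇ m) n v e
    in 1≤v , v≤n , ≡ᵇ-true⇒≡ _ _ Fv≡m

  elem-block⁺ : ∀ v m → 1 ≤ v → v ≤ n → F v ≡ m → elem v (block m) ≡ true
  elem-block⁺ v m p q e = elem-select-pushAll⁺ queue (λ i → F i ≡ᵇ m) n v p q
    (subst (λ z → (F v ≡ᵇ z) ≡ true) e (≡ᵇ-refl (F v)))

  ∉-block : ∀ v m → 1 ≤ v → v ≤ n → F v ≢ m → elem v (block m) ≡ false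
  ∉-block v m p q ne = ¬true⇒false (λ e → ne (proj₂ (proj₂ (elem-block⁻ v m e))))

  head0-block : ∀ m → IsBlockMinIn m → head0 (block m) ≡ m
  head0-block m (fm , p , q) = atHead⇒head0 m (block m)
    (atHead-queue⁺ (λ i → F i ≡ᵇ m) n m p q (subst (λ z → (z ≡ᵇ m) ≡ true) (sym fm) (≡ᵇ-refl m))
    (λ i a b → ¬true⇒false
      (λ e → <-irrefl refl
      (<-≤-trans b (subst (_≤ i) (≡ᵇ-true⇒≡ _ _ e) (proj₁ (pw i a (≤-trans (<⇒≤ b) q))))))))

  last0-block : ∀ m → last0 (block m) ≡ maxOf m
  last0-block m = last0-select F m n

  minima-areMins : All IsBlockMinIn minima
  minima-areMins = elem⇒All minima (λ m m∈ →
    let (m∈pushed , min) = elem-select⁻ isBlockMin (pushAll stack n) m m∈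
        (1≤m , m≤n) = elem-pushAll⁻ stack n m m∈pushed
    in ≡ᵇ-true⇒≡ _ _ min , 1≤m , m≤n)

  F-elem-minima : ∀ v → 1 ≤ v → v ≤ n → elem (F v) minima ≡ true
  F-elem-minima v 1≤v v≤n =
    elem-select⁺ isBlockMin (pushAll stack n) (F v) (uncurry (elem-pushAll⁺ stack n (F v)) (F-inRange v 1≤v v≤n))
      (subst (λ z → (z ≡ᵇ F v) ≡ true) (sym (proj₂ (pw v 1≤v v≤n))) (≡ᵇ-refl (F v)))

  minima-descending : StrictlyDescending minima
  minima-descending = strictlyDescending-select isBlockMin (pushAll stack n) (strictlyDescending-pushAll n)

  headOf-blocks : ∀ v → 1 ≤ v → v ≤ n → ∀ ms → All IsBlockMinIn ms → elem (F v) ms ≡ true →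
    headOf (map block ms) v ≡ F v
  headOf-blocks v p q (m ∷ ms) (mp ∷ mps) e with F v ≡ᵇ m in efm
  ... | true rewrite elem-block⁺ v m p q (≡ᵇ-true⇒≡ _ _ efm) = trans (head0-block m mp)
    (sym (≡ᵇ-true⇒≡ _ _ efm))
  ... | false rewrite ∉-block v m p q (≡ᵇ-false⇒≢ _ _ efm) = headOf-blocks v p q ms mps
    (subst (λ z → (z ∨ elem (F v) ms) ≡ true) (trans (≡ᵇ-sym m (F v)) efm) e)

  toPartitionWord-blocks : toPartitionWord (blocks f n) n ≡ f
  toPartitionWord-blocks = at-ext (toPartitionWord (blocks f n) n) f
    (trans (length-map-pushAll _ n) (sym len))
    (λ i 1≤i i≤len → let i≤n = subst (i ≤_) (length-map-pushAll _ n) i≤len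
                     in trans (at-map-pushAll _ n i 1≤i i≤n)
                              (headOf-blocks i 1≤i i≤n minima minima-areMins (F-elem-minima i 1≤i i≤n)))

  blockList : List (List ℕ)
  blockList = blocks f n

  blockList-runs : All (λ B → NonEmpty B × Ascending B) blockList
  blockList-runs = go minima minima-areMins
    where
    go : ∀ ms → All IsBlockMinIn ms → All (λ B → NonEmpty B × Ascending B) (map block ms)
    go [] _ = []
    go (m ∷ ms) ((fm , p , q) ∷ mps) =
      (elem⇒nonEmpty m (block m) (elem-block⁺ m m p q fm) , strictlyAscending⇒ascending (block m)
      (strictlyAscending-select _ (pushAll queue n) (strictlyAscending-pushAll n))) ∷ go ms mps

  blockList-stronglyDecreasing : StronglyDecreasing blockList
  blockList-stronglyDecreasing = go minima minima-areMins minima-descending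
    where
    go : ∀ ms → All IsBlockMinIn ms → StrictlyDescending ms → StronglyDecreasing (map block ms)
    go [] _ _ = tt
    go (m ∷ []) _ _ = tt
    go (m ∷ m' ∷ ms) (mp ∷ mp' ∷ mps) ((lt ∷ _) , sd) =
      subst₂ _<_ (sym (head0-block m' mp')) (sym (head0-block m mp)) lt ,
      subst₂ _<_ (sym (last0-block m')) (sym (last0-block m))
        (sm m' m (proj₁ (proj₂ mp')) (proj₂ (proj₂ mp)) (proj₁ mp') (proj₁ mp) lt) ,
      go (m' ∷ ms) (mp' ∷ mps) sd

  elem-concat-blocks : ∀ z ms → elem z (concat (map block ms)) ≡ true → elem (F z) ms ≡ true
  elem-concat-blocks z (m ∷ ms) e rewrite elem-++ z (block m) (concat (map block ms)) with elem z
    (block m) in ezm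
  ... | true rewrite proj₂ (proj₂ (elem-block⁻ z m ezm)) | ≡ᵇ-refl m = refl
  ... | false = elem-cons m (F z) ms (elem-concat-blocks z ms e)

  blockList-distinct : Distinct (concat blockList)
  blockList-distinct = go minima minima-areMins minima-descending
    where
    go : ∀ ms → All IsBlockMinIn ms → StrictlyDescending ms → Distinct (concat (map block ms))
    go [] _ _ = tt
    go (m ∷ ms) (mp ∷ mps) (a , sd) = distinct-++ (block m) (concat (map block ms))
      (distinct-select _ (pushAll queue n) (distinct-pushAll queue n)) (go ms mps sd)
      (λ z z∈ → ¬true⇒false (λ z∈rest →
        <-irrefl (proj₂ (proj₂ (elem-block⁻ z m z∈))) (All-elem ms (F z) a (elem-concat-blocks z ms z∈rest))))

  blockList-inRange : ∀ z → elem z (concat blockList) ≡ true → InRange n z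
  blockList-inRange z e = elem-pushAll⁻ queue n z (proj₁ (elem-select⁻ _ (pushAll queue n) z (in-own-block minima e)))
    where
    in-own-block : ∀ ms → elem z (concat (map block ms)) ≡ true → elem z (block (F z)) ≡ true
    in-own-block (m ∷ ms) e rewrite elem-++ z (block m) (concat (map block ms)) with elem z (block m) in ezm
    ... | true rewrite proj₂ (proj₂ (elem-block⁻ z m ezm)) = ezm
    ... | false = in-own-block ms e

  blockList-covers : Covers n (concat blockList)
  blockList-covers v p q = elem-concat-map block minima (F v) v (F-elem-minima v p q)
    (elem-block⁺ v (F v) p q refl)

  blockList-length : length (concat blockList) ≡ n
  blockList-length = distinct-covering⇒length n (concat blockList) blockList-distinct
    (elem⇒All (concat blockList) blockList-inRange) blockList-covers

module PartitionOfRuns (L : List (List ℕ)) (n : ℕ) (decreasing : StronglyDecreasing L) (runs : All IsRun L)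
  (distinct : Distinct (concat L))
          (inRange : ∀ z → elem z (concat L) ≡ true → InRange n z) (covers : Covers n (concat L)) where
  f : List ℕ
  f = toPartitionWord L n

  len : length f ≡ n
  len = length-map-pushAll (headOf L) n

  f-at : ∀ i → 1 ≤ i → i ≤ n → at f i ≡ headOf L i
  f-at i p q = at-map-pushAll (headOf L) n i p q

  headOf-inRange : ∀ i → 1 ≤ i → i ≤ n → InRange n (headOf L i)
  headOf-inRange i p q = inRange (headOf L i) (headOf-elem L i runs (covers i p q))

  f-inRange : All (InRange n) f
  f-inRange = All-map⁺ (headOf L) (pushAll queue n) (elem⇒All (pushAll queue n) (λ i i∈ → uncurry (headOf-inRange i) (elem-pushAll⁻ queue n i i∈)))

  open PartitionWord f n len f-inRange
  open Scan f

  f-isPartitionWord : IsPartitionWord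
  f-isPartitionWord i p q = subst (_≤ i) (sym (f-at i p q)) (headOf-≤ L i runs (covers i p q)) ,
    trans (cong F (f-at i p q))
      (trans (f-at (headOf L i) (proj₁ (headOf-inRange i p q)) (proj₂ (headOf-inRange i p q)))
      (trans (headOf-idem L i runs distinct (covers i p q)) (sym (f-at i p q))))

  maxOf≡lastOf : ∀ m → 1 ≤ m → m ≤ n → F m ≡ m → maxOf m ≡ lastOf L m
  maxOf≡lastOf m p q fm = ≤-antisym up down
    where
    cm : elem m (concat L) ≡ true
    cm = covers m p q
    ℓ : ℕ
    ℓ = lastOf L m
    ℓr : InRange n ℓ
    ℓr = inRange ℓ (lastOf-elem L m runs cm)
    hm : headOf L m ≡ m
    hm = trans (sym (f-at m p q)) fm
    Fℓ : F ℓ ≡ m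
    Fℓ = trans (f-at ℓ (proj₁ ℓr) (proj₂ ℓr)) (trans (headOf-lastOf L m runs distinct cm) hm)
    down : ℓ ≤ maxOf m
    down = maxOf-maximal m ℓ Fℓ (proj₁ ℓr) (proj₂ ℓr)
    b1 : 1 ≤ maxOf m
    b1 = ≤-trans (proj₁ ℓr) down
    up : maxOf m ≤ ℓ
    up = let fb = maxOf-hit m b1 ; bn = maxOf-≤ m ; cb = covers (maxOf m) b1 bn in
      ≤-trans (≤lastOf L (maxOf m) runs cb)
        (≤-reflexive (headOf≡⇒lastOf≡ L (maxOf m) m decreasing runs cb cm
        (trans (sym (f-at (maxOf m) b1 bn)) (trans fb (sym hm)))))

  f-stronglyMonotone : IsStronglyMonotone
  f-stronglyMonotone m m' p q fm fm' lt = subst₂ _<_ (sym (maxOf≡lastOf m p mq fm)) (sym (maxOf≡lastOf m' p' q fm'))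
      (headOf<⇒lastOf< L m m' decreasing runs (covers m p mq) (covers m' p' q)
        (subst₂ _<_ (sym (trans (sym (f-at m p mq)) fm)) (sym (trans (sym (f-at m' p' q)) fm')) lt))
    where
    mq : m ≤ n
    mq = ≤-trans (<⇒≤ lt) q
    p' : 1 ≤ m'
    p' = ≤-trans p (<⇒≤ lt)

  blocks-toPartitionWord : blocks f n ≡ L
  blocks-toPartitionWord = trans (cong (map (blockOf f n)) minima≡heads)
    (trans (sym (map-∘ {g = blockOf f n} {f = head0} L))
    (map-id-All _ L (AllM.zipWith (λ { (k , nb) → blockOf-head k (proj₂ nb) })
    (blocks-from-headOf L decreasing runs distinct , runs))))
    where
    minima≡heads : select (isMin f) (pushAll stack n) ≡ map head0 L
    minima≡heads = trans (select-cong (isMin f) (λ m → elem m (map head0 L)) (pushAll stack n)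
        (λ m m∈ → let (1≤m , m≤n) = elem-pushAll⁻ stack n m m∈
                  in trans (cong (_≡ᵇ m) (f-at m 1≤m m≤n)) (isHead≡ L m runs distinct (covers m 1≤m m≤n))))
      (select-elem-pushAll-stack (map head0 L) n (heads-strictlyDescending L decreasing)
        (elem⇒All (map head0 L) (λ z e → inRange z (heads-elem L z runs e))))
    blockOf-head : ∀ {B} → (∀ i → elem i B ≡ true → elem i (concat L) ≡ true) ×
      (∀ i → elem i (concat L) ≡ true → (headOf L i ≡ᵇ head0 B) ≡ elem i B) → Ascending B →
      blockOf f n (head0 B) ≡ B
    blockOf-head {B} (sub , eq) asc = trans
      (select-cong (λ i → at f i ≡ᵇ head0 B) (λ i → elem i B) (pushAll queue n)
        (λ i i∈ → let (1≤i , i≤n) = elem-pushAll⁻ queue n i i∈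
                  in trans (cong (_≡ᵇ head0 B) (f-at i 1≤i i≤n)) (eq i (covers i 1≤i i≤n))))
      (select-elem-pushAll-queue B n (ascending⇒strictlyAscending B asc)
        (elem⇒All B (λ z e → inRange z (sub z e))))

isSMPartition : ℕ → List ℕ → Bool
isSMPartition n f = isPartitionWord n f ∧ stronglyMonotone n f

isAvoidingPerm : ℕ → List ℕ → Bool
isAvoidingPerm n w = isPerm n w ∧ (not (has1-32 w) ∧ not (has21-3 w))

concatBlocks : ℕ → List ℕ → List ℕ
concatBlocks n f = concat (blocks f n)

runsPartition : ℕ → List ℕ → List ℕ
runsPartition n w = toPartitionWord (ascRuns w) n

module Bijection (n : ℕ) where
  module SMPartition (f : List ℕ) (fw : IsWord n n f) (e : isSMPartition n f ≡ true) where
    open PartitionWord f n (proj₁ fw) (proj₂ fw) using (isPartitionWordᵇ⁻; stronglyMonotoneᵇ⁻)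
    open BlocksOfPartition f n (proj₁ fw) (proj₂ fw) (isPartitionWordᵇ⁻ (∧-true⁻ˡ (isPartitionWord n f) e))
      (stronglyMonotoneᵇ⁻ (∧-true⁻ʳ (isPartitionWord n f) e)) public
    ascRuns-blockList : ascRuns (concat blockList) ≡ blockList
    ascRuns-blockList = ascRuns-concat blockList blockList-stronglyDecreasing blockList-runs

  φ-into : ∀ f → IsWord n n f → isSMPartition n f ≡ true →
    IsWord n n (concatBlocks n f) × (isAvoidingPerm n (concatBlocks n f) ≡ true)
  φ-into f fw e =
    (blockList-length , elem⇒All (concat blockList) blockList-inRange) ,
    ∧-true⁺ (allᵇ-range⁺ _ n blockList-covers)
            (∧-true⁺ (false⇒not-true _ (proj₁ avoids)) (false⇒not-true _ (proj₂ avoids)))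
    where
    open SMPartition f fw e
    avoids : (has1-32 (concat blockList) ≡ false) × (has21-3 (concat blockList) ≡ false)
    avoids = stronglyDecreasing⇒avoiding (concat blockList)
               (subst StronglyDecreasing (sym ascRuns-blockList) blockList-stronglyDecreasing)

  ψ∘φ : ∀ f → IsWord n n f → isSMPartition n f ≡ true → runsPartition n (concatBlocks n f) ≡ f
  ψ∘φ f fw e = trans (cong (λ L → toPartitionWord L n) ascRuns-blockList) toPartitionWord-blocks
    where
    open SMPartition f fw e

  module Avoider (w : List ℕ) (ww : IsWord n n w) (e : isAvoidingPerm n w ≡ true) where
    covers : Covers n w
    covers = allᵇ-range⁻ _ n (∧-true⁻ˡ (isPerm n w) e)
    distinct : Distinct w
    distinct = pigeonhole n w (proj₁ ww) (proj₂ ww) covers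
    avoids : (not (has1-32 w) ∧ not (has21-3 w)) ≡ true
    avoids = ∧-true⁻ʳ (isPerm n w) e
    decreasing : StronglyDecreasing (ascRuns w)
    decreasing = avoiding⇒stronglyDecreasing w distinct
                   (not-true⇒false _ (∧-true⁻ˡ (not (has1-32 w)) avoids))
                   (not-true⇒false _ (∧-true⁻ʳ (not (has1-32 w)) avoids))
    runs : List (List ℕ)
    runs = ascRuns w
    concat-runs : concat runs ≡ w
    concat-runs = concat-ascRuns w
    open PartitionOfRuns runs n decreasing (ascRuns-blocks w) (subst Distinct (sym concat-runs) distinct)
      (λ z ez → All-elem w z (proj₂ ww) (subst (λ q → elem z q ≡ true) concat-runs ez))
      (λ v p q → subst (λ z → elem v z ≡ true) (sym concat-runs) (covers v p q)) public

  ψ-into : ∀ w → IsWord n n w → isAvoidingPerm n w ≡ true →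
    IsWord n n (runsPartition n w) × (isSMPartition n (runsPartition n w) ≡ true)
  ψ-into w ww e =
    (len , f-inRange) , ∧-true⁺ (isPartitionWordᵇ⁺ f-isPartitionWord) (stronglyMonotoneᵇ⁺ f-stronglyMonotone)
    where
    open Avoider w ww e
    open PartitionWord f n len f-inRange using (isPartitionWordᵇ⁺; stronglyMonotoneᵇ⁺)

  φ∘ψ : ∀ w → IsWord n n w → isAvoidingPerm n w ≡ true → concatBlocks n (runsPartition n w) ≡ w
  φ∘ψ w ww e = trans (cong concat blocks-toPartitionWord) concat-runs
    where
    open Avoider w ww e

countS₁≡a : ∀ n → countS₁ n ≡ a n
countS₁≡a n = begin
  countS₁ n
    ≡⟨ count-filterᵇ (isPerm n) _ (words n n) ⟩
  sumMap (λ w → ind (isAvoidingPerm n w)) (words n n)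
    ≡⟨ CountingBijection.count-target≡count-source n (isSMPartition n) (isAvoidingPerm n)
                                                   (concatBlocks n) (runsPartition n) φ-into ψ-into ψ∘φ φ∘ψ ⟩
  sumMap (λ f → ind (isSMPartition n f)) (words n n)
    ≡⟨ sym (count-filterᵇ (isPartitionWord n) (stronglyMonotone n) (words n n)) ⟩
  a n ∎
  where
  open ≡-Reasoning
  open Bijection n

-- Complementation

sameOrder-3-12⁻ : ∀ a b c → sameOrder p3-12 a b c ≡ true → (b < c) × (c < a)
sameOrder-3-12⁻ a b c e =
  let (_ , _ , b<c , _ , c<a , _) = sameOrder⁻ p3-12 a b c e
  in <ᵇ-true⇒< b c b<c , <ᵇ-true⇒< c a c<a

sameOrder-3-12⁺ : ∀ a b c → b < c → c < a → sameOrder p3-12 a b c ≡ true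
sameOrder-3-12⁺ a b c p q rewrite ≥⇒<ᵇ-false a b (<⇒≤ (<-trans p q)) | ≥⇒<ᵇ-false a c
  (<⇒≤ q) | <⇒<ᵇ-true b c p | <⇒<ᵇ-true b a (<-trans p q) | <⇒<ᵇ-true c a q | ≥⇒<ᵇ-false c b
  (<⇒≤ p) = refl

sameOrder-23-1⁻ : ∀ a b c → sameOrder p23-1 a b c ≡ true → (c < a) × (a < b)
sameOrder-23-1⁻ a b c e =
  let (a<b , _ , _ , _ , c<a , _) = sameOrder⁻ p23-1 a b c e
  in <ᵇ-true⇒< c a c<a , <ᵇ-true⇒< a b a<b

sameOrder-23-1⁺ : ∀ a b c → c < a → a < b → sameOrder p23-1 a b c ≡ true
sameOrder-23-1⁺ a b c p q rewrite <⇒<ᵇ-true a b q | ≥⇒<ᵇ-false a c (<⇒≤ p) | ≥⇒<ᵇ-false b c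
  (<⇒≤ (<-trans p q)) | ≥⇒<ᵇ-false b a (<⇒≤ q) | <⇒<ᵇ-true c a p | <⇒<ᵇ-true c b
  (<-trans p q) = refl

module Complement (n : ℕ) where
  comp : ℕ → ℕ
  comp x = suc n ∸ x

  complement : List ℕ → List ℕ
  complement = map comp

  comp-< : ∀ x y → InRange n x → y < x → comp x < comp y
  comp-< x y (_ , x≤n) y<x = ∸-monoʳ-< y<x (m≤n⇒m≤1+n x≤n)

  comp-<⁻ : ∀ x y → comp x < comp y → y < x
  comp-<⁻ x y = ∸-cancelʳ-<

  comp-inRange : ∀ x → InRange n x → InRange n (comp x)
  comp-inRange (suc x) (_ , x<n) = m<n⇒0<n∸m x<n , m∸n≤m n x

  comp-involutive : ∀ x → InRange n x → comp (comp x) ≡ x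
  comp-involutive x (_ , x≤n) = m∸[m∸n]≡n (m≤n⇒m≤1+n x≤n)

  comp-injective : ∀ x y → InRange n x → InRange n y → comp x ≡ comp y → x ≡ y
  comp-injective x y x∈ y∈ e = trans (sym (comp-involutive x x∈))
    (trans (cong comp e) (comp-involutive y y∈))

  comp-≡ᵇ : ∀ x y → InRange n x → InRange n y → (comp x ≡ᵇ comp y) ≡ (x ≡ᵇ y)
  comp-≡ᵇ x y x∈ y∈ = bool-ext
    (λ e → subst (λ z → (x ≡ᵇ z) ≡ true) (comp-injective x y x∈ y∈ (≡ᵇ-true⇒≡ _ _ e)) (≡ᵇ-refl x))
    (λ e → subst (λ z → (comp x ≡ᵇ comp z) ≡ true) (≡ᵇ-true⇒≡ x y e) (≡ᵇ-refl (comp x)))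

  sameOrder-comp-1-32 : ∀ a b c → InRange n a → InRange n b → InRange n c →
                        sameOrder p3-12 (comp a) (comp b) (comp c) ≡ sameOrder p1-32 a b c
  sameOrder-comp-1-32 a b c a∈ b∈ c∈ = bool-ext
    (λ e → let (b′<c′ , c′<a′) = sameOrder-3-12⁻ (comp a) (comp b) (comp c) e
           in sameOrder-1-32⁺ a b c (comp-<⁻ c a c′<a′) (comp-<⁻ b c b′<c′))
    (λ e → let (a<c , c<b) = sameOrder-1-32⁻ a b c e
           in sameOrder-3-12⁺ (comp a) (comp b) (comp c) (comp-< b c b∈ c<b) (comp-< c a c∈ a<c))

  sameOrder-comp-21-3 : ∀ a b c → InRange n a → InRange n b → InRange n c →
                        sameOrder p23-1 (comp a) (comp b) (comp c) ≡ sameOrder p21-3 a b c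
  sameOrder-comp-21-3 a b c a∈ b∈ c∈ = bool-ext
    (λ e → let (c′<a′ , a′<b′) = sameOrder-23-1⁻ (comp a) (comp b) (comp c) e
           in sameOrder-21-3⁺ a b c (comp-<⁻ a b a′<b′) (comp-<⁻ c a c′<a′))
    (λ e → let (b<a , a<c) = sameOrder-21-3⁻ a b c e
           in sameOrder-23-1⁺ (comp a) (comp b) (comp c) (comp-< c a c∈ a<c) (comp-< a b a∈ b<a))

  anyᵇ-adjPairs-comp : ∀ a w → InRange n a → All (InRange n) w →
    anyᵇ (λ { (b , c) → sameOrder p3-12 (comp a) b c }) (adjPairs (complement w))
    ≡ anyᵇ (λ { (b , c) → sameOrder p1-32 a b c }) (adjPairs w)
  anyᵇ-adjPairs-comp a [] _ _ = refl
  anyᵇ-adjPairs-comp a (b ∷ []) _ _ = refl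
  anyᵇ-adjPairs-comp a (b ∷ c ∷ w) a∈ (b∈ ∷ c∈ ∷ w∈) =
    cong₂ _∨_ (sameOrder-comp-1-32 a b c a∈ b∈ c∈) (anyᵇ-adjPairs-comp a (c ∷ w) a∈ (c∈ ∷ w∈))

  has3-12-complement : ∀ w → All (InRange n) w → containsX-YZ p3-12 (complement w) ≡ has1-32 w
  has3-12-complement [] _ = refl
  has3-12-complement (a ∷ w) (a∈ ∷ w∈) = cong₂ _∨_ (anyᵇ-adjPairs-comp a w a∈ w∈)
    (has3-12-complement w w∈)

  anyᵇ-comp : ∀ a b w → InRange n a → InRange n b → All (InRange n) w →
    anyᵇ (λ c → sameOrder p23-1 (comp a) (comp b) c) (complement w) ≡ anyᵇ
      (λ c → sameOrder p21-3 a b c) w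
  anyᵇ-comp a b [] _ _ _ = refl
  anyᵇ-comp a b (c ∷ w) a∈ b∈ (c∈ ∷ w∈) = cong₂ _∨_ (sameOrder-comp-21-3 a b c a∈ b∈ c∈)
    (anyᵇ-comp a b w a∈ b∈ w∈)

  has23-1-complement : ∀ w → All (InRange n) w → containsXY-Z p23-1 (complement w) ≡ has21-3 w
  has23-1-complement [] _ = refl
  has23-1-complement (a ∷ []) _ = refl
  has23-1-complement (a ∷ b ∷ w) (a∈ ∷ b∈ ∷ w∈) =
    cong₂ _∨_ (anyᵇ-comp a b w a∈ b∈ w∈) (has23-1-complement (b ∷ w) (b∈ ∷ w∈))

  sumTo-reflect : ∀ (h : ℕ → ℕ) → sumTo h n ≡ sumTo (h ∘ comp) n
  sumTo-reflect h = trans (sumBelow-reverse (h ∘ suc) n)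
    (sumBelow-cong n (λ i i<n → cong h (sym (+-∸-assoc 1 i<n))))

  sumMap-words-complement : ∀ k (g : List ℕ → ℕ) → sumMap g (words n k)
    ≡ sumMap (g ∘ complement) (words n k)
  sumMap-words-complement zero g = refl
  sumMap-words-complement (suc k) g = begin
    sumMap g (words n (suc k))
      ≡⟨ sumMap-words {n} k g ⟩
    sumTo (λ a → sumMap (λ w → g (a ∷ w)) (words n k)) n
      ≡⟨ sumTo-reflect (λ a → sumMap (λ w → g (a ∷ w)) (words n k)) ⟩
    sumTo (λ a → sumMap (λ w → g (comp a ∷ w)) (words n k)) n
      ≡⟨ sumTo-cong n (λ a _ _ → sumMap-words-complement k (λ w → g (comp a ∷ w))) ⟩
    sumTo (λ a → sumMap (λ w → g (complement (a ∷ w))) (words n k)) n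
      ≡⟨ sym (sumMap-words {n} k (g ∘ complement)) ⟩
    sumMap (g ∘ complement) (words n (suc k)) ∎
    where open ≡-Reasoning

  elem-complement : ∀ v w → InRange n v → All (InRange n) w → elem (comp v) (complement w)
    ≡ elem v w
  elem-complement v [] _ _ = refl
  elem-complement v (b ∷ w) v∈ (b∈ ∷ w∈) = cong₂ _∨_ (comp-≡ᵇ b v b∈ v∈) (elem-complement v w v∈ w∈)

  isPerm-complement : ∀ w → All (InRange n) w → isPerm n (complement w) ≡ isPerm n w
  isPerm-complement w w∈ = bool-ext
    (λ e → allᵇ-range⁺ _ n (λ v 1≤v v≤n → let v′∈ = comp-inRange v (1≤v , v≤n) in
      trans (sym (elem-complement v w (1≤v , v≤n) w∈))
        (allᵇ-range⁻ _ n e (comp v) (proj₁ v′∈) (proj₂ v′∈))))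
    (λ e → allᵇ-range⁺ _ n (λ v 1≤v v≤n → let v′∈ = comp-inRange v (1≤v , v≤n) in
      trans (cong (λ z → elem z (complement w)) (sym (comp-involutive v (1≤v , v≤n))))
            (trans (elem-complement (comp v) w v′∈ w∈)
              (allᵇ-range⁻ _ n e (comp v) (proj₁ v′∈) (proj₂ v′∈)))))

countS₂≡countS₁ : ∀ n → countS₂ n ≡ countS₁ n
countS₂≡countS₁ n = begin
  countS₂ n
    ≡⟨ count-filterᵇ (isPerm n) _ (words n n) ⟩
  sumMap (λ w → ind (isS₂ w)) (words n n)
    ≡⟨ sumMap-words-complement n (λ w → ind (isS₂ w)) ⟩
  sumMap (λ w → ind (isS₂ (complement w))) (words n n)
    ≡⟨ sumMap-words-cong n n _ _ complement-swaps ⟩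
  sumMap (λ w → ind (isS₁ w)) (words n n)
    ≡⟨ sym (count-filterᵇ (isPerm n) _ (words n n)) ⟩
  countS₁ n ∎
  where
  open ≡-Reasoning
  open Complement n
  isS₁ isS₂ : List ℕ → Bool
  isS₁ w = isPerm n w ∧ (not (has1-32 w) ∧ not (has21-3 w))
  isS₂ w = isPerm n w ∧ (not (containsX-YZ p3-12 w) ∧ not (containsXY-Z p23-1 w))
  complement-swaps : ∀ w → IsWord n n w → ind (isS₂ (complement w)) ≡ ind (isS₁ w)
  complement-swaps w (_ , w∈) rewrite isPerm-complement w w∈ | has3-12-complement w w∈ | has23-1-complement w w∈ = refl

mainTheorem13 : ((n : ℕ) → countS₁ n ≡ a n)
                  × ((n : ℕ) → countS₂ n ≡ a n)
                  × ((n : ℕ) → (ofℕ a ⊛ (𝟙 ⊖ 𝕩 ⊖ 𝕩 ⊛ 𝕩 ⊛ ofℕ B*)) n ≡ 𝟙 n)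
mainTheorem13 =
  countS₁≡a ,
  (λ n → trans (countS₂≡countS₁ n) (countS₁≡a n)) ,
  recurrence⇒inverse a B* (a≡walks 0) (a≡walks 1) a-recurrence
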